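{- There is an infinite computable graph $G=(V,E)$ such that $G$ has a computable tracing function, $G$ has no chordless 4-paths, and for every set $X\subseteq\mathbb{N}$: if there exists an index $e$ such that $W_e^X$ is infinite and $W_e^X\subseteq V^{\infty}$, then $0'\leq_T X$.
   Context: A graph is a pair $G=(V,E)$ with $V\subseteq\mathbb{N}$ and $E$ a symmetric irreflexive binary relation on $V$. An $n$-path is a sequence of distinct vertices $v_0,\dots,v_{n-1}$ with $E(v_i,v_{i+1})$ for all $i\le n-2$; it is chordless if $E(v_i,v_j)$ holds if and only if $|i-j|=1$. An infinite graph $G$ is traceable if there is a bijection $T:\mathbb{N}\to V$ (a tracing function) with $E(T(i),T(i+1))$ for all $i$. A vertex $x$ has infinite degree if there are infinitely many $y$ with $E(x,y)$; $V^{\infty}$ denotes the set of vertices of infinite degree. $W_e^X$ is the $e$-th set computably enumerable relative to $X$, and $0'$ is the halting problem. -}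

module Defs where

open import Data.Nat using (ℕ; zero; suc; _+_; _*_; _≤_; _<_)
open import Data.Nat.DivMod using (_/_)
open import Data.Fin using (Fin; toℕ)
open import Data.Vec using (Vec; []; _∷_; lookup)
open import Data.Bool using (Bool; true; false; if_then_else_)
open import Data.Product using (Σ; ∃; _×_; _,_)
open import Data.Empty using (⊥)
open import Relation.Nullary using (¬_)
open import Relation.Binary.PropositionalEquality using (_≡_; _≢_)

Oracle : Set
Oracle = ℕ → Bool

∅ : Oracle
∅ _ = false

-- Codes of partial recursive functionals (μ-recursive, with an oracle
-- query primitive), indexed by arity.

data Code : ℕ → Set where
  Z    : ∀ {n} → Code n
  S    : Code 1
  O    : Code 1
  P    : ∀ {n} → Fin n → Code n
  comp : ∀ {m n} → Code m → Vec (Code n) m → Code n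
  prec : ∀ {n} → Code n → Code (suc (suc n)) → Code (suc n)
  mu   : ∀ {n} → Code (suc n) → Code n

-- Big-step semantics: Eval X c xs y  means  Φ_c^X(xs)↓ = y.
mutual
  data Eval (X : Oracle) : ∀ {n} → Code n → Vec ℕ n → ℕ → Set where
    ev-Z    : ∀ {n} {xs : Vec ℕ n} → Eval X Z xs 0
    ev-S    : ∀ {x} → Eval X S (x ∷ []) (suc x)
    ev-O    : ∀ {x} → Eval X O (x ∷ []) (if X x then 1 else 0)
    ev-P    : ∀ {n} {xs : Vec ℕ n} (i : Fin n) → Eval X (P i) xs (lookup xs i)
    ev-comp : ∀ {m n} {f : Code m} {gs : Vec (Code n) m} {xs ys y} →
              EvalVec X gs xs ys → Eval X f ys y → Eval X (comp f gs) xs y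
    ev-prec0 : ∀ {n} {f : Code n} {g : Code (suc (suc n))} {xs y} →
               Eval X f xs y → Eval X (prec f g) (0 ∷ xs) y
    ev-precS : ∀ {n} {f : Code n} {g : Code (suc (suc n))} {xs k z y} →
               Eval X (prec f g) (k ∷ xs) z → Eval X g (k ∷ z ∷ xs) y →
               Eval X (prec f g) (suc k ∷ xs) y
    ev-mu   : ∀ {n} {f : Code (suc n)} {xs y} →
              Search X f xs 0 y → Eval X (mu f) xs y

  data EvalVec (X : Oracle) : ∀ {m n} → Vec (Code n) m → Vec ℕ n → Vec ℕ m → Set where
    ev-[] : ∀ {n} {xs : Vec ℕ n} → EvalVec X [] xs []
    ev-∷  : ∀ {m n} {g : Code n} {gs : Vec (Code n) m} {xs y ys} →
            Eval X g xs y → EvalVec X gs xs ys → EvalVec X (g ∷ gs) xs (y ∷ ys)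

  data Search (X : Oracle) {n} (f : Code (suc n)) (xs : Vec ℕ n) : ℕ → ℕ → Set where
    found : ∀ {z} → Eval X f (z ∷ xs) 0 → Search X f xs z z
    next  : ∀ {z k y} → Eval X f (z ∷ xs) (suc k) → Search X f xs (suc z) y →
            Search X f xs z y

⟨_,_⟩ : ℕ → ℕ → ℕ
⟨ a , b ⟩ = ((a + b) * suc (a + b)) / 2 + b

mutual
  encode : ∀ {n} → Code n → ℕ
  encode Z = ⟨ 0 , 0 ⟩
  encode S = ⟨ 1 , 0 ⟩
  encode O = ⟨ 2 , 0 ⟩
  encode (P i) = ⟨ 3 , toℕ i ⟩
  encode (comp {m} f gs) = ⟨ 4 , ⟨ m , ⟨ encode f , encodeVec gs ⟩ ⟩ ⟩
  encode (prec f g) = ⟨ 5 , ⟨ encode f , encode g ⟩ ⟩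
  encode (mu f) = ⟨ 6 , encode f ⟩

  encodeVec : ∀ {m n} → Vec (Code n) m → ℕ
  encodeVec [] = 0
  encodeVec (g ∷ gs) = suc ⟨ encode g , encodeVec gs ⟩

W : Code 1 → Oracle → ℕ → Set
W c X m = ∃ λ y → Eval X c (m ∷ []) y

Halting : ℕ → Set
Halting m = Σ (Code 1) λ c → encode c ≡ m × W c ∅ m

_≤T_ : (ℕ → Set) → Oracle → Set
A ≤T X = Σ (Code 1) λ c →
  ∀ m → (A m → Eval X c (m ∷ []) 1) × (¬ A m → Eval X c (m ∷ []) 0)

χ : Bool → ℕ
χ true = 1
χ false = 0

ComputableFun : (ℕ → ℕ) → Set
ComputableFun f = Σ (Code 1) λ c → ∀ n → Eval ∅ c (n ∷ []) (f n)

ComputableSet : (ℕ → Bool) → Set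
ComputableSet V = Σ (Code 1) λ c → ∀ n → Eval ∅ c (n ∷ []) (χ (V n))

ComputableRel : (ℕ → ℕ → Bool) → Set
ComputableRel E = Σ (Code 2) λ c → ∀ n m → Eval ∅ c (n ∷ m ∷ []) (χ (E n m))

Infinite : (ℕ → Set) → Set
Infinite A = ∀ n → ∃ λ m → n ≤ m × A m

record Graph : Set where
  field
    V : ℕ → Bool
    E : ℕ → ℕ → Bool
    E-sym   : ∀ x y → E x y ≡ true → E y x ≡ true
    E-irr   : ∀ x → E x x ≡ false
    E-inV   : ∀ x y → E x y ≡ true → V x ≡ true × V y ≡ true
open Graph public

ComputableGraph : Graph → Set
ComputableGraph G = ComputableSet (V G) × ComputableRel (E G)

InfiniteGraph : Graph → Set
InfiniteGraph G = Infinite (λ x → V G x ≡ true)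

IsTracing : Graph → (ℕ → ℕ) → Set
IsTracing G T =
  (∀ i → V G (T i) ≡ true) ×
  (∀ i j → T i ≡ T j → i ≡ j) ×
  (∀ v → V G v ≡ true → ∃ λ i → T i ≡ v) ×
  (∀ i → E G (T i) (T (suc i)) ≡ true)

Chordless4Path : Graph → ℕ → ℕ → ℕ → ℕ → Set
Chordless4Path G v0 v1 v2 v3 =
  v0 ≢ v1 × v0 ≢ v2 × v0 ≢ v3 × v1 ≢ v2 × v1 ≢ v3 × v2 ≢ v3 ×
  E G v0 v1 ≡ true × E G v1 v2 ≡ true × E G v2 v3 ≡ true ×
  E G v0 v2 ≡ false × E G v1 v3 ≡ false × E G v0 v3 ≡ false

NoChordless4Paths : Graph → Set
NoChordless4Paths G = ∀ v0 v1 v2 v3 → ¬ Chordless4Path G v0 v1 v2 v3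

InfDeg : Graph → ℕ → Set
InfDeg G x = V G x ≡ true × Infinite (λ y → E G x y ≡ true)

-- Enumerate 0′ in stages and let a marker move right by one at each stage, except that when
-- some m below it enters 0′ it drops back to m + 1 (for the least such m); pos t is its position
-- after stage t. Join x and y when the minimum of pos on the closed interval between them is
-- attained at x or y. Consecutive vertices are joined, so the identity traces the graph; and as
-- the interval from x to z is covered by the intervals from x to y and from y to z, interval
-- minima compose, which rules out chordless paths on four vertices. If pos s ≤ pos w for some
-- s > w, then the neighbours of w beyond s are all interval minima reaching back to w; their
-- positions strictly decrease, each marking a different entry into 0′, so w has finite degree.
-- Hence a vertex w of infinite degree has pos w < pos s for all s > w, so no m < pos w enters 0′
-- after stage w. Given an infinite W_e^X of such vertices, X searches for one with pos w > m and
-- reads off m ∈ 0′. Computability is shown through an expression language compiled to codes,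
-- with 0′ and W_e^X put in Σ⁰₁ form by checkable computation certificates.

module Submission where

open import Defs
open import Data.Nat
open import Data.Nat.Properties
open import Data.Nat.DivMod using (_/_; +-distrib-/-∣ʳ; m*n/n≡m)
open import Data.Nat.Divisibility using (divides)
open import Data.Nat.Tactic.RingSolver using (solve-∀)
open import Data.Bool using (Bool; true; false; if_then_else_; _∧_; _∨_; not)
open import Data.Bool.Properties using (∨-zeroʳ)
open import Data.Fin using (Fin; zero; suc; toℕ; fromℕ<)
open import Data.Fin.Properties using (toℕ-fromℕ<; toℕ<n)
open import Data.Vec using (Vec; []; _∷_; lookup; tabulate; head)
open import Data.Vec.Properties using (tabulate∘lookup)
open import Data.List using (List; []; _∷_; length; _++_; [_])
open import Data.List.Properties using (length-++; length-++-≤ˡ)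
open import Data.Product using (Σ; _×_; _,_; proj₁; proj₂)
open import Data.Sum using (_⊎_; inj₁; inj₂; [_,_]′; swap)
open import Function.Base using (_∘_)
open import Data.Empty using (⊥; ⊥-elim)
open import Relation.Nullary using (¬_; yes; no; Dec; contradiction)
open import Relation.Nullary.Decidable using (_⊎-dec_; _×-dec_)
open import Function.Bundles using (_⇔_; mk⇔; Equivalence)
open Equivalence using (to; from)
open import Function.Construct.Composition using (_⇔-∘_)
open import Function.Construct.Symmetry using (⇔-sym)
open import Data.Product.Function.NonDependent.Propositional using (_×-⇔_)
open import Data.Sum.Function.Propositional using (_⊎-⇔_)
open import Relation.Binary.Definitions using (tri<; tri≈; tri>)
open import Relation.Binary.PropositionalEquality hiding ([_])

-- Codes for elementary arithmetic

nonzero : ℕ → Bool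
nonzero zero = false
nonzero (suc _) = true

ev-prec-iterate : ∀ {X n} {cz : Code n} {cs : Code (suc (suc n))} {xs : Vec ℕ n} (F : ℕ → ℕ) →
  Eval X cz xs (F 0) → (∀ k → Eval X cs (k ∷ F k ∷ xs) (F (suc k))) →
  ∀ k → Eval X (prec cz cs) (k ∷ xs) (F k)
ev-prec-iterate F z s zero = ev-prec0 z
ev-prec-iterate F z s (suc k) = ev-precS (ev-prec-iterate F z s k) (s k)

ev-projections : ∀ {X m n} (ρ : Fin m → Fin n) (xs : Vec ℕ n) →
  EvalVec X (tabulate (λ i → P (ρ i))) xs (tabulate (λ i → lookup xs (ρ i)))
ev-projections {m = zero} ρ xs = ev-[]
ev-projections {m = suc m} ρ xs = ev-∷ (ev-P (ρ zero)) (ev-projections (λ i → ρ (suc i)) xs)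

projections : ∀ {n} → Vec (Code n) n
projections = tabulate P

projections₂ : ∀ {n} → Vec (Code (suc (suc n))) n
projections₂ = tabulate (λ i → P (suc (suc i)))

ev-projections-id : ∀ {X n} (xs : Vec ℕ n) → EvalVec X projections xs xs
ev-projections-id {X} xs = subst (EvalVec X projections xs) (tabulate∘lookup xs) (ev-projections (λ i → i) xs)

ev-projections₂ : ∀ {X n} a b (xs : Vec ℕ n) → EvalVec X projections₂ (a ∷ b ∷ xs) xs
ev-projections₂ {X} a b xs = subst (EvalVec X projections₂ (a ∷ b ∷ xs)) (tabulate∘lookup xs)
  (ev-projections (λ i → suc (suc i)) (a ∷ b ∷ xs))

ev-comp₁ : ∀ {X n} {c : Code 1} {g : Code n} {xs x y} → Eval X g xs x → Eval X c (x ∷ []) y →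
  Eval X (comp c (g ∷ [])) xs y
ev-comp₁ g c = ev-comp (ev-∷ g ev-[]) c

ev-comp₂ : ∀ {X n} {c : Code 2} {g h : Code n} {xs x x' y} → Eval X g xs x → Eval X h xs x' →
  Eval X c (x ∷ x' ∷ []) y → Eval X (comp c (g ∷ h ∷ [])) xs y
ev-comp₂ g h c = ev-comp (ev-∷ g (ev-∷ h ev-[])) c

ev-comp₃ : ∀ {X n} {c : Code 3} {g h k : Code n} {xs x x' x'' y} → Eval X g xs x → Eval X h xs x' →
  Eval X k xs x'' → Eval X c (x ∷ x' ∷ x'' ∷ []) y → Eval X (comp c (g ∷ h ∷ k ∷ [])) xs y
ev-comp₃ g h k c = ev-comp (ev-∷ g (ev-∷ h (ev-∷ k ev-[]))) c

oneC : ∀ {n} → Code n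
oneC = comp S (Z ∷ [])

ev-one : ∀ {X n} {xs : Vec ℕ n} → Eval X oneC xs 1
ev-one = ev-comp₁ ev-Z ev-S

addC : Code 2
addC = prec (P zero) (comp S (P (suc zero) ∷ []))

ev-add : ∀ {X} k y → Eval X addC (k ∷ y ∷ []) (k + y)
ev-add {X} k y = ev-prec-iterate (λ k → k + y) (ev-P zero) (λ k → ev-comp₁ (ev-P (suc zero)) ev-S) k

mulC : Code 2
mulC = prec Z (comp addC (P (suc (suc zero)) ∷ P (suc zero) ∷ []))

ev-mul : ∀ {X} k y → Eval X mulC (k ∷ y ∷ []) (k * y)
ev-mul k y = ev-prec-iterate (λ k → k * y) ev-Z
  (λ k → ev-comp₂ (ev-P (suc (suc zero))) (ev-P (suc zero)) (ev-add y (k * y))) k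

predC : Code 1
predC = prec Z (P zero)

ev-pred : ∀ {X} k → Eval X predC (k ∷ []) (pred k)
ev-pred k = ev-prec-iterate pred ev-Z (λ k → ev-P zero) k

subC : Code 2
subC = prec (P zero) (comp predC (P (suc zero) ∷ []))

ev-sub : ∀ {X} k x → Eval X subC (k ∷ x ∷ []) (x ∸ k)
ev-sub {X} k x = ev-prec-iterate (λ k → x ∸ k) (ev-P zero)
  (λ k → subst (Eval X (comp predC (P (suc zero) ∷ [])) (k ∷ x ∸ k ∷ x ∷ []))
     (pred[m∸n]≡m∸[1+n] x k) (ev-comp₁ (ev-P (suc zero)) (ev-pred (x ∸ k)))) k

monC : Code 2
monC = comp subC (P (suc zero) ∷ P zero ∷ [])

ev-mon : ∀ {X} x y → Eval X monC (x ∷ y ∷ []) (x ∸ y)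
ev-mon x y = ev-comp₂ (ev-P (suc zero)) (ev-P zero) (ev-sub y x)

sgC : Code 1
sgC = prec Z (comp S (Z ∷ []))

ev-sg : ∀ {X} k → Eval X sgC (k ∷ []) (χ (nonzero k))
ev-sg k = ev-prec-iterate (λ k → χ (nonzero k)) ev-Z (λ k → ev-comp₁ ev-Z ev-S) k

nsgC : Code 1
nsgC = prec oneC Z

ev-nsg : ∀ {X} k → Eval X nsgC (k ∷ []) (χ (not (nonzero k)))
ev-nsg k = ev-prec-iterate (λ k → χ (not (nonzero k))) ev-one (λ k → ev-Z) k

not-nonzero-distance : ∀ x y → not (nonzero ((x ∸ y) + (y ∸ x))) ≡ (x ≡ᵇ y)
not-nonzero-distance zero zero = refl
not-nonzero-distance zero (suc y) = refl
not-nonzero-distance (suc x) zero = refl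
not-nonzero-distance (suc x) (suc y) = not-nonzero-distance x y

eqC : Code 2
eqC = comp nsgC (comp addC (monC ∷ comp monC (P (suc zero) ∷ P zero ∷ []) ∷ []) ∷ [])

ev-eq : ∀ {X} x y → Eval X eqC (x ∷ y ∷ []) (χ (x ≡ᵇ y))
ev-eq {X} x y = subst (λ b → Eval X eqC (x ∷ y ∷ []) (χ b)) (not-nonzero-distance x y)
  (ev-comp₁ (ev-comp₂ (ev-mon x y) (ev-comp₂ (ev-P (suc zero)) (ev-P zero) (ev-mon y x)) (ev-add (x ∸ y) (y ∸ x)))
       (ev-nsg ((x ∸ y) + (y ∸ x))))

nonzero-monus : ∀ x y → nonzero (y ∸ x) ≡ (x <ᵇ y)
nonzero-monus zero zero = refl
nonzero-monus zero (suc y) = refl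
nonzero-monus (suc x) zero = refl
nonzero-monus (suc x) (suc y) = nonzero-monus x y

ltC : Code 2
ltC = comp sgC (comp monC (P (suc zero) ∷ P zero ∷ []) ∷ [])

ev-lt : ∀ {X} x y → Eval X ltC (x ∷ y ∷ []) (χ (x <ᵇ y))
ev-lt {X} x y = subst (λ b → Eval X ltC (x ∷ y ∷ []) (χ b)) (nonzero-monus x y)
  (ev-comp₁ (ev-comp₂ (ev-P (suc zero)) (ev-P zero) (ev-mon y x)) (ev-sg (y ∸ x)))

nonzero-*-zeroʳ : ∀ a → nonzero (a * 0) ≡ false
nonzero-*-zeroʳ zero = refl
nonzero-*-zeroʳ (suc a) = nonzero-*-zeroʳ a

nonzero-* : ∀ a b → nonzero (a * b) ≡ (nonzero a ∧ nonzero b)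
nonzero-* zero b = refl
nonzero-* (suc a) zero = nonzero-*-zeroʳ a
nonzero-* (suc a) (suc b) = refl

andC : Code 2
andC = comp sgC (mulC ∷ [])

ev-and : ∀ {X} a b → Eval X andC (a ∷ b ∷ []) (χ (nonzero a ∧ nonzero b))
ev-and {X} a b = subst (λ t → Eval X andC (a ∷ b ∷ []) (χ t)) (nonzero-* a b)
  (ev-comp₁ (ev-mul a b) (ev-sg (a * b)))

nonzero-+ : ∀ a b → nonzero (a + b) ≡ (nonzero a ∨ nonzero b)
nonzero-+ zero b = refl
nonzero-+ (suc a) b = refl

orC : Code 2
orC = comp sgC (addC ∷ [])

ev-or : ∀ {X} a b → Eval X orC (a ∷ b ∷ []) (χ (nonzero a ∨ nonzero b))
ev-or {X} a b = subst (λ t → Eval X orC (a ∷ b ∷ []) (χ t)) (nonzero-+ a b)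
  (ev-comp₁ (ev-add a b) (ev-sg (a + b)))

notC : Code 1
notC = nsgC

select≡if : ∀ c a b → χ (nonzero c) * a + χ (not (nonzero c)) * b ≡ (if nonzero c then a else b)
select≡if zero a b = +-identityʳ b
select≡if (suc c) a b = trans (+-identityʳ (a + 0)) (+-identityʳ a)

iteC : Code 3
iteC = comp addC (comp mulC (comp sgC (P zero ∷ []) ∷ P (suc zero) ∷ []) ∷
                  comp mulC (comp nsgC (P zero ∷ []) ∷ P (suc (suc zero)) ∷ []) ∷ [])

ev-ite : ∀ {X} c a b → Eval X iteC (c ∷ a ∷ b ∷ []) (if nonzero c then a else b)
ev-ite {X} c a b = subst (Eval X iteC (c ∷ a ∷ b ∷ [])) (select≡if c a b)
  (ev-comp₂ (ev-comp₂ (ev-comp₁ (ev-P zero) (ev-sg c)) (ev-P (suc zero)) (ev-mul _ a))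
       (ev-comp₂ (ev-comp₁ (ev-P zero) (ev-nsg c)) (ev-P (suc (suc zero))) (ev-mul _ b))
       (ev-add _ _))

triangle : ℕ → ℕ
triangle s = (s * suc s) / 2

triangle-suc : ∀ k → triangle (suc k) ≡ triangle k + suc k
triangle-suc k = begin
    (suc k * suc (suc k)) / 2 ≡⟨ cong (_/ 2) (e k) ⟩
    (k * suc k + suc k * 2) / 2 ≡⟨ +-distrib-/-∣ʳ (k * suc k) (divides (suc k) refl) ⟩
    (k * suc k) / 2 + (suc k * 2) / 2 ≡⟨ cong ((k * suc k) / 2 +_) (m*n/n≡m (suc k) 2) ⟩
    triangle k + suc k ∎
  where
  open ≡-Reasoning
  e : ∀ k → suc k * suc (suc k) ≡ k * suc k + suc k * 2
  e = solve-∀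

triangleC : Code 1
triangleC = prec Z (comp addC (P (suc zero) ∷ comp S (P zero ∷ []) ∷ []))

ev-triangle : ∀ {X} k → Eval X triangleC (k ∷ []) (triangle k)
ev-triangle {X} k = ev-prec-iterate triangle ev-Z
  (λ k → subst (Eval X _ (k ∷ triangle k ∷ [])) (sym (triangle-suc k))
     (ev-comp₂ (ev-P (suc zero)) (ev-comp₁ (ev-P zero) ev-S) (ev-add (triangle k) (suc k)))) k

pairC : Code 2
pairC = comp addC (comp triangleC (addC ∷ []) ∷ P (suc zero) ∷ [])

ev-pair : ∀ {X} a b → Eval X pairC (a ∷ b ∷ []) ⟨ a , b ⟩
ev-pair a b = ev-comp₂ (ev-comp₁ (ev-add a b) (ev-triangle (a + b))) (ev-P (suc zero)) (ev-add _ b)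

-- An expression language compiled to codes

infixl 6 _⊕_ _⊝_
infixl 7 _⊛_
infix 4 _≐_ _≺_
infixr 3 _∧ₑ_
infixr 2 _∨ₑ_

data Expr (n : ℕ) : Set where
  v : Fin n → Expr n
  lit : ℕ → Expr n
  _⊕_ _⊝_ _⊛_ _≐_ _≺_ _∧ₑ_ _∨ₑ_ ⟪_,_⟫ : Expr n → Expr n → Expr n
  ¬ₑ : Expr n → Expr n
  ifₑ : Expr n → Expr n → Expr n → Expr n
  query : Expr n → Expr n
  letₑ : Expr n → Expr (suc n) → Expr n
  recₑ : Expr n → Expr n → Expr (suc (suc n)) → Expr n
  exₑ allₑ mnₑ : Expr n → Expr (suc n) → Expr n
  app : ∀ {m} → Expr m → Vec (Expr n) m → Expr n
  prim : ∀ {m} (c : Code m) (f : Vec ℕ m → ℕ) → (∀ X xs → Eval X c xs (f xs)) → Vec (Expr n) m → Expr n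

primRec : ℕ → ℕ → (ℕ → ℕ → ℕ) → ℕ
primRec zero z s = z
primRec (suc k) z s = s k (primRec k z s)

anyBelow : ℕ → (ℕ → ℕ) → ℕ
anyBelow zero f = 0
anyBelow (suc k) f = χ (nonzero (anyBelow k f) ∨ nonzero (f k))

allBelow : ℕ → (ℕ → ℕ) → ℕ
allBelow zero f = 1
allBelow (suc k) f = χ (nonzero (allBelow k f) ∧ nonzero (f k))

minBelow : ℕ → (ℕ → ℕ) → ℕ
minBelow zero f = 0
minBelow (suc k) f = if nonzero (χ (minBelow k f <ᵇ k)) then minBelow k f else (if nonzero (f k) then k else suc k)

⟦_⟧ : ∀ {n} → Expr n → Oracle → Vec ℕ n → ℕ
⟦_⟧* : ∀ {n m} → Vec (Expr n) m → Oracle → Vec ℕ n → Vec ℕ m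
⟦ [] ⟧* X xs = []
⟦ e ∷ es ⟧* X xs = ⟦ e ⟧ X xs ∷ ⟦ es ⟧* X xs
⟦ v i ⟧ X xs = lookup xs i
⟦ lit c ⟧ X xs = c
⟦ a ⊕ b ⟧ X xs = ⟦ a ⟧ X xs + ⟦ b ⟧ X xs
⟦ a ⊝ b ⟧ X xs = ⟦ a ⟧ X xs ∸ ⟦ b ⟧ X xs
⟦ a ⊛ b ⟧ X xs = ⟦ a ⟧ X xs * ⟦ b ⟧ X xs
⟦ a ≐ b ⟧ X xs = χ (⟦ a ⟧ X xs ≡ᵇ ⟦ b ⟧ X xs)
⟦ a ≺ b ⟧ X xs = χ (⟦ a ⟧ X xs <ᵇ ⟦ b ⟧ X xs)
⟦ a ∧ₑ b ⟧ X xs = χ (nonzero (⟦ a ⟧ X xs) ∧ nonzero (⟦ b ⟧ X xs))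
⟦ a ∨ₑ b ⟧ X xs = χ (nonzero (⟦ a ⟧ X xs) ∨ nonzero (⟦ b ⟧ X xs))
⟦ ⟪ a , b ⟫ ⟧ X xs = ⟨ ⟦ a ⟧ X xs , ⟦ b ⟧ X xs ⟩
⟦ ¬ₑ a ⟧ X xs = χ (not (nonzero (⟦ a ⟧ X xs)))
⟦ ifₑ c a b ⟧ X xs = if nonzero (⟦ c ⟧ X xs) then ⟦ a ⟧ X xs else ⟦ b ⟧ X xs
⟦ query a ⟧ X xs = if X (⟦ a ⟧ X xs) then 1 else 0
⟦ letₑ a b ⟧ X xs = ⟦ b ⟧ X (⟦ a ⟧ X xs ∷ xs)
⟦ recₑ b z s ⟧ X xs = primRec (⟦ b ⟧ X xs) (⟦ z ⟧ X xs) (λ k a → ⟦ s ⟧ X (k ∷ a ∷ xs))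
⟦ exₑ b f ⟧ X xs = anyBelow (⟦ b ⟧ X xs) (λ i → ⟦ f ⟧ X (i ∷ xs))
⟦ allₑ b f ⟧ X xs = allBelow (⟦ b ⟧ X xs) (λ i → ⟦ f ⟧ X (i ∷ xs))
⟦ mnₑ b f ⟧ X xs = minBelow (⟦ b ⟧ X xs) (λ i → ⟦ f ⟧ X (i ∷ xs))
⟦ app f as ⟧ X xs = ⟦ f ⟧ X (⟦ as ⟧* X xs)
⟦ prim c f pf as ⟧ X xs = f (⟦ as ⟧* X xs)

constC : ∀ {n} → ℕ → Code n
constC zero = Z
constC (suc c) = comp S (constC c ∷ [])

ev-const : ∀ {X n} {xs : Vec ℕ n} c → Eval X (constC c) xs c
ev-const zero = ev-Z
ev-const (suc c) = ev-comp₁ (ev-const c) ev-S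

binaryC : ∀ {n} → Code 2 → Code n → Code n → Code n
binaryC c a b = comp c (a ∷ b ∷ [])

dropSecondC : ∀ {n} → Code (suc n) → Code (suc (suc n))
dropSecondC f = comp f (P zero ∷ projections₂)

compile : ∀ {n} → Expr n → Code n
compile* : ∀ {n m} → Vec (Expr n) m → Vec (Code n) m
compile* [] = []
compile* (e ∷ es) = compile e ∷ compile* es
compile (app f as) = comp (compile f) (compile* as)
compile (prim c f pf as) = comp c (compile* as)
compile (v i) = P i
compile (lit c) = constC c
compile (a ⊕ b) = binaryC addC (compile a) (compile b)
compile (a ⊝ b) = binaryC monC (compile a) (compile b)
compile (a ⊛ b) = binaryC mulC (compile a) (compile b)
compile (a ≐ b) = binaryC eqC (compile a) (compile b)
compile (a ≺ b) = binaryC ltC (compile a) (compile b)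
compile (a ∧ₑ b) = binaryC andC (compile a) (compile b)
compile (a ∨ₑ b) = binaryC orC (compile a) (compile b)
compile ⟪ a , b ⟫ = binaryC pairC (compile a) (compile b)
compile (¬ₑ a) = comp notC (compile a ∷ [])
compile (ifₑ c a b) = comp iteC (compile c ∷ compile a ∷ compile b ∷ [])
compile (query a) = comp O (compile a ∷ [])
compile (letₑ a b) = comp (compile b) (compile a ∷ projections)
compile (recₑ b z s) = comp (prec (compile z) (compile s)) (compile b ∷ projections)
compile (exₑ b f) = comp (prec Z (binaryC orC (P (suc zero)) (dropSecondC (compile f)))) (compile b ∷ projections)
compile (allₑ b f) = comp (prec oneC (binaryC andC (P (suc zero)) (dropSecondC (compile f)))) (compile b ∷ projections)
compile (mnₑ b f) = comp (prec Z (comp iteC (binaryC ltC (P (suc zero)) (P zero) ∷ P (suc zero) ∷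
   comp iteC (dropSecondC (compile f) ∷ P zero ∷ comp S (P zero ∷ []) ∷ []) ∷ []))) (compile b ∷ projections)

ev-dropSecond : ∀ {X n} {f : Code (suc n)} {i a xs y} → Eval X f (i ∷ xs) y → Eval X (dropSecondC f) (i ∷ a ∷ xs) y
ev-dropSecond {i = i} {a} {xs} e = ev-comp (ev-∷ (ev-P zero) (ev-projections₂ i a xs)) e

ev-iterate : ∀ {X n} {b : Code n} {cz : Code n} {cs : Code (suc (suc n))} {xs : Vec ℕ n} {k} (F : ℕ → ℕ) →
  Eval X b xs k → Eval X cz xs (F 0) → (∀ k → Eval X cs (k ∷ F k ∷ xs) (F (suc k))) →
  Eval X (comp (prec cz cs) (b ∷ projections)) xs (F k)
ev-iterate {xs = xs} F eb ez es = ev-comp (ev-∷ eb (ev-projections-id xs)) (ev-prec-iterate F ez es _)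

correct : ∀ {n} (e : Expr n) X (xs : Vec ℕ n) → Eval X (compile e) xs (⟦ e ⟧ X xs)
correct* : ∀ {n m} (es : Vec (Expr n) m) X (xs : Vec ℕ n) → EvalVec X (compile* es) xs (⟦ es ⟧* X xs)
correct* [] X xs = ev-[]
correct* (e ∷ es) X xs = ev-∷ (correct e X xs) (correct* es X xs)
correct (app f as) X xs = ev-comp (correct* as X xs) (correct f X _)
correct (prim c f pf as) X xs = ev-comp (correct* as X xs) (pf X _)
correct (v i) X xs = ev-P i
correct (lit c) X xs = ev-const c
correct (a ⊕ b) X xs = ev-comp₂ (correct a X xs) (correct b X xs) (ev-add _ _)
correct (a ⊝ b) X xs = ev-comp₂ (correct a X xs) (correct b X xs) (ev-mon _ _)
correct (a ⊛ b) X xs = ev-comp₂ (correct a X xs) (correct b X xs) (ev-mul _ _)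
correct (a ≐ b) X xs = ev-comp₂ (correct a X xs) (correct b X xs) (ev-eq _ _)
correct (a ≺ b) X xs = ev-comp₂ (correct a X xs) (correct b X xs) (ev-lt _ _)
correct (a ∧ₑ b) X xs = ev-comp₂ (correct a X xs) (correct b X xs) (ev-and _ _)
correct (a ∨ₑ b) X xs = ev-comp₂ (correct a X xs) (correct b X xs) (ev-or _ _)
correct ⟪ a , b ⟫ X xs = ev-comp₂ (correct a X xs) (correct b X xs) (ev-pair _ _)
correct (¬ₑ a) X xs = ev-comp₁ (correct a X xs) (ev-nsg _)
correct (ifₑ c a b) X xs = ev-comp₃ (correct c X xs) (correct a X xs) (correct b X xs) (ev-ite _ _ _)
correct (query a) X xs = ev-comp₁ (correct a X xs) ev-O
correct (letₑ a b) X xs = ev-comp (ev-∷ (correct a X xs) (ev-projections-id xs)) (correct b X _)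
correct (recₑ b z s) X xs = ev-iterate (λ k → primRec k (⟦ z ⟧ X xs) (λ k a → ⟦ s ⟧ X (k ∷ a ∷ xs)))
  (correct b X xs) (correct z X xs) (λ k → correct s X _)
correct (exₑ b f) X xs = ev-iterate (λ k → anyBelow k (λ i → ⟦ f ⟧ X (i ∷ xs)))
  (correct b X xs) ev-Z (λ k → ev-comp₂ (ev-P (suc zero)) (ev-dropSecond (correct f X _)) (ev-or _ _))
correct (allₑ b f) X xs = ev-iterate (λ k → allBelow k (λ i → ⟦ f ⟧ X (i ∷ xs)))
  (correct b X xs) ev-one (λ k → ev-comp₂ (ev-P (suc zero)) (ev-dropSecond (correct f X _)) (ev-and _ _))
correct (mnₑ b f) X xs = ev-iterate (λ k → minBelow k (λ i → ⟦ f ⟧ X (i ∷ xs)))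
  (correct b X xs) ev-Z
  (λ k → ev-comp₃ (ev-comp₂ (ev-P (suc zero)) (ev-P zero) (ev-lt _ _)) (ev-P (suc zero))
              (ev-comp₃ (ev-dropSecond (correct f X _)) (ev-P zero) (ev-comp₁ (ev-P zero) ev-S) (ev-ite _ _ _))
              (ev-ite _ _ _))

-- Bounded search and Cantor unpairing

nonzero-χ : ∀ b → nonzero (χ b) ≡ b
nonzero-χ true = refl
nonzero-χ false = refl

<ᵇ-refl : ∀ n → (n <ᵇ n) ≡ false
<ᵇ-refl zero = refl
<ᵇ-refl (suc n) = <ᵇ-refl n

<⇒<ᵇ≡true : ∀ {m n} → m < n → (m <ᵇ n) ≡ true
<⇒<ᵇ≡true {zero} {suc n} _ = refl
<⇒<ᵇ≡true {suc m} {suc n} (s≤s p) = <⇒<ᵇ≡true p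

<ᵇ≡true⇒< : ∀ m n → (m <ᵇ n) ≡ true → m < n
<ᵇ≡true⇒< zero (suc n) _ = s≤s z≤n
<ᵇ≡true⇒< (suc m) (suc n) p = s≤s (<ᵇ≡true⇒< m n p)

≡ᵇ≡true⇒≡ : ∀ {m n} → (m ≡ᵇ n) ≡ true → m ≡ n
≡ᵇ≡true⇒≡ {m} {n} p = ≡ᵇ⇒≡ m n (subst Data.Bool.T (sym p) _)

≡ᵇ-refl : ∀ n → (n ≡ᵇ n) ≡ true
≡ᵇ-refl zero = refl
≡ᵇ-refl (suc n) = ≡ᵇ-refl n

≢⇒≡ᵇ≡false : ∀ {m n} → m ≢ n → (m ≡ᵇ n) ≡ false
≢⇒≡ᵇ≡false {zero} {zero} ne = ⊥-elim (ne refl)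
≢⇒≡ᵇ≡false {zero} {suc n} ne = refl
≢⇒≡ᵇ≡false {suc m} {zero} ne = refl
≢⇒≡ᵇ≡false {suc m} {suc n} ne = ≢⇒≡ᵇ≡false (λ e → ne (cong suc e))

false≢true : false ≡ true → ⊥
false≢true ()

minBelow-none : ∀ (f : ℕ → ℕ) a → (∀ i → i < a → nonzero (f i) ≡ false) → ∀ k → k ≤ a → minBelow k f ≡ k
minBelow-none f a none zero _ = refl
minBelow-none f a none (suc k) k<a rewrite minBelow-none f a none k (≤-trans (n≤1+n k) k<a)
  | <ᵇ-refl k | none k k<a = refl

minBelow-least : ∀ (f : ℕ → ℕ) a → nonzero (f a) ≡ true → (∀ i → i < a → nonzero (f i) ≡ false) →
  ∀ k → a < k → minBelow k f ≡ a
minBelow-least f a fa none (suc k) (s≤s a≤k) with m≤n⇒m<n∨m≡n a≤k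
... | inj₁ a<k rewrite minBelow-least f a fa none k a<k | <⇒<ᵇ≡true a<k = refl
... | inj₂ refl rewrite minBelow-none f a none a ≤-refl | <ᵇ-refl a | fa = refl

anyBelow-intro : ∀ (f : ℕ → ℕ) i k → i < k → nonzero (f i) ≡ true → nonzero (anyBelow k f) ≡ true
anyBelow-intro f i (suc k) (s≤s i≤k) fi with m≤n⇒m<n∨m≡n i≤k
... | inj₁ i<k rewrite nonzero-χ (nonzero (anyBelow k f) ∨ nonzero (f k)) | anyBelow-intro f i k i<k fi = refl
... | inj₂ refl rewrite nonzero-χ (nonzero (anyBelow i f) ∨ nonzero (f i)) | fi = ∨-zeroʳ (nonzero (anyBelow i f))

anyBelow-elim : ∀ (f : ℕ → ℕ) k → nonzero (anyBelow k f) ≡ true → Σ ℕ λ i → i < k × nonzero (f i) ≡ true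
anyBelow-elim f zero ()
anyBelow-elim f (suc k) p rewrite nonzero-χ (nonzero (anyBelow k f) ∨ nonzero (f k)) with nonzero (anyBelow k f) in e1 | nonzero (f k) in e2
... | true | _ = let (i , i<k , fi) = anyBelow-elim f k e1 in i , ≤-trans i<k (n≤1+n k) , fi
... | false | true = k , ≤-refl , e2

allBelow-intro : ∀ (f : ℕ → ℕ) k → (∀ i → i < k → nonzero (f i) ≡ true) → nonzero (allBelow k f) ≡ true
allBelow-intro f zero h = refl
allBelow-intro f (suc k) h rewrite nonzero-χ (nonzero (allBelow k f) ∧ nonzero (f k))
  | allBelow-intro f k (λ i i<k → h i (≤-trans i<k (n≤1+n k))) | h k ≤-refl = refl

allBelow-elim : ∀ (f : ℕ → ℕ) k → nonzero (allBelow k f) ≡ true → ∀ i → i < k → nonzero (f i) ≡ true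
allBelow-elim f (suc k) p i (s≤s i≤k) rewrite nonzero-χ (nonzero (allBelow k f) ∧ nonzero (f k))
  with nonzero (allBelow k f) in e1 | nonzero (f k) in e2 | m≤n⇒m<n∨m≡n i≤k
... | true | true | inj₁ i<k = allBelow-elim f k e1 i i<k
... | true | true | inj₂ refl = e2
... | true | false | _ = ⊥-elim (false≢true p)
... | false | _ | _ = ⊥-elim (false≢true p)

triangle-mono : ∀ s t → s ≤ t → triangle s ≤ triangle t
triangle-mono s t s≤t with m≤n⇒m<n∨m≡n s≤t
... | inj₂ refl = ≤-refl
triangle-mono s (suc t') s≤t | inj₁ (s≤s s≤t') =
  ≤-trans (triangle-mono s t' s≤t') (subst (triangle t' ≤_) (sym (triangle-suc t')) (m≤m+n (triangle t') (suc t')))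

triangle-≥ : ∀ s → s ≤ triangle s
triangle-≥ zero = z≤n
triangle-≥ (suc s) rewrite triangle-suc s = subst (_≤ triangle s + suc s) refl (m≤n+m (suc s) (triangle s))

pair-≥₁ : ∀ a b → a ≤ ⟨ a , b ⟩
pair-≥₁ a b = ≤-trans (m≤m+n a b) (≤-trans (triangle-≥ (a + b)) (m≤m+n (triangle (a + b)) b))

pair-≥₂ : ∀ a b → b ≤ ⟨ a , b ⟩
pair-≥₂ a b = m≤n+m b (triangle (a + b))

pair<triangle-suc : ∀ a b → ⟨ a , b ⟩ < triangle (suc (a + b))
pair<triangle-suc a b rewrite triangle-suc (a + b) = +-monoʳ-< (triangle (a + b)) (s≤s (m≤n+m b a))

pair-injective : ∀ a b c d → ⟨ a , b ⟩ ≡ ⟨ c , d ⟩ → a ≡ c × b ≡ d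
pair-injective a b c d e with <-cmp (a + b) (c + d)
... | tri< lt _ _ = ⊥-elim (<-irrefl e (≤-trans (pair<triangle-suc a b)
          (≤-trans (triangle-mono _ _ lt) (m≤m+n (triangle (c + d)) d))))
... | tri> _ _ dropCodes = ⊥-elim (<-irrefl (sym e) (≤-trans (pair<triangle-suc c d)
          (≤-trans (triangle-mono _ _ dropCodes) (m≤m+n (triangle (a + b)) b))))
... | tri≈ _ s≡ _ =
  let b≡d : b ≡ d
      b≡d = +-cancelˡ-≡ (triangle (a + b)) b d (trans e (cong (λ s → triangle s + d) (sym s≡)))
  in +-cancelʳ-≡ b a c (trans s≡ (cong (c +_) (sym b≡d))) , b≡d

unpair₁Expr : Expr 1
unpair₁Expr = mnₑ (v zero ⊕ lit 1) (exₑ (v (suc zero) ⊕ lit 1) (⟪ v (suc zero) , v zero ⟫ ≐ v (suc (suc zero))))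

opaque
  unpair₁ : ℕ → ℕ
  unpair₁ z = minBelow (z + 1) (λ a → anyBelow (z + 1) (λ b → χ (⟨ a , b ⟩ ≡ᵇ z)))

  unpair₁-unfold : ∀ z → unpair₁ z ≡ minBelow (z + 1) (λ a → anyBelow (z + 1) (λ b → χ (⟨ a , b ⟩ ≡ᵇ z)))
  unpair₁-unfold z = refl

unpair₁Expr-correct : ∀ X (xs : Vec ℕ 1) → Eval X (compile unpair₁Expr) xs (unpair₁ (head xs))
unpair₁Expr-correct X (z ∷ []) = subst (Eval X (compile unpair₁Expr) (z ∷ [])) (sym (unpair₁-unfold z)) (correct unpair₁Expr X (z ∷ []))

unpair₁ₑ : ∀ {n} → Expr n → Expr n
unpair₁ₑ a = prim (compile unpair₁Expr) (λ xs → unpair₁ (head xs)) unpair₁Expr-correct (a ∷ [])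

unpair₂Expr : Expr 1
unpair₂Expr = mnₑ (v zero ⊕ lit 1) (⟪ unpair₁ₑ (v (suc zero)) , v zero ⟫ ≐ v (suc zero))

opaque
  unpair₂ : ℕ → ℕ
  unpair₂ z = minBelow (z + 1) (λ b → χ (⟨ unpair₁ z , b ⟩ ≡ᵇ z))

  unpair₂-unfold : ∀ z → unpair₂ z ≡ minBelow (z + 1) (λ b → χ (⟨ unpair₁ z , b ⟩ ≡ᵇ z))
  unpair₂-unfold z = refl

unpair₂Expr-correct : ∀ X (xs : Vec ℕ 1) → Eval X (compile unpair₂Expr) xs (unpair₂ (head xs))
unpair₂Expr-correct X (z ∷ []) = subst (Eval X (compile unpair₂Expr) (z ∷ [])) (sym (unpair₂-unfold z)) (correct unpair₂Expr X (z ∷ []))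

unpair₂ₑ : ∀ {n} → Expr n → Expr n
unpair₂ₑ a = prim (compile unpair₂Expr) (λ xs → unpair₂ (head xs)) unpair₂Expr-correct (a ∷ [])

unpair₁-pair : ∀ a b → unpair₁ ⟨ a , b ⟩ ≡ a
unpair₁-pair a b rewrite unpair₁-unfold ⟨ a , b ⟩ = minBelow-least f a fa none (z + 1) (s≤s' (pair-≥₁ a b))
  where
  z = ⟨ a , b ⟩
  s≤s' : ∀ {x y} → x ≤ y → x < y + 1
  s≤s' {x} {y} p = subst (x <_) (+-comm 1 y) (s≤s p)
  f = λ a' → anyBelow (z + 1) (λ b' → χ (⟨ a' , b' ⟩ ≡ᵇ z))
  fa : nonzero (f a) ≡ true
  fa = anyBelow-intro _ b (z + 1) (s≤s' (pair-≥₂ a b)) (trans (nonzero-χ _) (≡ᵇ-refl z))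
  none : ∀ i → i < a → nonzero (f i) ≡ false
  none i i<a with nonzero (f i) in eq
  ... | false = refl
  ... | true = let (b' , _ , h) = anyBelow-elim _ (z + 1) eq
                   e = ≡ᵇ≡true⇒≡ (trans (sym (nonzero-χ _)) h)
               in ⊥-elim (<-irrefl (proj₁ (pair-injective i b' a b e)) i<a)

unpair₂-pair : ∀ a b → unpair₂ ⟨ a , b ⟩ ≡ b
unpair₂-pair a b rewrite unpair₂-unfold ⟨ a , b ⟩ = minBelow-least f b fb none (z + 1) (s≤s' (pair-≥₂ a b))
  where
  z = ⟨ a , b ⟩
  s≤s' : ∀ {x y} → x ≤ y → x < y + 1
  s≤s' {x} {y} p = subst (x <_) (+-comm 1 y) (s≤s p)
  f = λ b' → χ (⟨ unpair₁ z , b' ⟩ ≡ᵇ z)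
  fb : nonzero (f b) ≡ true
  fb rewrite unpair₁-pair a b = trans (nonzero-χ _) (≡ᵇ-refl z)
  none : ∀ i → i < b → nonzero (f i) ≡ false
  none i i<b rewrite unpair₁-pair a b | nonzero-χ (⟨ a , i ⟩ ≡ᵇ z) with ⟨ a , i ⟩ ≟ z
  ... | yes e = ⊥-elim (<-irrefl (proj₂ (pair-injective a i a b e)) i<b)
  ... | no ne = ≢⇒≡ᵇ≡false ne

-- Computation certificates

-- A certificate is a pair ⟨ i , L ⟩, L a list of i entries coded by nested pairs. An entry
-- ⟨ 0 , m , xs , y , h ⟩ claims that the code numbered m maps the argument tuple xs (coded as
-- ⟨ arity , nested values ⟩) to y, the hint h being the tuple of intermediate values of a
-- composition or the previous value of a recursion step; an entry ⟨ 1 , m , n , h₁ , h₂ , h₃ ⟩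
-- claims that m numbers a code of arity n. Each entry must follow by one rule from earlier ones.

v0 : ∀ {n} → Expr (suc n)
v0 = v zero
v1 : ∀ {n} → Expr (suc (suc n))
v1 = v (suc zero)
v2 : ∀ {n} → Expr (suc (suc (suc n)))
v2 = v (suc (suc zero))
v3 : ∀ {n} → Expr (suc (suc (suc (suc n))))
v3 = v (suc (suc (suc zero)))
v4 : ∀ {n} → Expr (suc (suc (suc (suc (suc n)))))
v4 = v (suc (suc (suc (suc zero))))
v5 : ∀ {n} → Expr (suc (suc (suc (suc (suc (suc n))))))
v5 = v (suc (suc (suc (suc (suc zero)))))
v6 : ∀ {n} → Expr (suc (suc (suc (suc (suc (suc (suc n)))))))
v6 = v (suc (suc (suc (suc (suc (suc zero))))))
v7 : ∀ {n} → Expr (suc (suc (suc (suc (suc (suc (suc (suc n))))))))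
v7 = v (suc (suc (suc (suc (suc (suc (suc zero)))))))

app₂ : ∀ {n} → Expr 2 → Expr n → Expr n → Expr n
app₂ f a b = app f (a ∷ b ∷ [])

dropExpr : Expr 2
dropExpr = recₑ v1 v0 (unpair₂ₑ v1)

entryExpr : Expr 2
entryExpr = unpair₁ₑ (app₂ dropExpr v0 v1)

entryₑ : ∀ {n} → Expr n → Expr n → Expr n
entryₑ a b = app₂ entryExpr a b

fieldₑ : ∀ {n} → Expr n → ℕ → Expr n
fieldₑ e k = entryₑ e (lit k)

argₑ : ∀ {n} → Expr n → Expr n → Expr n
argₑ xs t = entryₑ (unpair₂ₑ xs) t

tailArgsₑ : ∀ {n} → Expr n → Expr n
tailArgsₑ xs = ⟪ unpair₁ₑ xs ⊝ lit 1 , unpair₂ₑ (unpair₂ₑ xs) ⟫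

consArgsₑ : ∀ {n} → Expr n → Expr n → Expr n
consArgsₑ a xs = ⟪ lit 1 ⊕ unpair₁ₑ xs , ⟪ a , unpair₂ₑ xs ⟫ ⟫

dropCodesExpr : Expr 2
dropCodesExpr = recₑ v1 v0 (unpair₂ₑ (v1 ⊝ lit 1))

dropCodesₑ : ∀ {n} → Expr n → Expr n → Expr n
dropCodesₑ a b = app₂ dropCodesExpr a b

-- v0, …, v5 stand for j (bound), L, i, m, xs, y.
hasEvalExpr : Expr 5
hasEvalExpr = exₑ v1 ((fieldₑ (entryₑ v1 v0) 0 ≐ lit 0) ∧ₑ (fieldₑ (entryₑ v1 v0) 1 ≐ v3) ∧ₑ
                (fieldₑ (entryₑ v1 v0) 2 ≐ v4) ∧ₑ (fieldₑ (entryₑ v1 v0) 3 ≐ v5))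

hasNonzeroEvalExpr : Expr 4
hasNonzeroEvalExpr = exₑ v1 ((fieldₑ (entryₑ v1 v0) 0 ≐ lit 0) ∧ₑ (fieldₑ (entryₑ v1 v0) 1 ≐ v3) ∧ₑ
                 (fieldₑ (entryₑ v1 v0) 2 ≐ v4) ∧ₑ ¬ₑ (fieldₑ (entryₑ v1 v0) 3 ≐ lit 0))

hasSomeEvalExpr : Expr 4
hasSomeEvalExpr = exₑ v1 ((fieldₑ (entryₑ v1 v0) 0 ≐ lit 0) ∧ₑ (fieldₑ (entryₑ v1 v0) 1 ≐ v3) ∧ₑ
                  (fieldₑ (entryₑ v1 v0) 2 ≐ v4))

hasTypingExpr : Expr 4
hasTypingExpr = exₑ v1 ((fieldₑ (entryₑ v1 v0) 0 ≐ lit 1) ∧ₑ (fieldₑ (entryₑ v1 v0) 1 ≐ v3) ∧ₑ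
                (fieldₑ (entryₑ v1 v0) 2 ≐ v4))

hasEvalₑ : ∀ {n} → Expr n → Expr n → Expr n → Expr n → Expr n → Expr n
hasEvalₑ L i m xs y = app hasEvalExpr (L ∷ i ∷ m ∷ xs ∷ y ∷ [])

hasNonzeroEvalₑ : ∀ {n} → Expr n → Expr n → Expr n → Expr n → Expr n
hasNonzeroEvalₑ L i m xs = app hasNonzeroEvalExpr (L ∷ i ∷ m ∷ xs ∷ [])

hasSomeEvalₑ : ∀ {n} → Expr n → Expr n → Expr n → Expr n → Expr n
hasSomeEvalₑ L i m xs = app hasSomeEvalExpr (L ∷ i ∷ m ∷ xs ∷ [])

hasTypingₑ : ∀ {n} → Expr n → Expr n → Expr n → Expr n → Expr n
hasTypingₑ L i m k = app hasTypingExpr (L ∷ i ∷ m ∷ k ∷ [])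

-- v0, …, v5 stand for L, i, m, xs, y, h.
compArity compOuter compInner : Expr 6
compArity = unpair₁ₑ v5 ≐ unpair₁ₑ (unpair₂ₑ v2)
compOuter = hasEvalₑ v0 v1 (unpair₁ₑ (unpair₂ₑ (unpair₂ₑ v2))) v5 v4
compInner = allₑ (unpair₁ₑ (unpair₂ₑ v2)) (hasEvalₑ v1 v2 (unpair₁ₑ (dropCodesₑ (unpair₂ₑ (unpair₂ₑ (unpair₂ₑ v3))) v0 ⊝ lit 1)) v4 (argₑ v6 v0))

compRule : Expr 6
compRule = compArity ∧ₑ compOuter ∧ₑ compInner

precZeroRule precSucPrevious precSucStep : Expr 6
precZeroRule = hasEvalₑ v0 v1 (unpair₁ₑ (unpair₂ₑ v2)) (tailArgsₑ v3) v4
precSucPrevious = hasEvalₑ v0 v1 v2 (consArgsₑ (argₑ v3 (lit 0) ⊝ lit 1) (tailArgsₑ v3)) v5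
precSucStep = hasEvalₑ v0 v1 (unpair₂ₑ (unpair₂ₑ v2)) (consArgsₑ (argₑ v3 (lit 0) ⊝ lit 1) (consArgsₑ v5 (tailArgsₑ v3))) v4

precRule : Expr 6
precRule = ifₑ (argₑ v3 (lit 0) ≐ lit 0) precZeroRule (precSucPrevious ∧ₑ precSucStep)

muZero muBelow : Expr 6
muZero = hasEvalₑ v0 v1 (unpair₂ₑ v2) (consArgsₑ v4 v3) (lit 0)
muBelow = allₑ v4 (hasNonzeroEvalₑ v1 v2 (unpair₂ₑ v3) (consArgsₑ v0 v4))

muRule : Expr 6
muRule = muZero ∧ₑ muBelow

evalRule : Expr 6
evalRule = ifₑ (unpair₁ₑ v2 ≐ lit 0) (v4 ≐ lit 0)
     (ifₑ (unpair₁ₑ v2 ≐ lit 1) (v4 ≐ lit 1 ⊕ argₑ v3 (lit 0))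
     (ifₑ (unpair₁ₑ v2 ≐ lit 2) (v4 ≐ query (argₑ v3 (lit 0)))
     (ifₑ (unpair₁ₑ v2 ≐ lit 3) (v4 ≐ argₑ v3 (unpair₂ₑ v2))
     (ifₑ (unpair₁ₑ v2 ≐ lit 4) compRule
     (ifₑ (unpair₁ₑ v2 ≐ lit 5) precRule
     (ifₑ (unpair₁ₑ v2 ≐ lit 6) muRule (lit 0)))))))

-- v0, …, v6 stand for L, i, m, n, h₁, h₂, h₃.
compShape compOuterTyped compInnerTyped compListEnds : Expr 7
compShape = v2 ≐ ⟪ lit 4 , ⟪ v4 , ⟪ v5 , v6 ⟫ ⟫ ⟫
compOuterTyped = hasTypingₑ v0 v1 v5 v4
compInnerTyped = allₑ v4 ((dropCodesₑ v7 v0 ≐ lit 1 ⊕ ⟪ unpair₁ₑ (dropCodesₑ v7 v0 ⊝ lit 1) , unpair₂ₑ (dropCodesₑ v7 v0 ⊝ lit 1) ⟫) ∧ₑ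
               hasTypingₑ v1 v2 (unpair₁ₑ (dropCodesₑ v7 v0 ⊝ lit 1)) v4)
compListEnds = dropCodesₑ v6 v4 ≐ lit 0

compTyping : Expr 7
compTyping = compShape ∧ₑ compOuterTyped ∧ₑ compInnerTyped ∧ₑ compListEnds

zeroShape succShape unaryArity queryShape projShape projInRange precShape precPositiveArity precBaseTyped precStepTyped muShape muBodyTyped : Expr 7
zeroShape = v2 ≐ lit ⟨ 0 , 0 ⟩
succShape = v2 ≐ lit ⟨ 1 , 0 ⟩
unaryArity = v3 ≐ lit 1
queryShape = v2 ≐ lit ⟨ 2 , 0 ⟩
projShape = v2 ≐ ⟪ lit 3 , v4 ⟫
projInRange = v4 ≺ v3
precShape = v2 ≐ ⟪ lit 5 , ⟪ v4 , v5 ⟫ ⟫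
precPositiveArity = lit 0 ≺ v3
precBaseTyped = hasTypingₑ v0 v1 v4 (v3 ⊝ lit 1)
precStepTyped = hasTypingₑ v0 v1 v5 (lit 1 ⊕ v3)
muShape = v2 ≐ ⟪ lit 6 , v4 ⟫
muBodyTyped = hasTypingₑ v0 v1 v4 (lit 1 ⊕ v3)

typingRule : Expr 7
typingRule = ifₑ (unpair₁ₑ v2 ≐ lit 0) zeroShape
     (ifₑ (unpair₁ₑ v2 ≐ lit 1) (succShape ∧ₑ unaryArity)
     (ifₑ (unpair₁ₑ v2 ≐ lit 2) (queryShape ∧ₑ unaryArity)
     (ifₑ (unpair₁ₑ v2 ≐ lit 3) (projShape ∧ₑ projInRange)
     (ifₑ (unpair₁ₑ v2 ≐ lit 4) compTyping
     (ifₑ (unpair₁ₑ v2 ≐ lit 5) (precShape ∧ₑ precPositiveArity ∧ₑ precBaseTyped ∧ₑ precStepTyped)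
     (ifₑ (unpair₁ₑ v2 ≐ lit 6) (muShape ∧ₑ muBodyTyped) (lit 0)))))))

entryRule : Expr 2
entryRule = ifₑ (fieldₑ (entryₑ v0 v1) 0 ≐ lit 0)
           (app evalRule (v0 ∷ v1 ∷ fieldₑ (entryₑ v0 v1) 1 ∷ fieldₑ (entryₑ v0 v1) 2 ∷ fieldₑ (entryₑ v0 v1) 3 ∷
                     fieldₑ (entryₑ v0 v1) 4 ∷ []))
         (ifₑ (fieldₑ (entryₑ v0 v1) 0 ≐ lit 1)
           (app typingRule (v0 ∷ v1 ∷ fieldₑ (entryₑ v0 v1) 1 ∷ fieldₑ (entryₑ v0 v1) 2 ∷ fieldₑ (entryₑ v0 v1) 3 ∷
                     fieldₑ (entryₑ v0 v1) 4 ∷ fieldₑ (entryₑ v0 v1) 5 ∷ []))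
           (lit 0))

certificateRule : Expr 1
certificateRule = allₑ (unpair₁ₑ v0) (app₂ entryRule (unpair₂ₑ v1) v0)

-- Soundness of certificates

Truthy : ℕ → Set
Truthy n = nonzero n ≡ true

dropₙ : ℕ → ℕ → ℕ
dropₙ L i = primRec i L (λ _ a → unpair₂ a)

entry : ℕ → ℕ → ℕ
entry L i = unpair₁ (dropₙ L i)

dropCodes : ℕ → ℕ → ℕ
dropCodes G t = primRec t G (λ _ a → unpair₂ (a ∸ 1))

decodeArgs : (n : ℕ) → ℕ → Vec ℕ n
decodeArgs zero L = []
decodeArgs (suc n) L = unpair₁ L ∷ decodeArgs n (unpair₂ L)

dropₙ-suc : ∀ L t → dropₙ L (suc t) ≡ dropₙ (unpair₂ L) t
dropₙ-suc L zero = refl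
dropₙ-suc L (suc t) = cong unpair₂ (dropₙ-suc L t)

dropCodes-suc : ∀ G t → dropCodes G (suc t) ≡ dropCodes (unpair₂ (G ∸ 1)) t
dropCodes-suc G zero = refl
dropCodes-suc G (suc t) = cong (λ a → unpair₂ (a ∸ 1)) (dropCodes-suc G t)

lookup-decodeArgs : ∀ n L (j : Fin n) → lookup (decodeArgs n L) j ≡ entry L (toℕ j)
lookup-decodeArgs (suc n) L zero = refl
lookup-decodeArgs (suc n) L (suc j) = trans (lookup-decodeArgs n (unpair₂ L) j) (cong unpair₁ (sym (dropₙ-suc L (toℕ j))))

EvalClaim : Oracle → ℕ → ℕ → ℕ → Set
EvalClaim X m xs y = ∀ (c : Code (unpair₁ xs)) → encode c ≡ m → Eval X c (decodeArgs (unpair₁ xs) (unpair₂ xs)) y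

TypingClaim : ℕ → ℕ → Set
TypingClaim m n = Σ (Code n) λ c → encode c ≡ m

SoundEntry : Oracle → ℕ → ℕ → Set
SoundEntry X L j = (entry (entry L j) 0 ≡ 0 → EvalClaim X (entry (entry L j) 1) (entry (entry L j) 2) (entry (entry L j) 3)) ×
                (entry (entry L j) 0 ≡ 1 → TypingClaim (entry (entry L j) 1) (entry (entry L j) 2))

truthy-∧⁻ : ∀ a b → Truthy (χ (a ∧ b)) → a ≡ true × b ≡ true
truthy-∧⁻ true true _ = refl , refl
truthy-∧⁻ true false ()
truthy-∧⁻ false b ()

truthy-≡ᵇ⁻ : ∀ a b → Truthy (χ (a ≡ᵇ b)) → a ≡ b
truthy-≡ᵇ⁻ a b p = ≡ᵇ≡true⇒≡ (trans (sym (nonzero-χ _)) p)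

truthy-<ᵇ⁻ : ∀ a b → Truthy (χ (a <ᵇ b)) → a < b
truthy-<ᵇ⁻ a b p = <ᵇ≡true⇒< a b (trans (sym (nonzero-χ _)) p)

truthy-≢0⁻ : ∀ a → Truthy (χ (not (nonzero (χ (a ≡ᵇ 0))))) → Σ ℕ λ a' → a ≡ suc a'
truthy-≢0⁻ zero ()
truthy-≢0⁻ (suc a) _ = a , refl

hasEval-elim : ∀ X L i m xs y → Truthy (⟦ hasEvalExpr ⟧ X (L ∷ i ∷ m ∷ xs ∷ y ∷ [])) →
  Σ ℕ λ j → j < i × entry (entry L j) 0 ≡ 0 × entry (entry L j) 1 ≡ m × entry (entry L j) 2 ≡ xs × entry (entry L j) 3 ≡ y
hasEval-elim X L i m xs y p with anyBelow-elim _ i p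
... | j , j<i , q with truthy-∧⁻ _ _ q
... | q0 , q' with truthy-∧⁻ _ _ q'
... | q1 , q'' with truthy-∧⁻ _ _ q''
... | q2 , q3 = j , j<i , truthy-≡ᵇ⁻ _ _ q0 , truthy-≡ᵇ⁻ _ _ q1 , truthy-≡ᵇ⁻ _ _ q2 , truthy-≡ᵇ⁻ _ _ q3

hasNonzeroEval-elim : ∀ X L i m xs → Truthy (⟦ hasNonzeroEvalExpr ⟧ X (L ∷ i ∷ m ∷ xs ∷ [])) →
  Σ ℕ λ j → j < i × entry (entry L j) 0 ≡ 0 × entry (entry L j) 1 ≡ m × entry (entry L j) 2 ≡ xs ×
     Σ ℕ λ y' → entry (entry L j) 3 ≡ suc y'
hasNonzeroEval-elim X L i m xs p with anyBelow-elim _ i p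
... | j , j<i , q with truthy-∧⁻ _ _ q
... | q0 , q' with truthy-∧⁻ _ _ q'
... | q1 , q'' with truthy-∧⁻ _ _ q''
... | q2 , q3 = j , j<i , truthy-≡ᵇ⁻ _ _ q0 , truthy-≡ᵇ⁻ _ _ q1 , truthy-≡ᵇ⁻ _ _ q2 , truthy-≢0⁻ _ q3

hasSomeEval-elim : ∀ X L i m xs → Truthy (⟦ hasSomeEvalExpr ⟧ X (L ∷ i ∷ m ∷ xs ∷ [])) →
  Σ ℕ λ j → j < i × entry (entry L j) 0 ≡ 0 × entry (entry L j) 1 ≡ m × entry (entry L j) 2 ≡ xs
hasSomeEval-elim X L i m xs p with anyBelow-elim _ i p
... | j , j<i , q with truthy-∧⁻ _ _ q
... | q0 , q' with truthy-∧⁻ _ _ q'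
... | q1 , q2 = j , j<i , truthy-≡ᵇ⁻ _ _ q0 , truthy-≡ᵇ⁻ _ _ q1 , truthy-≡ᵇ⁻ _ _ q2

hasTyping-elim : ∀ X L i m n → Truthy (⟦ hasTypingExpr ⟧ X (L ∷ i ∷ m ∷ n ∷ [])) →
  Σ ℕ λ j → j < i × entry (entry L j) 0 ≡ 1 × entry (entry L j) 1 ≡ m × entry (entry L j) 2 ≡ n
hasTyping-elim X L i m n p with anyBelow-elim _ i p
... | j , j<i , q with truthy-∧⁻ _ _ q
... | q0 , q' with truthy-∧⁻ _ _ q'
... | q1 , q2 = j , j<i , truthy-≡ᵇ⁻ _ _ q0 , truthy-≡ᵇ⁻ _ _ q1 , truthy-≡ᵇ⁻ _ _ q2

SoundBefore : Oracle → ℕ → ℕ → Set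
SoundBefore X L i = ∀ j → j < i → SoundEntry X L j

hasEval-sound : ∀ X L i m xs y → SoundBefore X L i → Truthy (⟦ hasEvalExpr ⟧ X (L ∷ i ∷ m ∷ xs ∷ y ∷ [])) → EvalClaim X m xs y
hasEval-sound X L i m xs y pr p with hasEval-elim X L i m xs y p
... | j , j<i , k0 , refl , refl , refl = proj₁ (pr j j<i) k0

hasTyping-sound : ∀ X L i m n → SoundBefore X L i → Truthy (⟦ hasTypingExpr ⟧ X (L ∷ i ∷ m ∷ n ∷ [])) → TypingClaim m n
hasTyping-sound X L i m n pr p with hasTyping-elim X L i m n p
... | j , j<i , k1 , refl , refl = proj₂ (pr j j<i) k1

truthy-∧ₑ⁻ : ∀ {n} (e1 e2 : Expr n) X xs → Truthy (⟦ e1 ∧ₑ e2 ⟧ X xs) → Truthy (⟦ e1 ⟧ X xs) × Truthy (⟦ e2 ⟧ X xs)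
truthy-∧ₑ⁻ e1 e2 X xs p = truthy-∧⁻ (nonzero (⟦ e1 ⟧ X xs)) (nonzero (⟦ e2 ⟧ X xs)) p

truthy-≐⁻ : ∀ {n} (e1 e2 : Expr n) X xs → Truthy (⟦ e1 ≐ e2 ⟧ X xs) → ⟦ e1 ⟧ X xs ≡ ⟦ e2 ⟧ X xs
truthy-≐⁻ e1 e2 X xs p = truthy-≡ᵇ⁻ (⟦ e1 ⟧ X xs) (⟦ e2 ⟧ X xs) p

EvalClaim-at : ∀ {X m xs y} → EvalClaim X m xs y → ∀ {k L} → k ≡ unpair₁ xs → L ≡ unpair₂ xs → (c : Code k) → encode c ≡ m →
  Eval X c (decodeArgs k L) y
EvalClaim-at J refl refl c e = J c e

decodeArgs-pair : ∀ k a U → decodeArgs (suc k) ⟨ a , U ⟩ ≡ a ∷ decodeArgs k U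
decodeArgs-pair k a U = cong₂ _∷_ (unpair₁-pair a U) (cong (decodeArgs k) (unpair₂-pair a U))

consArgs : ℕ → ℕ → ℕ
consArgs a xs = ⟨ 1 + unpair₁ xs , ⟨ a , unpair₂ xs ⟩ ⟩

EvalClaim-cons : ∀ {X m a xs y k} → EvalClaim X m (consArgs a xs) y → k ≡ unpair₁ xs → (c : Code (suc k)) → encode c ≡ m →
  Eval X c (a ∷ decodeArgs k (unpair₂ xs)) y
EvalClaim-cons {X} {m} {a} {xs} {y} {k} J keq c e =
  subst (λ w → Eval X c w y) (decodeArgs-pair k a (unpair₂ xs))
    (EvalClaim-at J (trans (cong suc keq) (sym (unpair₁-pair (1 + unpair₁ xs) ⟨ a , unpair₂ xs ⟩))) (sym (unpair₂-pair (1 + unpair₁ xs) ⟨ a , unpair₂ xs ⟩)) c e)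

tailArgs : ℕ → ℕ
tailArgs xs = ⟨ unpair₁ xs ∸ 1 , unpair₂ (unpair₂ xs) ⟩

evalRuleCase : ℕ → Oracle → Vec ℕ 6 → ℕ
evalRuleCase t X ctx = if nonzero (χ (t ≡ᵇ 0)) then ⟦ v4 ≐ lit 0 ⟧ X ctx
  else if nonzero (χ (t ≡ᵇ 1)) then ⟦ v4 ≐ lit 1 ⊕ argₑ v3 (lit 0) ⟧ X ctx
  else if nonzero (χ (t ≡ᵇ 2)) then ⟦ v4 ≐ query (argₑ v3 (lit 0)) ⟧ X ctx
  else if nonzero (χ (t ≡ᵇ 3)) then ⟦ v4 ≐ argₑ v3 (unpair₂ₑ v2) ⟧ X ctx
  else if nonzero (χ (t ≡ᵇ 4)) then ⟦ compRule ⟧ X ctx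
  else if nonzero (χ (t ≡ᵇ 5)) then ⟦ precRule ⟧ X ctx
  else if nonzero (χ (t ≡ᵇ 6)) then ⟦ muRule ⟧ X ctx else 0

evalRule-case : ∀ X L i m xs y h {t} → unpair₁ m ≡ t →
  ⟦ evalRule ⟧ X (L ∷ i ∷ m ∷ xs ∷ y ∷ h ∷ []) ≡ evalRuleCase t X (L ∷ i ∷ m ∷ xs ∷ y ∷ h ∷ [])
evalRule-case X L i m xs y h eq = cong (λ t → evalRuleCase t X (L ∷ i ∷ m ∷ xs ∷ y ∷ h ∷ [])) eq

search-from : ∀ {X n} {f : Code (suc n)} {xs : Vec ℕ n} {y} → Eval X f (y ∷ xs) 0 →
  (∀ t → t < y → Σ ℕ λ k → Eval X f (t ∷ xs) (suc k)) → ∀ d z → z + d ≡ y → Search X f xs z y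
search-from e0 h zero z eq rewrite +-identityʳ z | eq = found e0
search-from {y = y} e0 h (suc d) z eq =
  next (proj₂ (h z (subst (z <_) eq (m<m+n z (s≤s z≤n)))))
       (search-from e0 h d (suc z) (trans (sym (+-suc z d)) eq))

evalRule-sound-args : ∀ X L i xs k → k ≡ unpair₁ xs → SoundBefore X L i → ∀ {mf} (gs : Vec (Code k) mf) G YL →
  encodeVec gs ≡ G →
  (∀ t → t < mf → Truthy (⟦ hasEvalExpr ⟧ X (L ∷ i ∷ unpair₁ (dropCodes G t ∸ 1) ∷ xs ∷ entry YL t ∷ []))) →
  EvalVec X gs (decodeArgs k (unpair₂ xs)) (decodeArgs mf YL)
evalRule-sound-args X L i xs k keq pr [] G YL e h = ev-[]
evalRule-sound-args X L i xs k keq pr (g ∷ gs) G YL refl h =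
  ev-∷ (EvalClaim-at (hasEval-sound X L i _ xs _ pr (h 0 (s≤s z≤n))) keq refl g
          (sym (unpair₁-pair (encode g) (encodeVec gs))))
       (evalRule-sound-args X L i xs k keq pr gs (encodeVec gs) (unpair₂ YL) refl
          (λ t t<m → subst₂ (λ a b → Truthy (⟦ hasEvalExpr ⟧ X (L ∷ i ∷ unpair₁ (a ∸ 1) ∷ xs ∷ b ∷ [])))
             (trans (dropCodes-suc _ t) (cong (λ w → dropCodes w t) (unpair₂-pair (encode g) (encodeVec gs))))
             (cong unpair₁ (dropₙ-suc YL t))
             (h (suc t) (s≤s t<m))))

evalRule-sound : ∀ X L i xs y h → SoundBefore X L i → ∀ k → k ≡ unpair₁ xs → (c : Code k) →
  Truthy (⟦ evalRule ⟧ X (L ∷ i ∷ encode c ∷ xs ∷ y ∷ h ∷ [])) → Eval X c (decodeArgs k (unpair₂ xs)) y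
evalRule-sound X L i xs y h pr k keq Z p =
  subst (Eval X Z _) (sym (truthy-≡ᵇ⁻ y 0 (subst Truthy (evalRule-case X L i _ xs y h (unpair₁-pair 0 0)) p))) ev-Z
evalRule-sound X L i xs y h pr k keq S p =
  subst (Eval X S _) (sym (truthy-≡ᵇ⁻ y _ (subst Truthy (evalRule-case X L i _ xs y h (unpair₁-pair 1 0)) p))) ev-S
evalRule-sound X L i xs y h pr k keq O p =
  subst (Eval X O _) (sym (truthy-≡ᵇ⁻ y _ (subst Truthy (evalRule-case X L i _ xs y h (unpair₁-pair 2 0)) p))) ev-O
evalRule-sound X L i xs y h pr k keq (P j) p =
  subst (Eval X (P j) _) (trans (lookup-decodeArgs k (unpair₂ xs) j)
      (trans (cong (entry (unpair₂ xs)) (sym (unpair₂-pair 3 (toℕ j)))) (sym (truthy-≡ᵇ⁻ y _ p'))))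
    (ev-P j)
  where p' = subst Truthy (evalRule-case X L i _ xs y h (unpair₁-pair 3 (toℕ j))) p
evalRule-sound X L i xs y h pr k keq (comp {mf} f gs) p =
  ev-comp (evalRule-sound-args X L i xs k keq pr gs G (unpair₂ h) (sym eG) (λ t t<m → allBelow-elim _ _ C t (subst (t <_) (sym e1) t<m)))
    (EvalClaim-at (hasEval-sound X L i _ h y pr B) (sym (trans (truthy-≐⁻ (unpair₁ₑ v5) (unpair₁ₑ (unpair₂ₑ v2)) X ctx A) e1)) refl f (sym e2))
  where
  m = encode (comp f gs)
  ctx = L ∷ i ∷ m ∷ xs ∷ y ∷ h ∷ []
  Wc = ⟨ mf , ⟨ encode f , encodeVec gs ⟩ ⟩
  Wf = ⟨ encode f , encodeVec gs ⟩
  p' : Truthy (⟦ compRule ⟧ X ctx)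
  p' = subst Truthy (evalRule-case X L i m xs y h (unpair₁-pair 4 Wc)) p
  e0 : unpair₂ m ≡ Wc
  e0 = unpair₂-pair 4 Wc
  e1 : unpair₁ (unpair₂ m) ≡ mf
  e1 = trans (cong unpair₁ e0) (unpair₁-pair mf Wf)
  e2 : unpair₁ (unpair₂ (unpair₂ m)) ≡ encode f
  e2 = trans (cong (λ w → unpair₁ (unpair₂ w)) e0) (trans (cong unpair₁ (unpair₂-pair mf Wf)) (unpair₁-pair (encode f) (encodeVec gs)))
  eG : unpair₂ (unpair₂ (unpair₂ m)) ≡ encodeVec gs
  eG = trans (cong (λ w → unpair₂ (unpair₂ w)) e0) (trans (cong unpair₂ (unpair₂-pair mf Wf)) (unpair₂-pair (encode f) (encodeVec gs)))
  G = unpair₂ (unpair₂ (unpair₂ m))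
  A : Truthy (⟦ compArity ⟧ X ctx)
  A = proj₁ (truthy-∧ₑ⁻ compArity (compOuter ∧ₑ compInner) X ctx p')
  B : Truthy (⟦ compOuter ⟧ X ctx)
  B = proj₁ (truthy-∧ₑ⁻ compOuter compInner X ctx (proj₂ (truthy-∧ₑ⁻ compArity (compOuter ∧ₑ compInner) X ctx p')))
  C : Truthy (⟦ compInner ⟧ X ctx)
  C = proj₂ (truthy-∧ₑ⁻ compOuter compInner X ctx (proj₂ (truthy-∧ₑ⁻ compArity (compOuter ∧ₑ compInner) X ctx p')))
evalRule-sound X L i xs y h pr (suc k') keq (prec f g) p = precCase (unpair₁ (unpair₂ xs)) refl p'
  where
  m = encode (prec f g)
  ctx = L ∷ i ∷ m ∷ xs ∷ y ∷ h ∷ []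
  Wc = ⟨ encode f , encode g ⟩
  p' : Truthy (⟦ precRule ⟧ X ctx)
  p' = subst Truthy (evalRule-case X L i m xs y h (unpair₁-pair 5 Wc)) p
  e0 : unpair₂ m ≡ Wc
  e0 = unpair₂-pair 5 Wc
  ef : encode f ≡ unpair₁ (unpair₂ m)
  ef = sym (trans (cong unpair₁ e0) (unpair₁-pair (encode f) (encode g)))
  eg : encode g ≡ unpair₂ (unpair₂ m)
  eg = sym (trans (cong unpair₂ e0) (unpair₂-pair (encode f) (encode g)))
  T = tailArgs xs
  typingEntry₁ : k' ≡ unpair₁ T
  typingEntry₁ = trans (cong (_∸ 1) keq) (sym (unpair₁-pair (unpair₁ xs ∸ 1) (unpair₂ (unpair₂ xs))))
  typingEntry₂ : unpair₂ T ≡ unpair₂ (unpair₂ xs)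
  typingEntry₂ = unpair₂-pair (unpair₁ xs ∸ 1) (unpair₂ (unpair₂ xs))
  rest = decodeArgs k' (unpair₂ (unpair₂ xs))
  precCase : ∀ a0 → unpair₁ (unpair₂ xs) ≡ a0 →
    Truthy (if nonzero (χ (a0 ≡ᵇ 0)) then ⟦ precZeroRule ⟧ X ctx else ⟦ precSucPrevious ∧ₑ precSucStep ⟧ X ctx) →
    Eval X (prec f g) (unpair₁ (unpair₂ xs) ∷ rest) y
  precCase zero e q =
    subst (λ w → Eval X (prec f g) (w ∷ rest) y) (sym e)
    (ev-prec0 (subst (λ w → Eval X f (decodeArgs k' w) y) typingEntry₂
      (EvalClaim-at (hasEval-sound X L i _ T y pr q) typingEntry₁ refl f ef)))
  precCase (suc a) e q =
    subst (λ w → Eval X (prec f g) (w ∷ rest) y) (sym e)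
    (ev-precS (subst (λ w → Eval X (prec f g) (w ∷ decodeArgs k' (unpair₂ (unpair₂ xs))) h) ea
                (subst (λ w → Eval X (prec f g) (a0' ∷ decodeArgs k' w) h) typingEntry₂
                  (EvalClaim-cons (hasEval-sound X L i _ (consArgs a0' T) h pr q1) typingEntry₁ (prec f g) refl)))
             (subst (λ w → Eval X g (w ∷ h ∷ rest) y) ea
               (subst (λ w → Eval X g (a0' ∷ w) y)
                (trans (cong (decodeArgs (suc k')) (unpair₂-pair (1 + unpair₁ T) ⟨ h , unpair₂ T ⟩))
                  (trans (decodeArgs-pair k' h (unpair₂ T)) (cong (λ w → h ∷ decodeArgs k' w) typingEntry₂)))
                (EvalClaim-cons (hasEval-sound X L i _ (consArgs a0' (consArgs h T)) y pr q2)
                   (trans (cong suc typingEntry₁) (sym (unpair₁-pair (1 + unpair₁ T) ⟨ h , unpair₂ T ⟩))) g eg))))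
    where
    a0' = unpair₁ (unpair₂ xs) ∸ 1
    ea : a0' ≡ a
    ea = cong (_∸ 1) e
    q1 = proj₁ (truthy-∧ₑ⁻ precSucPrevious precSucStep X ctx q)
    q2 = proj₂ (truthy-∧ₑ⁻ precSucPrevious precSucStep X ctx q)
evalRule-sound X L i xs y h pr k keq (mu f) p = ev-mu (search-from e0 hh y 0 refl)
  where
  m = encode (mu f)
  ctx = L ∷ i ∷ m ∷ xs ∷ y ∷ h ∷ []
  p' : Truthy (⟦ muRule ⟧ X ctx)
  p' = subst Truthy (evalRule-case X L i m xs y h (unpair₁-pair 6 (encode f))) p
  ef : encode f ≡ unpair₂ m
  ef = sym (unpair₂-pair 6 (encode f))
  q1 = proj₁ (truthy-∧ₑ⁻ muZero muBelow X ctx p')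
  q2 = proj₂ (truthy-∧ₑ⁻ muZero muBelow X ctx p')
  e0 : Eval X f (y ∷ decodeArgs k (unpair₂ xs)) 0
  e0 = EvalClaim-cons (hasEval-sound X L i _ (consArgs y xs) 0 pr q1) keq f ef
  hh : ∀ t → t < y → Σ ℕ λ k' → Eval X f (t ∷ decodeArgs k (unpair₂ xs)) (suc k')
  hh t t<y with hasNonzeroEval-elim X L i (unpair₂ m) (consArgs t xs) (allBelow-elim _ y q2 t t<y)
  ... | j , j<i , k0 , e1 , e2 , y' , e3 =
    y' , EvalClaim-cons {X} {unpair₂ m} {t} {xs} {suc y'} {k}
           (subst₂ (λ a b → EvalClaim X a b (suc y')) e1 e2
             (subst (EvalClaim X (entry (entry L j) 1) (entry (entry L j) 2)) e3 (proj₁ (pr j j<i) k0))) keq f ef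

typingRuleCase : ℕ → Oracle → Vec ℕ 7 → ℕ
typingRuleCase t X ctx = if nonzero (χ (t ≡ᵇ 0)) then ⟦ zeroShape ⟧ X ctx
  else if nonzero (χ (t ≡ᵇ 1)) then ⟦ succShape ∧ₑ unaryArity ⟧ X ctx
  else if nonzero (χ (t ≡ᵇ 2)) then ⟦ queryShape ∧ₑ unaryArity ⟧ X ctx
  else if nonzero (χ (t ≡ᵇ 3)) then ⟦ projShape ∧ₑ projInRange ⟧ X ctx
  else if nonzero (χ (t ≡ᵇ 4)) then ⟦ compTyping ⟧ X ctx
  else if nonzero (χ (t ≡ᵇ 5)) then ⟦ precShape ∧ₑ precPositiveArity ∧ₑ precBaseTyped ∧ₑ precStepTyped ⟧ X ctx
  else if nonzero (χ (t ≡ᵇ 6)) then ⟦ muShape ∧ₑ muBodyTyped ⟧ X ctx else 0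

compListHead compListCons compListTyped : Expr 8
compListHead = dropCodesₑ v7 v0
compListCons = lit 1 ⊕ ⟪ unpair₁ₑ (dropCodesₑ v7 v0 ⊝ lit 1) , unpair₂ₑ (dropCodesₑ v7 v0 ⊝ lit 1) ⟫
compListTyped = hasTypingₑ v1 v2 (unpair₁ₑ (dropCodesₑ v7 v0 ⊝ lit 1)) v4

compListStep : Expr 8
compListStep = (compListHead ≐ compListCons) ∧ₑ compListTyped

typed-code-list : ∀ X L i n → SoundBefore X L i → ∀ k G →
  (∀ t → t < k → Truthy (⟦ compListStep ⟧ X (t ∷ L ∷ i ∷ 0 ∷ n ∷ 0 ∷ 0 ∷ G ∷ []))) → dropCodes G k ≡ 0 →
  Σ (Vec (Code n) k) λ gs → encodeVec gs ≡ G
typed-code-list X L i n pr zero G h e = [] , sym e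
typed-code-list X L i n pr (suc k) G h e with typed-code-list X L i n pr k (unpair₂ (G ∸ 1))
    (λ t t<k → subst (λ w → Truthy (⟦ compListStep ⟧ X (t ∷ L ∷ i ∷ 0 ∷ n ∷ 0 ∷ 0 ∷ w ∷ []))) refl
       (hh t t<k))
    (trans (sym (dropCodes-suc G k)) e)
  where
  hh : ∀ t → t < k → Truthy (⟦ compListStep ⟧ X (t ∷ L ∷ i ∷ 0 ∷ n ∷ 0 ∷ 0 ∷ unpair₂ (G ∸ 1) ∷ []))
  hh t t<k = subst (λ w → Truthy (χ (nonzero (χ (w ≡ᵇ 1 + ⟨ unpair₁ (w ∸ 1) , unpair₂ (w ∸ 1) ⟩)) ∧
                                   nonzero (⟦ hasTypingExpr ⟧ X (L ∷ i ∷ unpair₁ (w ∸ 1) ∷ n ∷ [])))))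
               (dropCodes-suc G t) (h (suc t) (s≤s t<k))
... | gs , egs = (proj₁ Jg ∷ gs) , trans (cong suc (cong₂ ⟨_,_⟩ (proj₂ Jg) egs)) (sym eG)
  where
  q = h 0 (s≤s z≤n)
  ctx0 = 0 ∷ L ∷ i ∷ 0 ∷ n ∷ 0 ∷ 0 ∷ G ∷ []
  eG : G ≡ 1 + ⟨ unpair₁ (G ∸ 1) , unpair₂ (G ∸ 1) ⟩
  eG = truthy-≐⁻ compListHead compListCons X ctx0 (proj₁ (truthy-∧ₑ⁻ (compListHead ≐ compListCons) compListTyped X ctx0 q))
  Jg = hasTyping-sound X L i (unpair₁ (G ∸ 1)) n pr (proj₂ (truthy-∧ₑ⁻ (compListHead ≐ compListCons) compListTyped X ctx0 q))

typing-prec : ∀ n m h1 h2 → m ≡ ⟨ 5 , ⟨ h1 , h2 ⟩ ⟩ → 0 < n → TypingClaim h1 (n ∸ 1) → TypingClaim h2 (1 + n) → TypingClaim m n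
typing-prec (suc n) m h1 h2 e _ (f , ef) (g , eg) = prec f g , trans (cong₂ (λ a b → ⟨ 5 , ⟨ a , b ⟩ ⟩) ef eg) (sym e)

typingRule-sound : ∀ X L i m n h1 h2 h3 → SoundBefore X L i → Truthy (⟦ typingRule ⟧ X (L ∷ i ∷ m ∷ n ∷ h1 ∷ h2 ∷ h3 ∷ [])) → TypingClaim m n
typingRule-sound X L i m n h1 h2 h3 pr p = tyCase (unpair₁ m) refl p
  where
  ctx = L ∷ i ∷ m ∷ n ∷ h1 ∷ h2 ∷ h3 ∷ []
  tyCase : ∀ t → unpair₁ m ≡ t → Truthy (typingRuleCase (unpair₁ m) X ctx) → TypingClaim m n
  tyCase t e q with subst (λ w → Truthy (typingRuleCase w X ctx)) e q
  tyCase 0 e q | q' = Z , sym (truthy-≐⁻ v2 (lit ⟨ 0 , 0 ⟩) X ctx q')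
  tyCase 1 e q | q' = subst (TypingClaim m) (sym (truthy-≐⁻ v3 (lit 1) X ctx (proj₂ (truthy-∧ₑ⁻ succShape unaryArity X ctx q'))))
                        (S , sym (truthy-≐⁻ v2 (lit ⟨ 1 , 0 ⟩) X ctx (proj₁ (truthy-∧ₑ⁻ succShape unaryArity X ctx q'))))
  tyCase 2 e q | q' = subst (TypingClaim m) (sym (truthy-≐⁻ v3 (lit 1) X ctx (proj₂ (truthy-∧ₑ⁻ queryShape unaryArity X ctx q'))))
                        (O , sym (truthy-≐⁻ v2 (lit ⟨ 2 , 0 ⟩) X ctx (proj₁ (truthy-∧ₑ⁻ queryShape unaryArity X ctx q'))))
  tyCase 3 e q | q' = P (fromℕ< lt) ,
      trans (cong (λ a → ⟨ 3 , a ⟩) (toℕ-fromℕ< lt)) (sym (truthy-≐⁻ v2 ⟪ lit 3 , v4 ⟫ X ctx (proj₁ (truthy-∧ₑ⁻ projShape projInRange X ctx q'))))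
    where
    lt : h1 < n
    lt = truthy-<ᵇ⁻ h1 n (proj₂ (truthy-∧ₑ⁻ projShape projInRange X ctx q'))
  tyCase 4 e q | q' = comp (proj₁ F) (proj₁ GS) ,
      trans (cong₂ (λ a b → ⟨ 4 , ⟨ h1 , ⟨ a , b ⟩ ⟩ ⟩) (proj₂ F) (proj₂ GS))
            (sym (truthy-≐⁻ v2 ⟪ lit 4 , ⟪ v4 , ⟪ v5 , v6 ⟫ ⟫ ⟫ X ctx qa))
    where
    qa = proj₁ (truthy-∧ₑ⁻ compShape (compOuterTyped ∧ₑ compInnerTyped ∧ₑ compListEnds) X ctx q')
    qr = proj₂ (truthy-∧ₑ⁻ compShape (compOuterTyped ∧ₑ compInnerTyped ∧ₑ compListEnds) X ctx q')
    qb = proj₁ (truthy-∧ₑ⁻ compOuterTyped (compInnerTyped ∧ₑ compListEnds) X ctx qr)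
    qr' = proj₂ (truthy-∧ₑ⁻ compOuterTyped (compInnerTyped ∧ₑ compListEnds) X ctx qr)
    qc = proj₁ (truthy-∧ₑ⁻ compInnerTyped compListEnds X ctx qr')
    qd = proj₂ (truthy-∧ₑ⁻ compInnerTyped compListEnds X ctx qr')
    F = hasTyping-sound X L i h2 h1 pr qb
    GS = typed-code-list X L i n pr h1 h3 (λ t t<h → allBelow-elim _ h1 qc t t<h) (truthy-≐⁻ (dropCodesₑ v6 v4) (lit 0) X ctx qd)
  tyCase 5 e q | q' = typing-prec n m h1 h2 (truthy-≐⁻ v2 ⟪ lit 5 , ⟪ v4 , v5 ⟫ ⟫ X ctx qa)
                        (truthy-<ᵇ⁻ 0 n qb) (hasTyping-sound X L i h1 (n ∸ 1) pr qc) (hasTyping-sound X L i h2 (1 + n) pr qd)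
    where
    qa = proj₁ (truthy-∧ₑ⁻ precShape (precPositiveArity ∧ₑ precBaseTyped ∧ₑ precStepTyped) X ctx q')
    qr = proj₂ (truthy-∧ₑ⁻ precShape (precPositiveArity ∧ₑ precBaseTyped ∧ₑ precStepTyped) X ctx q')
    qb = proj₁ (truthy-∧ₑ⁻ precPositiveArity (precBaseTyped ∧ₑ precStepTyped) X ctx qr)
    qr' = proj₂ (truthy-∧ₑ⁻ precPositiveArity (precBaseTyped ∧ₑ precStepTyped) X ctx qr)
    qc = proj₁ (truthy-∧ₑ⁻ precBaseTyped precStepTyped X ctx qr')
    qd = proj₂ (truthy-∧ₑ⁻ precBaseTyped precStepTyped X ctx qr')
  tyCase 6 e q | q' = mu (proj₁ F) , trans (cong (λ a → ⟨ 6 , a ⟩) (proj₂ F))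
                        (sym (truthy-≐⁻ v2 ⟪ lit 6 , v4 ⟫ X ctx (proj₁ (truthy-∧ₑ⁻ muShape muBodyTyped X ctx q'))))
    where
    F = hasTyping-sound X L i h1 (1 + n) pr (proj₂ (truthy-∧ₑ⁻ muShape muBodyTyped X ctx q'))
  tyCase (suc (suc (suc (suc (suc (suc (suc t))))))) e q | ()

evalClaim-sound : ∀ X L i m xs y h → SoundBefore X L i → Truthy (⟦ evalRule ⟧ X (L ∷ i ∷ m ∷ xs ∷ y ∷ h ∷ [])) → EvalClaim X m xs y
evalClaim-sound X L i m xs y h pr p c e =
  evalRule-sound X L i xs y h pr (unpair₁ xs) refl c (subst (λ w → Truthy (⟦ evalRule ⟧ X (L ∷ i ∷ w ∷ xs ∷ y ∷ h ∷ []))) (sym e) p)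

entryRuleCase : ℕ → Oracle → ℕ → ℕ → ℕ
entryRuleCase t X L i = if nonzero (χ (t ≡ᵇ 0))
   then ⟦ evalRule ⟧ X (L ∷ i ∷ entry (entry L i) 1 ∷ entry (entry L i) 2 ∷ entry (entry L i) 3 ∷ entry (entry L i) 4 ∷ [])
   else (if nonzero (χ (t ≡ᵇ 1))
   then ⟦ typingRule ⟧ X (L ∷ i ∷ entry (entry L i) 1 ∷ entry (entry L i) 2 ∷ entry (entry L i) 3 ∷ entry (entry L i) 4 ∷ entry (entry L i) 5 ∷ [])
   else 0)

entryRule-sound : ∀ X L i → SoundBefore X L i → Truthy (⟦ entryRule ⟧ X (L ∷ i ∷ [])) → SoundEntry X L i
entryRule-sound X L i pr p =
  (λ k0 → evalClaim-sound X L i _ _ _ _ pr (subst (λ t → Truthy (entryRuleCase t X L i)) k0 p)) ,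
  (λ k1 → typingRule-sound X L i _ _ _ _ _ pr (subst (λ t → Truthy (entryRuleCase t X L i)) k1 p))

certificate-sound : ∀ X z → Truthy (⟦ certificateRule ⟧ X (z ∷ [])) → ∀ i → i < unpair₁ z → SoundEntry X (unpair₂ z) i
certificate-sound X z p = go (unpair₁ z) ≤-refl
  where
  go : ∀ n → n ≤ unpair₁ z → ∀ i → i < n → SoundEntry X (unpair₂ z) i
  go (suc n) n≤ i (s≤s i≤n) with m≤n⇒m<n∨m≡n i≤n
  ... | inj₁ i<n = go n (≤-trans (n≤1+n n) n≤) i i<n
  ... | inj₂ refl = entryRule-sound X (unpair₂ z) i (go i (≤-trans (n≤1+n i) n≤))
                      (allBelow-elim _ (unpair₁ z) p i n≤)

-- Completeness of certificates

nestVec : ∀ {k} → Vec ℕ k → ℕ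
nestVec [] = 0
nestVec (x ∷ xs) = ⟨ x , nestVec xs ⟩

encodeArgs : ∀ {k} → Vec ℕ k → ℕ
encodeArgs {k} xs = ⟨ k , nestVec xs ⟩

nestList : List ℕ → ℕ
nestList [] = 0
nestList (x ∷ xs) = ⟨ x , nestList xs ⟩

lookupOr0 : List ℕ → ℕ → ℕ
lookupOr0 [] j = 0
lookupOr0 (x ∷ xs) zero = x
lookupOr0 (x ∷ xs) (suc j) = lookupOr0 xs j

entry-zero : ∀ a b → entry ⟨ a , b ⟩ 0 ≡ a
entry-zero a b = unpair₁-pair a b

entry-suc : ∀ a b j → entry ⟨ a , b ⟩ (suc j) ≡ entry b j
entry-suc a b j = cong unpair₁ (trans (dropₙ-suc ⟨ a , b ⟩ j) (cong (λ w → dropₙ w j) (unpair₂-pair a b)))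

entry-nestList : ∀ es j → entry (nestList es) j ≡ lookupOr0 es j ⊎ length es ≤ j
entry-nestList [] j = inj₂ z≤n
entry-nestList (x ∷ es) zero = inj₁ (entry-zero x (nestList es))
entry-nestList (x ∷ es) (suc j) with entry-nestList es j
... | inj₁ e = inj₁ (trans (entry-suc x (nestList es) j) e)
... | inj₂ l = inj₂ (s≤s l)

entry-nestList-< : ∀ es j → j < length es → entry (nestList es) j ≡ lookupOr0 es j
entry-nestList-< es j j< with entry-nestList es j
... | inj₁ e = e
... | inj₂ l = ⊥-elim (<-irrefl refl (≤-trans j< l))

decodeArgs-nestVec : ∀ {k} (xs : Vec ℕ k) → decodeArgs k (nestVec xs) ≡ xs
decodeArgs-nestVec [] = refl
decodeArgs-nestVec (x ∷ xs) = cong₂ _∷_ (unpair₁-pair x (nestVec xs)) (trans (cong (decodeArgs _) (unpair₂-pair x (nestVec xs))) (decodeArgs-nestVec xs))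

evalEntry : ℕ → ℕ → ℕ → ℕ → ℕ
evalEntry m xs y h = ⟨ 0 , ⟨ m , ⟨ xs , ⟨ y , ⟨ h , 0 ⟩ ⟩ ⟩ ⟩ ⟩

typingEntry : ℕ → ℕ → ℕ → ℕ → ℕ → ℕ
typingEntry m n h1 h2 h3 = ⟨ 1 , ⟨ m , ⟨ n , ⟨ h1 , ⟨ h2 , ⟨ h3 , 0 ⟩ ⟩ ⟩ ⟩ ⟩ ⟩

evalEntry₀ : ∀ m xs y h → entry (evalEntry m xs y h) 0 ≡ 0
evalEntry₀ m xs y h = entry-nestList-< (0 ∷ m ∷ xs ∷ y ∷ h ∷ []) 0 (s≤s z≤n)
evalEntry₁ : ∀ m xs y h → entry (evalEntry m xs y h) 1 ≡ m
evalEntry₁ m xs y h = entry-nestList-< (0 ∷ m ∷ xs ∷ y ∷ h ∷ []) 1 (s≤s (s≤s z≤n))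
evalEntry₂ : ∀ m xs y h → entry (evalEntry m xs y h) 2 ≡ xs
evalEntry₂ m xs y h = entry-nestList-< (0 ∷ m ∷ xs ∷ y ∷ h ∷ []) 2 (s≤s (s≤s (s≤s z≤n)))
evalEntry₃ : ∀ m xs y h → entry (evalEntry m xs y h) 3 ≡ y
evalEntry₃ m xs y h = entry-nestList-< (0 ∷ m ∷ xs ∷ y ∷ h ∷ []) 3 (s≤s (s≤s (s≤s (s≤s z≤n))))
evalEntry₄ : ∀ m xs y h → entry (evalEntry m xs y h) 4 ≡ h
evalEntry₄ m xs y h = entry-nestList-< (0 ∷ m ∷ xs ∷ y ∷ h ∷ []) 4 (s≤s (s≤s (s≤s (s≤s (s≤s z≤n)))))

typingEntry₀ : ∀ m n a b c → entry (typingEntry m n a b c) 0 ≡ 1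
typingEntry₀ m n a b c = entry-nestList-< (1 ∷ m ∷ n ∷ a ∷ b ∷ c ∷ []) 0 (s≤s z≤n)
typingEntry₁ : ∀ m n a b c → entry (typingEntry m n a b c) 1 ≡ m
typingEntry₁ m n a b c = entry-nestList-< (1 ∷ m ∷ n ∷ a ∷ b ∷ c ∷ []) 1 (s≤s (s≤s z≤n))
typingEntry₂ : ∀ m n a b c → entry (typingEntry m n a b c) 2 ≡ n
typingEntry₂ m n a b c = entry-nestList-< (1 ∷ m ∷ n ∷ a ∷ b ∷ c ∷ []) 2 (s≤s (s≤s (s≤s z≤n)))
typingEntry₃ : ∀ m n a b c → entry (typingEntry m n a b c) 3 ≡ a
typingEntry₃ m n a b c = entry-nestList-< (1 ∷ m ∷ n ∷ a ∷ b ∷ c ∷ []) 3 (s≤s (s≤s (s≤s (s≤s z≤n))))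
typingEntry₄ : ∀ m n a b c → entry (typingEntry m n a b c) 4 ≡ b
typingEntry₄ m n a b c = entry-nestList-< (1 ∷ m ∷ n ∷ a ∷ b ∷ c ∷ []) 4 (s≤s (s≤s (s≤s (s≤s (s≤s z≤n)))))
typingEntry₅ : ∀ m n a b c → entry (typingEntry m n a b c) 5 ≡ c
typingEntry₅ m n a b c = entry-nestList-< (1 ∷ m ∷ n ∷ a ∷ b ∷ c ∷ []) 5 (s≤s (s≤s (s≤s (s≤s (s≤s (s≤s z≤n))))))

truthy-∧⁺ : ∀ {a b : Bool} → a ≡ true → b ≡ true → Truthy (χ (a ∧ b))
truthy-∧⁺ refl refl = refl

truthy-≡ᵇ⁺ : ∀ {a b} → a ≡ b → Truthy (χ (a ≡ᵇ b))
truthy-≡ᵇ⁺ {a} refl = trans (nonzero-χ _) (≡ᵇ-refl a)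

truthy-<ᵇ⁺ : ∀ {a b} → a < b → Truthy (χ (a <ᵇ b))
truthy-<ᵇ⁺ p = trans (nonzero-χ _) (<⇒<ᵇ≡true p)

hasEval-intro : ∀ X L i m xs y j h → j < i → entry L j ≡ evalEntry m xs y h → Truthy (⟦ hasEvalExpr ⟧ X (L ∷ i ∷ m ∷ xs ∷ y ∷ []))
hasEval-intro X L i m xs y j h j<i e = anyBelow-intro _ j i j<i
  (truthy-∧⁺ (truthy-≡ᵇ⁺ (trans (cong (λ w → entry w 0) e) (evalEntry₀ m xs y h)))
  (truthy-∧⁺ (truthy-≡ᵇ⁺ (trans (cong (λ w → entry w 1) e) (evalEntry₁ m xs y h)))
  (truthy-∧⁺ (truthy-≡ᵇ⁺ (trans (cong (λ w → entry w 2) e) (evalEntry₂ m xs y h)))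
        (truthy-≡ᵇ⁺ (trans (cong (λ w → entry w 3) e) (evalEntry₃ m xs y h))))))

hasNonzeroEval-intro : ∀ X L i m xs y j h → j < i → entry L j ≡ evalEntry m xs (suc y) h → Truthy (⟦ hasNonzeroEvalExpr ⟧ X (L ∷ i ∷ m ∷ xs ∷ []))
hasNonzeroEval-intro X L i m xs y j h j<i e = anyBelow-intro _ j i j<i
  (truthy-∧⁺ (truthy-≡ᵇ⁺ (trans (cong (λ w → entry w 0) e) (evalEntry₀ m xs (suc y) h)))
  (truthy-∧⁺ (truthy-≡ᵇ⁺ (trans (cong (λ w → entry w 1) e) (evalEntry₁ m xs (suc y) h)))
  (truthy-∧⁺ (truthy-≡ᵇ⁺ (trans (cong (λ w → entry w 2) e) (evalEntry₂ m xs (suc y) h)))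
        (subst (λ w → Truthy (χ (not (nonzero (χ (w ≡ᵇ 0)))))) (sym (trans (cong (λ w → entry w 3) e) (evalEntry₃ m xs (suc y) h))) refl))))

hasSomeEval-intro : ∀ X L i m xs y j h → j < i → entry L j ≡ evalEntry m xs y h → Truthy (⟦ hasSomeEvalExpr ⟧ X (L ∷ i ∷ m ∷ xs ∷ []))
hasSomeEval-intro X L i m xs y j h j<i e = anyBelow-intro _ j i j<i
  (truthy-∧⁺ (truthy-≡ᵇ⁺ (trans (cong (λ w → entry w 0) e) (evalEntry₀ m xs y h)))
  (truthy-∧⁺ (truthy-≡ᵇ⁺ (trans (cong (λ w → entry w 1) e) (evalEntry₁ m xs y h)))
        (truthy-≡ᵇ⁺ (trans (cong (λ w → entry w 2) e) (evalEntry₂ m xs y h)))))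

hasTyping-intro : ∀ X L i m n j a b c → j < i → entry L j ≡ typingEntry m n a b c → Truthy (⟦ hasTypingExpr ⟧ X (L ∷ i ∷ m ∷ n ∷ []))
hasTyping-intro X L i m n j a b c j<i e = anyBelow-intro _ j i j<i
  (truthy-∧⁺ (truthy-≡ᵇ⁺ (trans (cong (λ w → entry w 0) e) (typingEntry₀ m n a b c)))
  (truthy-∧⁺ (truthy-≡ᵇ⁺ (trans (cong (λ w → entry w 1) e) (typingEntry₁ m n a b c)))
        (truthy-≡ᵇ⁺ (trans (cong (λ w → entry w 2) e) (typingEntry₂ m n a b c)))))

data EntryBefore (es : List ℕ) (i : ℕ) (q : ℕ) : Set where
  entryBefore : ∀ j → j < i → j < length es → lookupOr0 es j ≡ q → EntryBefore es i q

data EvalBefore (es : List ℕ) (i : ℕ) (m xs y : ℕ) : Set where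
  evalBefore : ∀ h → EntryBefore es i (evalEntry m xs y h) → EvalBefore es i m xs y

data NonzeroEvalBefore (es : List ℕ) (i : ℕ) (m xs : ℕ) : Set where
  nonzeroEvalBefore : ∀ y → EvalBefore es i m xs (suc y) → NonzeroEvalBefore es i m xs

data TypingBefore (es : List ℕ) (i : ℕ) (m n : ℕ) : Set where
  typingBefore : ∀ a b c → EntryBefore es i (typingEntry m n a b c) → TypingBefore es i m n

lookupOr0-++ˡ : ∀ es fs j → j < length es → lookupOr0 (es ++ fs) j ≡ lookupOr0 es j
lookupOr0-++ˡ (x ∷ es) fs zero _ = refl
lookupOr0-++ˡ (x ∷ es) fs (suc j) (s≤s p) = lookupOr0-++ˡ es fs j p

lookupOr0-++ʳ : ∀ es fs j → lookupOr0 (es ++ fs) (length es + j) ≡ lookupOr0 fs j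
lookupOr0-++ʳ [] fs j = refl
lookupOr0-++ʳ (x ∷ es) fs j = lookupOr0-++ʳ es fs j

entryBefore-extend : ∀ {es i q} fs → EntryBefore es i q → EntryBefore (es ++ fs) i q
entryBefore-extend {es} fs (entryBefore j j<i j<l e) = entryBefore j j<i (≤-trans j<l (length-++-≤ˡ es)) (trans (lookupOr0-++ˡ es fs j j<l) e)

entryBefore-shift : ∀ {fs i q} es → EntryBefore fs i q → EntryBefore (es ++ fs) (length es + i) q
entryBefore-shift {fs} es (entryBefore j j<i j<l e) = entryBefore (length es + j) (+-monoʳ-< (length es) j<i)
  (subst (length es + j <_) (sym (length-++ es)) (+-monoʳ-< (length es) j<l)) (trans (lookupOr0-++ʳ es fs j) e)

evalBefore-extend : ∀ {es i m xs y} fs → EvalBefore es i m xs y → EvalBefore (es ++ fs) i m xs y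
evalBefore-extend fs (evalBefore h p) = evalBefore h (entryBefore-extend fs p)
evalBefore-shift : ∀ {fs i m xs y} es → EvalBefore fs i m xs y → EvalBefore (es ++ fs) (length es + i) m xs y
evalBefore-shift es (evalBefore h p) = evalBefore h (entryBefore-shift es p)
nonzeroEvalBefore-extend : ∀ {es i m xs} fs → NonzeroEvalBefore es i m xs → NonzeroEvalBefore (es ++ fs) i m xs
nonzeroEvalBefore-extend fs (nonzeroEvalBefore y p) = nonzeroEvalBefore y (evalBefore-extend fs p)
nonzeroEvalBefore-shift : ∀ {fs i m xs} es → NonzeroEvalBefore fs i m xs → NonzeroEvalBefore (es ++ fs) (length es + i) m xs
nonzeroEvalBefore-shift es (nonzeroEvalBefore y p) = nonzeroEvalBefore y (evalBefore-shift es p)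
typingBefore-extend : ∀ {es i m n} fs → TypingBefore es i m n → TypingBefore (es ++ fs) i m n
typingBefore-extend fs (typingBefore a b c p) = typingBefore a b c (entryBefore-extend fs p)
typingBefore-shift : ∀ {fs i m n} es → TypingBefore fs i m n → TypingBefore (es ++ fs) (length es + i) m n
typingBefore-shift es (typingBefore a b c p) = typingBefore a b c (entryBefore-shift es p)

data JustifiedEval (X : Oracle) (es : List ℕ) (i : ℕ) : ∀ {k} → Code k → Vec ℕ k → ℕ → ℕ → Set where
  jZ : ∀ {k} {xs : Vec ℕ k} {h} → JustifiedEval X es i Z xs 0 h
  jS : ∀ {x h} → JustifiedEval X es i S (x ∷ []) (suc x) h
  jO : ∀ {x h} → JustifiedEval X es i O (x ∷ []) (if X x then 1 else 0) h
  jP : ∀ {k} {xs : Vec ℕ k} (j : Fin k) {h} → JustifiedEval X es i (P j) xs (lookup xs j) h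
  jC : ∀ {m k} {f : Code m} {gs : Vec (Code k) m} {xs : Vec ℕ k} {ys : Vec ℕ m} {y} →
       EvalBefore es i (encode f) (encodeArgs ys) y →
       (∀ (t : Fin m) → EvalBefore es i (encode (lookup gs t)) (encodeArgs xs) (lookup ys t)) →
       JustifiedEval X es i (comp f gs) xs y (encodeArgs ys)
  jR0 : ∀ {k} {f : Code k} {g : Code (suc (suc k))} {xs : Vec ℕ k} {y h} →
       EvalBefore es i (encode f) (encodeArgs xs) y → JustifiedEval X es i (prec f g) (0 ∷ xs) y h
  jRS : ∀ {k} {f : Code k} {g : Code (suc (suc k))} {xs : Vec ℕ k} {a z y} →
       EvalBefore es i (encode (prec f g)) (encodeArgs (a ∷ xs)) z →
       EvalBefore es i (encode g) (encodeArgs (a ∷ z ∷ xs)) y → JustifiedEval X es i (prec f g) (suc a ∷ xs) y z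
  jM : ∀ {k} {f : Code (suc k)} {xs : Vec ℕ k} {y h} →
       EvalBefore es i (encode f) (encodeArgs (y ∷ xs)) 0 →
       (∀ t → t < y → NonzeroEvalBefore es i (encode f) (encodeArgs (t ∷ xs))) → JustifiedEval X es i (mu f) xs y h

justifiedEval-extend : ∀ {X es i k} {c : Code k} {xs y h} fs → JustifiedEval X es i c xs y h → JustifiedEval X (es ++ fs) i c xs y h
justifiedEval-extend fs jZ = jZ
justifiedEval-extend fs jS = jS
justifiedEval-extend fs jO = jO
justifiedEval-extend fs (jP j) = jP j
justifiedEval-extend fs (jC {ys = ys} a b) = jC {ys = ys} (evalBefore-extend fs a) (λ t → evalBefore-extend fs (b t))
justifiedEval-extend fs (jR0 a) = jR0 (evalBefore-extend fs a)
justifiedEval-extend fs (jRS a b) = jRS (evalBefore-extend fs a) (evalBefore-extend fs b)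
justifiedEval-extend fs (jM a b) = jM (evalBefore-extend fs a) (λ t t< → nonzeroEvalBefore-extend fs (b t t<))

justifiedEval-shift : ∀ {X fs i k} {c : Code k} {xs y h} es → JustifiedEval X fs i c xs y h → JustifiedEval X (es ++ fs) (length es + i) c xs y h
justifiedEval-shift es jZ = jZ
justifiedEval-shift es jS = jS
justifiedEval-shift es jO = jO
justifiedEval-shift es (jP j) = jP j
justifiedEval-shift es (jC {ys = ys} a b) = jC {ys = ys} (evalBefore-shift es a) (λ t → evalBefore-shift es (b t))
justifiedEval-shift es (jR0 a) = jR0 (evalBefore-shift es a)
justifiedEval-shift es (jRS a b) = jRS (evalBefore-shift es a) (evalBefore-shift es b)
justifiedEval-shift es (jM a b) = jM (evalBefore-shift es a) (λ t t< → nonzeroEvalBefore-shift es (b t t<))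

typingHint₁ typingHint₂ typingHint₃ : ∀ {n} → Code n → ℕ
typingHint₁ (P j) = toℕ j
typingHint₁ (comp {m} f gs) = m
typingHint₁ (prec f g) = encode f
typingHint₁ (mu f) = encode f
typingHint₁ _ = 0
typingHint₂ (comp f gs) = encode f
typingHint₂ (prec f g) = encode g
typingHint₂ _ = 0
typingHint₃ (comp f gs) = encodeVec gs
typingHint₃ _ = 0

typingEntryOf : ∀ {n} → Code n → ℕ
typingEntryOf {n} c = typingEntry (encode c) n (typingHint₁ c) (typingHint₂ c) (typingHint₃ c)

data JustifiedTyping (es : List ℕ) (i : ℕ) : ∀ {n} → Code n → Set where
  tZ : ∀ {n} → JustifiedTyping es i (Z {n})
  tS : JustifiedTyping es i S
  tO : JustifiedTyping es i O
  tP : ∀ {n} (j : Fin n) → JustifiedTyping es i (P j)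
  tC : ∀ {m n} {f : Code m} {gs : Vec (Code n) m} → TypingBefore es i (encode f) m →
       (∀ (t : Fin m) → TypingBefore es i (encode (lookup gs t)) n) → JustifiedTyping es i (comp f gs)
  tR : ∀ {n} {f : Code n} {g : Code (suc (suc n))} → TypingBefore es i (encode f) n →
       TypingBefore es i (encode g) (suc (suc n)) → JustifiedTyping es i (prec f g)
  tM : ∀ {n} {f : Code (suc n)} → TypingBefore es i (encode f) (suc n) → JustifiedTyping es i (mu f)

justifiedTyping-extend : ∀ {es i n} {c : Code n} fs → JustifiedTyping es i c → JustifiedTyping (es ++ fs) i c
justifiedTyping-extend fs tZ = tZ
justifiedTyping-extend fs tS = tS
justifiedTyping-extend fs tO = tO
justifiedTyping-extend fs (tP j) = tP j
justifiedTyping-extend fs (tC a b) = tC (typingBefore-extend fs a) (λ t → typingBefore-extend fs (b t))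
justifiedTyping-extend fs (tR a b) = tR (typingBefore-extend fs a) (typingBefore-extend fs b)
justifiedTyping-extend fs (tM a) = tM (typingBefore-extend fs a)

justifiedTyping-shift : ∀ {fs i n} {c : Code n} es → JustifiedTyping fs i c → JustifiedTyping (es ++ fs) (length es + i) c
justifiedTyping-shift es tZ = tZ
justifiedTyping-shift es tS = tS
justifiedTyping-shift es tO = tO
justifiedTyping-shift es (tP j) = tP j
justifiedTyping-shift es (tC a b) = tC (typingBefore-shift es a) (λ t → typingBefore-shift es (b t))
justifiedTyping-shift es (tR a b) = tR (typingBefore-shift es a) (typingBefore-shift es b)
justifiedTyping-shift es (tM a) = tM (typingBefore-shift es a)

JustifiedEntry : Oracle → List ℕ → ℕ → Set
JustifiedEntry X es i =
  (Σ ℕ λ k → Σ (Code k) λ c → Σ (Vec ℕ k) λ xs → Σ ℕ λ y → Σ ℕ λ h →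
     lookupOr0 es i ≡ evalEntry (encode c) (encodeArgs xs) y h × JustifiedEval X es i c xs y h) ⊎
  (Σ ℕ λ n → Σ (Code n) λ c → lookupOr0 es i ≡ typingEntryOf c × JustifiedTyping es i c)

AllJustified : Oracle → List ℕ → Set
AllJustified X es = ∀ i → i < length es → JustifiedEntry X es i

allJustified-++ : ∀ {X} es fs → AllJustified X es → AllJustified X fs → AllJustified X (es ++ fs)
allJustified-++ {X} es fs A B i i< with i <? length es
... | yes p = case (A i p)
  where
  case : JustifiedEntry X es i → JustifiedEntry X (es ++ fs) i
  case (inj₁ (k , c , xs , y , h , e , J)) = inj₁ (k , c , xs , y , h , trans (lookupOr0-++ˡ es fs i p) e , justifiedEval-extend fs J)
  case (inj₂ (n , c , e , J)) = inj₂ (n , c , trans (lookupOr0-++ˡ es fs i p) e , justifiedTyping-extend fs J)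
... | no ¬p = subst (JustifiedEntry X (es ++ fs)) (m+[n∸m]≡n (≮⇒≥ ¬p)) (case (B (i ∸ length es) lt))
  where
  lt : i ∸ length es < length fs
  lt = subst (i ∸ length es <_) (m+n∸m≡n (length es) (length fs))
         (∸-monoˡ-< (subst (i <_) (length-++ es) i<) (≮⇒≥ ¬p))
  j = i ∸ length es
  case : JustifiedEntry X fs j → JustifiedEntry X (es ++ fs) (length es + j)
  case (inj₁ (k , c , xs , y , h , e , J)) = inj₁ (k , c , xs , y , h , trans (lookupOr0-++ʳ es fs j) e , justifiedEval-shift es J)
  case (inj₂ (n , c , e , J)) = inj₂ (n , c , trans (lookupOr0-++ʳ es fs j) e , justifiedTyping-shift es J)

truthy-∧ₑ⁺ : ∀ {n} (e1 e2 : Expr n) X xs → Truthy (⟦ e1 ⟧ X xs) → Truthy (⟦ e2 ⟧ X xs) → Truthy (⟦ e1 ∧ₑ e2 ⟧ X xs)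
truthy-∧ₑ⁺ e1 e2 X xs p q = truthy-∧⁺ p q

hasEval-from : ∀ X {es i m xs y} → EvalBefore es i m xs y → ∀ {m' xs' y'} → m' ≡ m → xs' ≡ xs → y' ≡ y →
  Truthy (⟦ hasEvalExpr ⟧ X (nestList es ∷ i ∷ m' ∷ xs' ∷ y' ∷ []))
hasEval-from X {es} {i} {m} {xs} {y} (evalBefore h (entryBefore j j<i j<l e)) refl refl refl =
  hasEval-intro X (nestList es) i m xs y j h j<i (trans (entry-nestList-< es j j<l) e)

hasNonzeroEval-from : ∀ X {es i m xs} → NonzeroEvalBefore es i m xs → ∀ {m' xs'} → m' ≡ m → xs' ≡ xs →
  Truthy (⟦ hasNonzeroEvalExpr ⟧ X (nestList es ∷ i ∷ m' ∷ xs' ∷ []))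
hasNonzeroEval-from X {es} {i} {m} {xs} (nonzeroEvalBefore y (evalBefore h (entryBefore j j<i j<l e))) refl refl =
  hasNonzeroEval-intro X (nestList es) i m xs y j h j<i (trans (entry-nestList-< es j j<l) e)

hasTyping-from : ∀ X {es i m n} → TypingBefore es i m n → ∀ {m' n'} → m' ≡ m → n' ≡ n →
  Truthy (⟦ hasTypingExpr ⟧ X (nestList es ∷ i ∷ m' ∷ n' ∷ []))
hasTyping-from X {es} {i} {m} {n} (typingBefore a b c (entryBefore j j<i j<l e)) refl refl =
  hasTyping-intro X (nestList es) i m n j a b c j<i (trans (entry-nestList-< es j j<l) e)

unpair₁-encodeArgs : ∀ {k} (xs : Vec ℕ k) → unpair₁ (encodeArgs xs) ≡ k
unpair₁-encodeArgs {k} xs = unpair₁-pair k (nestVec xs)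

unpair₂-encodeArgs : ∀ {k} (xs : Vec ℕ k) → unpair₂ (encodeArgs xs) ≡ nestVec xs
unpair₂-encodeArgs {k} xs = unpair₂-pair k (nestVec xs)

encodeArgs-entry : ∀ {k} (xs : Vec ℕ k) (j : Fin k) → entry (unpair₂ (encodeArgs xs)) (toℕ j) ≡ lookup xs j
encodeArgs-entry {k} xs j = trans (cong (λ w → entry w (toℕ j)) (unpair₂-encodeArgs xs))
  (trans (sym (lookup-decodeArgs k (nestVec xs) j)) (cong (λ w → lookup w j) (decodeArgs-nestVec xs)))

encodeArgs-head : ∀ {k} x (xs : Vec ℕ k) → entry (unpair₂ (encodeArgs (x ∷ xs))) 0 ≡ x
encodeArgs-head x xs = encodeArgs-entry (x ∷ xs) zero

tailArgs-encodeArgs : ∀ {k} x (xs : Vec ℕ k) → tailArgs (encodeArgs (x ∷ xs)) ≡ encodeArgs xs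
tailArgs-encodeArgs {k} x xs = cong₂ ⟨_,_⟩ (cong (_∸ 1) (unpair₁-encodeArgs (x ∷ xs)))
  (trans (cong unpair₂ (unpair₂-encodeArgs (x ∷ xs))) (unpair₂-pair x (nestVec xs)))

consArgs-encodeArgs : ∀ {k} a (xs : Vec ℕ k) → consArgs a (encodeArgs xs) ≡ encodeArgs (a ∷ xs)
consArgs-encodeArgs {k} a xs = cong₂ (λ u w → ⟨ 1 + u , ⟨ a , w ⟩ ⟩) (unpair₁-encodeArgs xs) (unpair₂-encodeArgs xs)

dropCodes-lookup : ∀ {n m} (gs : Vec (Code n) m) t (t<m : t < m) →
  Σ ℕ λ W → dropCodes (encodeVec gs) t ≡ suc ⟨ encode (lookup gs (fromℕ< t<m)) , W ⟩
dropCodes-lookup (g ∷ gs) zero t<m = encodeVec gs , refl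
dropCodes-lookup (g ∷ gs) (suc t) (s≤s t<m) with dropCodes-lookup gs t t<m
... | W , e = W , trans (trans (dropCodes-suc (encodeVec (g ∷ gs)) t)
                  (cong (λ w → dropCodes w t) (unpair₂-pair (encode g) (encodeVec gs)))) e

dropCodes-end : ∀ {n m} (gs : Vec (Code n) m) → dropCodes (encodeVec gs) m ≡ 0
dropCodes-end [] = refl
dropCodes-end {m = suc m} (g ∷ gs) = trans (trans (dropCodes-suc (encodeVec (g ∷ gs)) m)
                  (cong (λ w → dropCodes w m) (unpair₂-pair (encode g) (encodeVec gs)))) (dropCodes-end gs)

dropCodes-code : ∀ {n m} (gs : Vec (Code n) m) t (t<m : t < m) →
  unpair₁ (dropCodes (encodeVec gs) t ∸ 1) ≡ encode (lookup gs (fromℕ< t<m))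
dropCodes-code gs t t<m with dropCodes-lookup gs t t<m
... | W , e = trans (cong (λ w → unpair₁ (w ∸ 1)) e) (unpair₁-pair _ W)

encodeArgs-entry-< : ∀ {m} (ys : Vec ℕ m) t (t<m : t < m) → entry (unpair₂ (encodeArgs ys)) t ≡ lookup ys (fromℕ< t<m)
encodeArgs-entry-< ys t t<m = trans (cong (entry (unpair₂ (encodeArgs ys))) (sym (toℕ-fromℕ< t<m))) (encodeArgs-entry ys (fromℕ< t<m))

evalRule-complete : ∀ X es i {k} (c : Code k) (xs : Vec ℕ k) y h → JustifiedEval X es i c xs y h →
  Truthy (⟦ evalRule ⟧ X (nestList es ∷ i ∷ encode c ∷ encodeArgs xs ∷ y ∷ h ∷ []))
evalRule-complete X es i {k} Z xs y h jZ =
  subst Truthy (sym (evalRule-case X (nestList es) i (encode (Z {k})) (encodeArgs xs) 0 h (unpair₁-pair 0 0))) refl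
evalRule-complete X es i S (x ∷ []) .(suc x) h jS =
  subst Truthy (sym (evalRule-case X (nestList es) i (encode S) (encodeArgs (x ∷ [])) (suc x) h (unpair₁-pair 1 0)))
    (truthy-≡ᵇ⁺ (cong suc (sym (encodeArgs-head x []))))
evalRule-complete X es i O (x ∷ []) _ h jO =
  subst Truthy (sym (evalRule-case X (nestList es) i (encode O) (encodeArgs (x ∷ [])) _ h (unpair₁-pair 2 0)))
    (truthy-≡ᵇ⁺ (cong (λ a → if X a then 1 else 0) (sym (encodeArgs-head x []))))
evalRule-complete X es i (P j) xs _ h (jP .j) =
  subst Truthy (sym (evalRule-case X (nestList es) i (encode (P j)) (encodeArgs xs) _ h (unpair₁-pair 3 (toℕ j))))
    (truthy-≡ᵇ⁺ (sym (trans (cong (entry (unpair₂ (encodeArgs xs))) (unpair₂-pair 3 (toℕ j))) (encodeArgs-entry xs j))))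
evalRule-complete X es i (comp {m} f gs) xs y .(encodeArgs ys) (jC {ys = ys} a b) =
  subst Truthy (sym (evalRule-case X L i M (encodeArgs xs) y (encodeArgs ys) (unpair₁-pair 4 Wc)))
    (truthy-∧ₑ⁺ compArity (compOuter ∧ₑ compInner) X ctx (truthy-≡ᵇ⁺ (trans (unpair₁-encodeArgs ys) (sym e1)))
      (truthy-∧ₑ⁺ compOuter compInner X ctx (hasEval-from X a e2 refl refl)
        (allBelow-intro _ (unpair₁ (unpair₂ M))
           (λ t t<m → let t<m' = subst (t <_) e1 t<m in
              hasEval-from X (b (fromℕ< t<m'))
                (trans (cong (λ w → unpair₁ (dropCodes w t ∸ 1)) eG) (dropCodes-code gs t t<m')) refl (encodeArgs-entry-< ys t t<m')))))
  where
  L = nestList es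
  M = encode (comp f gs)
  ctx = L ∷ i ∷ M ∷ encodeArgs xs ∷ y ∷ encodeArgs ys ∷ []
  Wc = ⟨ m , ⟨ encode f , encodeVec gs ⟩ ⟩
  Wf = ⟨ encode f , encodeVec gs ⟩
  e0 : unpair₂ M ≡ Wc
  e0 = unpair₂-pair 4 Wc
  e1 : unpair₁ (unpair₂ M) ≡ m
  e1 = trans (cong unpair₁ e0) (unpair₁-pair m Wf)
  e2 : unpair₁ (unpair₂ (unpair₂ M)) ≡ encode f
  e2 = trans (cong (λ w → unpair₁ (unpair₂ w)) e0) (trans (cong unpair₁ (unpair₂-pair m Wf)) (unpair₁-pair (encode f) (encodeVec gs)))
  eG : unpair₂ (unpair₂ (unpair₂ M)) ≡ encodeVec gs
  eG = trans (cong (λ w → unpair₂ (unpair₂ w)) e0) (trans (cong unpair₂ (unpair₂-pair m Wf)) (unpair₂-pair (encode f) (encodeVec gs)))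
evalRule-complete X es i (prec f g) (.0 ∷ xs) y h (jR0 a) =
  subst Truthy (sym (evalRule-case X L i M (encodeArgs (0 ∷ xs)) y h (unpair₁-pair 5 Wc)))
    (subst (λ t → Truthy (if nonzero (χ (t ≡ᵇ 0)) then ⟦ precZeroRule ⟧ X ctx else ⟦ precSucPrevious ∧ₑ precSucStep ⟧ X ctx))
       (sym (encodeArgs-head 0 xs))
       (hasEval-from X a (trans (cong unpair₁ e0) (unpair₁-pair (encode f) (encode g))) (tailArgs-encodeArgs 0 xs) refl))
  where
  L = nestList es
  M = encode (prec f g)
  ctx = L ∷ i ∷ M ∷ encodeArgs (0 ∷ xs) ∷ y ∷ h ∷ []
  Wc = ⟨ encode f , encode g ⟩
  e0 : unpair₂ M ≡ Wc
  e0 = unpair₂-pair 5 Wc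
evalRule-complete X es i (prec f g) (.(suc a') ∷ xs) y z (jRS {a = a'} a b) =
  subst Truthy (sym (evalRule-case X L i M (encodeArgs (suc a' ∷ xs)) y z (unpair₁-pair 5 Wc)))
    (subst (λ t → Truthy (if nonzero (χ (t ≡ᵇ 0)) then ⟦ precZeroRule ⟧ X ctx else ⟦ precSucPrevious ∧ₑ precSucStep ⟧ X ctx))
       (sym (encodeArgs-head (suc a') xs))
       (truthy-∧ₑ⁺ precSucPrevious precSucStep X ctx
          (hasEval-from X a refl (trans (cong₂ consArgs ea (tailArgs-encodeArgs (suc a') xs)) (consArgs-encodeArgs a' xs)) refl)
          (hasEval-from X b (trans (cong unpair₂ e0) (unpair₂-pair (encode f) (encode g)))
             (trans (cong₂ consArgs ea (trans (cong (consArgs z) (tailArgs-encodeArgs (suc a') xs)) (consArgs-encodeArgs z xs)))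
                    (consArgs-encodeArgs a' (z ∷ xs))) refl)))
  where
  L = nestList es
  M = encode (prec f g)
  ctx = L ∷ i ∷ M ∷ encodeArgs (suc a' ∷ xs) ∷ y ∷ z ∷ []
  Wc = ⟨ encode f , encode g ⟩
  e0 : unpair₂ M ≡ Wc
  e0 = unpair₂-pair 5 Wc
  ea : entry (unpair₂ (encodeArgs (suc a' ∷ xs))) 0 ∸ 1 ≡ a'
  ea = cong (_∸ 1) (encodeArgs-head (suc a') xs)
evalRule-complete X es i (mu f) xs y h (jM a b) =
  subst Truthy (sym (evalRule-case X L i M (encodeArgs xs) y h (unpair₁-pair 6 (encode f))))
    (truthy-∧ₑ⁺ muZero muBelow X ctx (hasEval-from X a ef (consArgs-encodeArgs y xs) refl)
       (allBelow-intro _ y (λ t t<y → hasNonzeroEval-from X (b t t<y) ef (consArgs-encodeArgs t xs))))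
  where
  L = nestList es
  M = encode (mu f)
  ctx = L ∷ i ∷ M ∷ encodeArgs xs ∷ y ∷ h ∷ []
  ef : unpair₂ M ≡ encode f
  ef = unpair₂-pair 6 (encode f)

typingRule-complete : ∀ X es i {n} (c : Code n) → JustifiedTyping es i c →
  Truthy (⟦ typingRule ⟧ X (nestList es ∷ i ∷ encode c ∷ n ∷ typingHint₁ c ∷ typingHint₂ c ∷ typingHint₃ c ∷ []))
typingRule-complete X es i {n} Z tZ = subst Truthy (sym (cong (λ t → typingRuleCase t X (nestList es ∷ i ∷ encode (Z {n}) ∷ n ∷ 0 ∷ 0 ∷ 0 ∷ [])) (unpair₁-pair 0 0)))
  (truthy-≡ᵇ⁺ {a = encode (Z {n})} refl)
typingRule-complete X es i S tS = subst Truthy (sym (cong (λ t → typingRuleCase t X (nestList es ∷ i ∷ encode S ∷ 1 ∷ 0 ∷ 0 ∷ 0 ∷ [])) (unpair₁-pair 1 0)))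
  (truthy-∧⁺ (truthy-≡ᵇ⁺ {a = encode S} refl) (truthy-≡ᵇ⁺ {a = 1} refl))
typingRule-complete X es i O tO = subst Truthy (sym (cong (λ t → typingRuleCase t X (nestList es ∷ i ∷ encode O ∷ 1 ∷ 0 ∷ 0 ∷ 0 ∷ [])) (unpair₁-pair 2 0)))
  (truthy-∧⁺ (truthy-≡ᵇ⁺ {a = encode O} refl) (truthy-≡ᵇ⁺ {a = 1} refl))
typingRule-complete X es i {n} (P j) (tP .j) =
  subst Truthy (sym (cong (λ t → typingRuleCase t X (nestList es ∷ i ∷ encode (P j) ∷ n ∷ toℕ j ∷ 0 ∷ 0 ∷ [])) (unpair₁-pair 3 (toℕ j))))
  (truthy-∧⁺ (truthy-≡ᵇ⁺ {a = encode (P j)} refl) (truthy-<ᵇ⁺ (toℕ<n j)))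
typingRule-complete X es i {n} (comp {m} f gs) (tC a b) =
  subst Truthy (sym (cong (λ t → typingRuleCase t X ctx) (unpair₁-pair 4 ⟨ m , ⟨ encode f , encodeVec gs ⟩ ⟩)))
    (truthy-∧ₑ⁺ compShape (compOuterTyped ∧ₑ compInnerTyped ∧ₑ compListEnds) X ctx (truthy-≡ᵇ⁺ {a = encode (comp f gs)} refl)
      (truthy-∧ₑ⁺ compOuterTyped (compInnerTyped ∧ₑ compListEnds) X ctx (hasTyping-from X a refl refl)
        (truthy-∧ₑ⁺ compInnerTyped compListEnds X ctx
          (allBelow-intro _ m (λ t t<m →
             truthy-∧⁺ (truthy-≡ᵇ⁺ (body1 t t<m))
                  (hasTyping-from X (b (fromℕ< t<m)) (dropCodes-code gs t t<m) refl)))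
          (truthy-≡ᵇ⁺ (dropCodes-end gs)))))
  where
  ctx = nestList es ∷ i ∷ encode (comp f gs) ∷ n ∷ m ∷ encode f ∷ encodeVec gs ∷ []
  body1 : ∀ t (t<m : t < m) → dropCodes (encodeVec gs) t ≡ 1 + ⟨ unpair₁ (dropCodes (encodeVec gs) t ∸ 1) , unpair₂ (dropCodes (encodeVec gs) t ∸ 1) ⟩
  body1 t t<m with dropCodes-lookup gs t t<m
  ... | W , e rewrite e = cong (λ w → suc w) (sym (cong₂ ⟨_,_⟩ (unpair₁-pair (encode (lookup gs (fromℕ< t<m))) W)
                                                            (unpair₂-pair (encode (lookup gs (fromℕ< t<m))) W)))
typingRule-complete X es i {suc n} (prec f g) (tR a b) =
  subst Truthy (sym (cong (λ t → typingRuleCase t X ctx) (unpair₁-pair 5 ⟨ encode f , encode g ⟩)))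
    (truthy-∧ₑ⁺ precShape (precPositiveArity ∧ₑ precBaseTyped ∧ₑ precStepTyped) X ctx (truthy-≡ᵇ⁺ {a = encode (prec f g)} refl)
      (truthy-∧ₑ⁺ precPositiveArity (precBaseTyped ∧ₑ precStepTyped) X ctx (truthy-<ᵇ⁺ {a = 0} {b = suc n} (s≤s z≤n))
        (truthy-∧ₑ⁺ precBaseTyped precStepTyped X ctx (hasTyping-from X a refl refl) (hasTyping-from X b refl refl))))
  where
  ctx = nestList es ∷ i ∷ encode (prec f g) ∷ suc n ∷ encode f ∷ encode g ∷ 0 ∷ []
typingRule-complete X es i {n} (mu f) (tM a) =
  subst Truthy (sym (cong (λ t → typingRuleCase t X ctx) (unpair₁-pair 6 (encode f))))
    (truthy-∧ₑ⁺ muShape muBodyTyped X ctx (truthy-≡ᵇ⁺ {a = encode (mu f)} refl) (hasTyping-from X a refl refl))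
  where
  ctx = nestList es ∷ i ∷ encode (mu f) ∷ n ∷ encode f ∷ 0 ∷ 0 ∷ []

entryRuleValue : Oracle → ℕ → ℕ → ℕ → ℕ → ℕ → ℕ → ℕ → ℕ → ℕ
entryRuleValue X L i a0 a1 a2 a3 a4 a5 = if nonzero (χ (a0 ≡ᵇ 0))
   then ⟦ evalRule ⟧ X (L ∷ i ∷ a1 ∷ a2 ∷ a3 ∷ a4 ∷ [])
   else (if nonzero (χ (a0 ≡ᵇ 1)) then ⟦ typingRule ⟧ X (L ∷ i ∷ a1 ∷ a2 ∷ a3 ∷ a4 ∷ a5 ∷ []) else 0)

entryRuleValue-cong : ∀ X L i {a0 a1 a2 a3 a4 a5 b0 b1 b2 b3 b4 b5} → a0 ≡ b0 → a1 ≡ b1 → a2 ≡ b2 → a3 ≡ b3 → a4 ≡ b4 → a5 ≡ b5 →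
  entryRuleValue X L i a0 a1 a2 a3 a4 a5 ≡ entryRuleValue X L i b0 b1 b2 b3 b4 b5
entryRuleValue-cong X L i refl refl refl refl refl refl = refl

entryRule-complete : ∀ X es i → i < length es → JustifiedEntry X es i → Truthy (⟦ entryRule ⟧ X (nestList es ∷ i ∷ []))
entryRule-complete X es i i< (inj₁ (k , c , xs , y , h , e , J)) =
  subst Truthy (sym (entryRuleValue-cong X L i (trans (cong (λ w → entry w 0) Ee) (evalEntry₀ (encode c) (encodeArgs xs) y h))
                             (trans (cong (λ w → entry w 1) Ee) (evalEntry₁ (encode c) (encodeArgs xs) y h))
                             (trans (cong (λ w → entry w 2) Ee) (evalEntry₂ (encode c) (encodeArgs xs) y h))
                             (trans (cong (λ w → entry w 3) Ee) (evalEntry₃ (encode c) (encodeArgs xs) y h))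
                             (trans (cong (λ w → entry w 4) Ee) (evalEntry₄ (encode c) (encodeArgs xs) y h))
                             (refl {x = entry (entry L i) 5})))
    (evalRule-complete X es i c xs y h J)
  where
  L = nestList es
  Ee : entry L i ≡ evalEntry (encode c) (encodeArgs xs) y h
  Ee = trans (entry-nestList-< es i i<) e
entryRule-complete X es i i< (inj₂ (n , c , e , J)) =
  subst Truthy (sym (entryRuleValue-cong X L i (trans (cong (λ w → entry w 0) Ee) (typingEntry₀ (encode c) n (typingHint₁ c) (typingHint₂ c) (typingHint₃ c)))
                             (trans (cong (λ w → entry w 1) Ee) (typingEntry₁ (encode c) n (typingHint₁ c) (typingHint₂ c) (typingHint₃ c)))
                             (trans (cong (λ w → entry w 2) Ee) (typingEntry₂ (encode c) n (typingHint₁ c) (typingHint₂ c) (typingHint₃ c)))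
                             (trans (cong (λ w → entry w 3) Ee) (typingEntry₃ (encode c) n (typingHint₁ c) (typingHint₂ c) (typingHint₃ c)))
                             (trans (cong (λ w → entry w 4) Ee) (typingEntry₄ (encode c) n (typingHint₁ c) (typingHint₂ c) (typingHint₃ c)))
                             (trans (cong (λ w → entry w 5) Ee) (typingEntry₅ (encode c) n (typingHint₁ c) (typingHint₂ c) (typingHint₃ c)))))
    (typingRule-complete X es i c J)
  where
  L = nestList es
  Ee : entry L i ≡ typingEntryOf c
  Ee = trans (entry-nestList-< es i i<) e

certificate : List ℕ → ℕ
certificate es = ⟨ length es , nestList es ⟩

certificateRule-complete : ∀ X es → AllJustified X es → Truthy (⟦ certificateRule ⟧ X (certificate es ∷ []))
certificateRule-complete X es A = subst₂ (λ a b → Truthy (allBelow a (λ i → ⟦ entryRule ⟧ X (b ∷ i ∷ []))))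
  (sym (unpair₁-pair (length es) (nestList es))) (sym (unpair₂-pair (length es) (nestList es)))
  (allBelow-intro _ (length es) (λ i i< → entryRule-complete X es i i< (A i i<)))

entryBefore-weaken : ∀ {es i i' q} → i ≤ i' → EntryBefore es i q → EntryBefore es i' q
entryBefore-weaken le (entryBefore j j<i j<l e) = entryBefore j (≤-trans j<i le) j<l e

entryBefore-end-extend : ∀ {es q} fs → EntryBefore es (length es) q → EntryBefore (es ++ fs) (length (es ++ fs)) q
entryBefore-end-extend {es} fs e = entryBefore-weaken (length-++-≤ˡ es) (entryBefore-extend fs e)

entryBefore-end-shift : ∀ {fs q} es → EntryBefore fs (length fs) q → EntryBefore (es ++ fs) (length (es ++ fs)) q
entryBefore-end-shift {fs} es e = subst (λ n → EntryBefore (es ++ fs) n _) (sym (length-++ es)) (entryBefore-shift es e)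

evalBefore-end-extend : ∀ {es m x y} fs → EvalBefore es (length es) m x y → EvalBefore (es ++ fs) (length (es ++ fs)) m x y
evalBefore-end-extend fs (evalBefore h e) = evalBefore h (entryBefore-end-extend fs e)
evalBefore-end-shift : ∀ {fs m x y} es → EvalBefore fs (length fs) m x y → EvalBefore (es ++ fs) (length (es ++ fs)) m x y
evalBefore-end-shift es (evalBefore h e) = evalBefore h (entryBefore-end-shift es e)
nonzeroEvalBefore-end-extend : ∀ {es m x} fs → NonzeroEvalBefore es (length es) m x → NonzeroEvalBefore (es ++ fs) (length (es ++ fs)) m x
nonzeroEvalBefore-end-extend fs (nonzeroEvalBefore y e) = nonzeroEvalBefore y (evalBefore-end-extend fs e)
nonzeroEvalBefore-end-shift : ∀ {fs m x} es → NonzeroEvalBefore fs (length fs) m x → NonzeroEvalBefore (es ++ fs) (length (es ++ fs)) m x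
nonzeroEvalBefore-end-shift es (nonzeroEvalBefore y e) = nonzeroEvalBefore y (evalBefore-end-shift es e)
typingBefore-end-extend : ∀ {es m n} fs → TypingBefore es (length es) m n → TypingBefore (es ++ fs) (length (es ++ fs)) m n
typingBefore-end-extend fs (typingBefore a b c e) = typingBefore a b c (entryBefore-end-extend fs e)
typingBefore-end-shift : ∀ {fs m n} es → TypingBefore fs (length fs) m n → TypingBefore (es ++ fs) (length (es ++ fs)) m n
typingBefore-end-shift es (typingBefore a b c e) = typingBefore a b c (entryBefore-end-shift es e)

lookupOr0-last : ∀ es q → lookupOr0 (es ++ [ q ]) (length es) ≡ q
lookupOr0-last [] q = refl
lookupOr0-last (x ∷ es) q = lookupOr0-last es q

length-snoc : ∀ (es : List ℕ) q → length es < length (es ++ [ q ])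
length-snoc [] q = s≤s z≤n
length-snoc (x ∷ es) q = s≤s (length-snoc es q)

entryBefore-last : ∀ es q → EntryBefore (es ++ [ q ]) (length (es ++ [ q ])) q
entryBefore-last es q = entryBefore (length es) (length-snoc es q) (length-snoc es q) (lookupOr0-last es q)

allJustified-snoc : ∀ X es q → AllJustified X es → JustifiedEntry X (es ++ [ q ]) (length es) → AllJustified X (es ++ [ q ])
allJustified-snoc X es q A J i i< with i <? length es
... | yes p = case (A i p)
  where
  case : JustifiedEntry X es i → JustifiedEntry X (es ++ [ q ]) i
  case (inj₁ (k , c , xs , y , h , e , J)) = inj₁ (k , c , xs , y , h , trans (lookupOr0-++ˡ es [ q ] i p) e , justifiedEval-extend [ q ] J)
  case (inj₂ (n , c , e , J)) = inj₂ (n , c , trans (lookupOr0-++ˡ es [ q ] i p) e , justifiedTyping-extend [ q ] J)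
... | no ¬p = subst (JustifiedEntry X (es ++ [ q ])) (sym (≤-antisym le (≮⇒≥ ¬p))) J
  where
  le : i ≤ length es
  le = s≤s⁻¹ (subst (i <_) (trans (length-++ es) (+-comm (length es) 1)) i<)

CertifiedTyping : Oracle → (n : ℕ) → Code n → Set
CertifiedTyping X n c = Σ (List ℕ) λ es → AllJustified X es × TypingBefore es (length es) (encode c) n

allJustified-[] : ∀ X → AllJustified X []
allJustified-[] X i ()

certify-typing : ∀ X es → AllJustified X es → ∀ {n} (c : Code n) → JustifiedTyping es (length es) c → CertifiedTyping X n c
certify-typing X es A {n} c J = (es ++ [ typingEntryOf c ]) ,
  allJustified-snoc X es (typingEntryOf c) A (inj₂ (n , c , lookupOr0-last es (typingEntryOf c) , justifiedTyping-extend [ typingEntryOf c ] J)) ,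
  typingBefore (typingHint₁ c) (typingHint₂ c) (typingHint₃ c) (entryBefore-last es (typingEntryOf c))

typing-certified : ∀ X {n} (c : Code n) → CertifiedTyping X n c
typings-certified : ∀ X {n m} (gs : Vec (Code n) m) →
  Σ (List ℕ) λ es → AllJustified X es × (∀ t → TypingBefore es (length es) (encode (lookup gs t)) n)
typing-certified X Z = certify-typing X [] (allJustified-[] X) Z tZ
typing-certified X S = certify-typing X [] (allJustified-[] X) S tS
typing-certified X O = certify-typing X [] (allJustified-[] X) O tO
typing-certified X (P j) = certify-typing X [] (allJustified-[] X) (P j) (tP j)
typing-certified X (comp f gs) with typing-certified X f | typings-certified X gs
... | esf , Af , Ef | esg , Ag , Eg =
  certify-typing X (esf ++ esg) (allJustified-++ esf esg Af Ag) (comp f gs) (tC (typingBefore-end-extend esg Ef) (λ t → typingBefore-end-shift esf (Eg t)))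
typing-certified X (prec f g) with typing-certified X f | typing-certified X g
... | esf , Af , Ef | esg , Ag , Eg =
  certify-typing X (esf ++ esg) (allJustified-++ esf esg Af Ag) (prec f g) (tR (typingBefore-end-extend esg Ef) (typingBefore-end-shift esf Eg))
typing-certified X (mu f) with typing-certified X f
... | esf , Af , Ef = certify-typing X esf Af (mu f) (tM Ef)
typings-certified X [] = [] , allJustified-[] X , λ ()
typings-certified X (g ∷ gs) with typing-certified X g | typings-certified X gs
... | es1 , A1 , E1 | es2 , A2 , E2 = (es1 ++ es2) , allJustified-++ es1 es2 A1 A2 , λ
  { zero → typingBefore-end-extend es2 E1 ; (suc t) → typingBefore-end-shift es1 (E2 t) }

CertifiedEval : Oracle → ∀ {k} → Code k → Vec ℕ k → ℕ → Set
CertifiedEval X c xs y = Σ (List ℕ) λ es → AllJustified X es × EvalBefore es (length es) (encode c) (encodeArgs xs) y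

certify-eval : ∀ X es → AllJustified X es → ∀ {k} (c : Code k) xs y h → JustifiedEval X es (length es) c xs y h → CertifiedEval X c xs y
certify-eval X es A {k} c xs y h J = (es ++ [ q ]) ,
  allJustified-snoc X es q A (inj₁ (k , c , xs , y , h , lookupOr0-last es q , justifiedEval-extend [ q ] J)) ,
  evalBefore h (entryBefore-last es q)
  where q = evalEntry (encode c) (encodeArgs xs) y h

eval-certified : ∀ {X k} {c : Code k} {xs y} → Eval X c xs y → CertifiedEval X c xs y
evals-certified : ∀ {X m k} {gs : Vec (Code k) m} {xs ys} → EvalVec X gs xs ys →
  Σ (List ℕ) λ es → AllJustified X es × (∀ t → EvalBefore es (length es) (encode (lookup gs t)) (encodeArgs xs) (lookup ys t))
search-certified : ∀ {X k} {f : Code (suc k)} {xs : Vec ℕ k} {z y} → Search X f xs z y →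
  Σ (List ℕ) λ es → AllJustified X es × EvalBefore es (length es) (encode f) (encodeArgs (y ∷ xs)) 0 ×
    (∀ t → z ≤ t → t < y → NonzeroEvalBefore es (length es) (encode f) (encodeArgs (t ∷ xs)))
eval-certified {X} {xs = xs} ev-Z = certify-eval X [] (allJustified-[] X) Z xs 0 0 jZ
eval-certified {X} {xs = xs} ev-S = certify-eval X [] (allJustified-[] X) S xs _ 0 jS
eval-certified {X} {xs = xs} ev-O = certify-eval X [] (allJustified-[] X) O xs _ 0 jO
eval-certified {X} {xs = xs} (ev-P i) = certify-eval X [] (allJustified-[] X) (P i) xs _ 0 (jP i)
eval-certified {X} {xs = xs} (ev-comp {f = f} {gs} {ys = ys} ev ef) with evals-certified ev | eval-certified ef
... | es1 , A1 , E1 | es2 , A2 , E2 =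
  certify-eval X (es1 ++ es2) (allJustified-++ es1 es2 A1 A2) (comp f gs) xs _ (encodeArgs ys)
    (jC {ys = ys} (evalBefore-end-shift es1 E2) (λ t → evalBefore-end-extend es2 (E1 t)))
eval-certified {X} (ev-prec0 {f = f} {g} {xs} e) with eval-certified e
... | es1 , A1 , E1 = certify-eval X es1 A1 (prec f g) (0 ∷ xs) _ 0 (jR0 E1)
eval-certified {X} (ev-precS {f = f} {g} {xs} {k} {z} e1 e2) with eval-certified e1 | eval-certified e2
... | es1 , A1 , E1 | es2 , A2 , E2 =
  certify-eval X (es1 ++ es2) (allJustified-++ es1 es2 A1 A2) (prec f g) (suc k ∷ xs) _ z
    (jRS (evalBefore-end-extend es2 E1) (evalBefore-end-shift es1 E2))
eval-certified {X} {xs = xs} (ev-mu {f = f} s) with search-certified s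
... | es1 , A1 , E1 , N1 = certify-eval X es1 A1 (mu f) xs _ 0 (jM E1 (λ t t< → N1 t z≤n t<))
evals-certified {X} ev-[] = [] , allJustified-[] X , λ ()
evals-certified {X} (ev-∷ e ev) with eval-certified e | evals-certified ev
... | es1 , A1 , E1 | es2 , A2 , E2 = (es1 ++ es2) , allJustified-++ es1 es2 A1 A2 , λ
  { zero → evalBefore-end-extend es2 E1 ; (suc t) → evalBefore-end-shift es1 (E2 t) }
search-certified (found e) with eval-certified e
... | es1 , A1 , E1 = es1 , A1 , E1 , λ t z≤t t<z → ⊥-elim (<-irrefl refl (≤-trans t<z z≤t))
search-certified {X} {z = z} (next {k = k} e s) with eval-certified e | search-certified s
... | es1 , A1 , E1 | es2 , A2 , E2 , N2 = (es1 ++ es2) , allJustified-++ es1 es2 A1 A2 , evalBefore-end-shift es1 E2 , nz'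
  where
  nz' : ∀ t → z ≤ t → t < _ → NonzeroEvalBefore (es1 ++ es2) (length (es1 ++ es2)) _ _
  nz' t z≤t t<y with m≤n⇒m<n∨m≡n z≤t
  ... | inj₁ z<t = nonzeroEvalBefore-end-shift es1 (N2 t z<t t<y)
  ... | inj₂ refl = nonzeroEvalBefore-end-extend es2 (nonzeroEvalBefore k E1)

-- Σ⁰₁ forms of 0′ and W_e^X

hasSomeEval-from : ∀ X {es i m xs y} → EvalBefore es i m xs y → ∀ {m' xs'} → m' ≡ m → xs' ≡ xs →
  Truthy (⟦ hasSomeEvalExpr ⟧ X (nestList es ∷ i ∷ m' ∷ xs' ∷ []))
hasSomeEval-from X {es} {i} {m} {xs} {y} (evalBefore h (entryBefore j j<i j<l e)) refl refl =
  hasSomeEval-intro X (nestList es) i m xs y j h j<i (trans (entry-nestList-< es j j<l) e)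

singletonArgsₑ : ∀ {n} → Expr (suc (suc n)) → Expr (suc (suc n))
singletonArgsₑ w = ⟪ lit 1 , ⟪ w , lit 0 ⟫ ⟫

haltValid haltEval haltTyped : Expr 2
haltValid = app certificateRule (v0 ∷ [])
haltEval = hasSomeEvalₑ (unpair₂ₑ v0) (unpair₁ₑ v0) v1 (singletonArgsₑ v1)
haltTyped = hasTypingₑ (unpair₂ₑ v0) (unpair₁ₑ v0) v1 (lit 1)

haltingCertificateExpr : Expr 2
haltingCertificateExpr = haltValid ∧ₑ haltEval ∧ₑ haltTyped

domainCertificateExpr : ∀ {k} → Code k → Expr 2
domainCertificateExpr e = app certificateRule (v0 ∷ []) ∧ₑ hasSomeEvalₑ (unpair₂ₑ v0) (unpair₁ₑ v0) (lit (encode e)) (singletonArgsₑ v1)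

EvalClaim-singleton : ∀ {X} {c : Code 1} {m y} → EvalClaim X (encode c) ⟨ 1 , ⟨ m , 0 ⟩ ⟩ y → Eval X c (m ∷ []) y
EvalClaim-singleton {X} {c} {m} {y} J = subst (λ w → Eval X c (w ∷ []) y) (unpair₁-pair m 0)
  (EvalClaim-at J (sym (unpair₁-pair 1 ⟨ m , 0 ⟩)) (sym (unpair₂-pair 1 ⟨ m , 0 ⟩)) c refl)

hasSomeEval-sound : ∀ X z m xs → Truthy (⟦ certificateRule ⟧ X (z ∷ [])) → Truthy (⟦ hasSomeEvalExpr ⟧ X (unpair₂ z ∷ unpair₁ z ∷ m ∷ xs ∷ [])) →
  Σ ℕ λ y → EvalClaim X m xs y
hasSomeEval-sound X z m xs Vd A with hasSomeEval-elim X (unpair₂ z) (unpair₁ z) m xs A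
... | j , j<i , k0 , e1 , e2 = entry (entry (unpair₂ z) j) 3 , subst₂ (λ a b → EvalClaim X a b (entry (entry (unpair₂ z) j) 3)) e1 e2 (proj₁ (certificate-sound X z Vd j j<i) k0)

haltingCertificate-sound : ∀ z m → Truthy (⟦ haltingCertificateExpr ⟧ ∅ (z ∷ m ∷ [])) → Halting m
haltingCertificate-sound z m p with hasSomeEval-sound ∅ z m ⟨ 1 , ⟨ m , 0 ⟩ ⟩ Vd A
  where
  Vd = proj₁ (truthy-∧ₑ⁻ haltValid (haltEval ∧ₑ haltTyped) ∅ (z ∷ m ∷ []) p)
  q = proj₂ (truthy-∧ₑ⁻ haltValid (haltEval ∧ₑ haltTyped) ∅ (z ∷ m ∷ []) p)
  A = proj₁ (truthy-∧ₑ⁻ haltEval haltTyped ∅ (z ∷ m ∷ []) q)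
... | y , J with hasTyping-sound ∅ (unpair₂ z) (unpair₁ z) m 1 (λ j j< → certificate-sound ∅ z Vd j j<) T
  where
  Vd = proj₁ (truthy-∧ₑ⁻ haltValid (haltEval ∧ₑ haltTyped) ∅ (z ∷ m ∷ []) p)
  q = proj₂ (truthy-∧ₑ⁻ haltValid (haltEval ∧ₑ haltTyped) ∅ (z ∷ m ∷ []) p)
  T = proj₂ (truthy-∧ₑ⁻ haltEval haltTyped ∅ (z ∷ m ∷ []) q)
... | c , refl = c , refl , y , EvalClaim-singleton J

domainCertificate-sound : ∀ X (e : Code 1) z w → Truthy (⟦ domainCertificateExpr e ⟧ X (z ∷ w ∷ [])) → W e X w
domainCertificate-sound X e z w p with hasSomeEval-sound X z (encode e) ⟨ 1 , ⟨ w , 0 ⟩ ⟩ Vd A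
  where
  Vd = proj₁ (truthy-∧ₑ⁻ (app certificateRule (v0 ∷ [])) (hasSomeEvalₑ (unpair₂ₑ v0) (unpair₁ₑ v0) (lit (encode e)) (singletonArgsₑ v1)) X (z ∷ w ∷ []) p)
  A = proj₂ (truthy-∧ₑ⁻ (app certificateRule (v0 ∷ [])) (hasSomeEvalₑ (unpair₂ₑ v0) (unpair₁ₑ v0) (lit (encode e)) (singletonArgsₑ v1)) X (z ∷ w ∷ []) p)
... | y , J = y , EvalClaim-singleton J

certificate-unpair : ∀ es → unpair₁ (certificate es) ≡ length es × unpair₂ (certificate es) ≡ nestList es
certificate-unpair es = unpair₁-pair (length es) (nestList es) , unpair₂-pair (length es) (nestList es)

haltingCertificate-complete : ∀ m → Halting m → Σ ℕ λ z → Truthy (⟦ haltingCertificateExpr ⟧ ∅ (z ∷ m ∷ []))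
haltingCertificate-complete m (c , refl , y , ev) with eval-certified ev | typing-certified ∅ c
... | es1 , A1 , E1 | es2 , A2 , E2 = certificate es ,
  truthy-∧⁺ (certificateRule-complete ∅ es (allJustified-++ es1 es2 A1 A2))
    (truthy-∧⁺ (subst₂ (λ a b → Truthy (⟦ hasSomeEvalExpr ⟧ ∅ (b ∷ a ∷ encode c ∷ ⟨ 1 , ⟨ encode c , 0 ⟩ ⟩ ∷ [])))
             (sym (proj₁ (certificate-unpair es))) (sym (proj₂ (certificate-unpair es)))
             (hasSomeEval-from ∅ (evalBefore-end-extend es2 E1) refl refl))
          (subst₂ (λ a b → Truthy (⟦ hasTypingExpr ⟧ ∅ (b ∷ a ∷ encode c ∷ 1 ∷ [])))
             (sym (proj₁ (certificate-unpair es))) (sym (proj₂ (certificate-unpair es)))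
             (hasTyping-from ∅ (typingBefore-end-shift es1 E2) refl refl)))
  where es = es1 ++ es2

domainCertificate-complete : ∀ X (e : Code 1) w → W e X w → Σ ℕ λ z → Truthy (⟦ domainCertificateExpr e ⟧ X (z ∷ w ∷ []))
domainCertificate-complete X e w (y , ev) with eval-certified ev
... | es , A , E = certificate es ,
  truthy-∧⁺ (certificateRule-complete X es A)
    (subst₂ (λ a b → Truthy (⟦ hasSomeEvalExpr ⟧ X (b ∷ a ∷ encode e ∷ ⟨ 1 , ⟨ w , 0 ⟩ ⟩ ∷ [])))
       (sym (proj₁ (certificate-unpair es))) (sym (proj₂ (certificate-unpair es)))
       (hasSomeEval-from X E refl refl))

-- Expressions as predicates

record Holds {n} (e : Expr n) (X : Oracle) (xs : Vec ℕ n) : Set where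
  constructor holds
  field truth : Truthy (⟦ e ⟧ X xs)
open Holds

Holds⇔Truthy : ∀ {n} {e : Expr n} {X xs} → Holds e X xs ⇔ Truthy (⟦ e ⟧ X xs)
Holds⇔Truthy = mk⇔ truth holds

truthy-∧ : ∀ p q → Truthy (χ (p ∧ q)) ⇔ (p ≡ true × q ≡ true)
truthy-∧ p q = mk⇔ (truthy-∧⁻ p q) (λ (p≡true , q≡true) → truthy-∧⁺ p≡true q≡true)

truthy-∨ : ∀ p q → Truthy (χ (p ∨ q)) ⇔ (p ≡ true ⊎ q ≡ true)
truthy-∨ true q = mk⇔ (λ _ → inj₁ refl) (λ _ → refl)
truthy-∨ false true = mk⇔ (λ _ → inj₂ refl) (λ _ → refl)
truthy-∨ false false = mk⇔ (λ ()) λ { (inj₁ ()) ; (inj₂ ()) }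

truthy-not : ∀ p → Truthy (χ (not p)) ⇔ (¬ p ≡ true)
truthy-not true = mk⇔ (λ ()) (λ h → contradiction refl h)
truthy-not false = mk⇔ (λ _ ()) (λ _ → refl)

truthy-≡ᵇ : ∀ m n → Truthy (χ (m ≡ᵇ n)) ⇔ (m ≡ n)
truthy-≡ᵇ m n = mk⇔ (truthy-≡ᵇ⁻ m n) truthy-≡ᵇ⁺

truthy-<ᵇ : ∀ m n → Truthy (χ (m <ᵇ n)) ⇔ (m < n)
truthy-<ᵇ m n = mk⇔ (truthy-<ᵇ⁻ m n) truthy-<ᵇ⁺

module _ {n} {X : Oracle} {xs : Vec ℕ n} where

  holds-∧ : ∀ {a b : Expr n} → Holds (a ∧ₑ b) X xs ⇔ (Holds a X xs × Holds b X xs)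
  holds-∧ {a} {b} = ((⇔-sym Holds⇔Truthy ×-⇔ ⇔-sym Holds⇔Truthy) ⇔-∘ truthy-∧ (nonzero (⟦ a ⟧ X xs)) (nonzero (⟦ b ⟧ X xs))) ⇔-∘ Holds⇔Truthy

  holds-∨ : ∀ {a b : Expr n} → Holds (a ∨ₑ b) X xs ⇔ (Holds a X xs ⊎ Holds b X xs)
  holds-∨ {a} {b} = ((⇔-sym Holds⇔Truthy ⊎-⇔ ⇔-sym Holds⇔Truthy) ⇔-∘ truthy-∨ (nonzero (⟦ a ⟧ X xs)) (nonzero (⟦ b ⟧ X xs))) ⇔-∘ Holds⇔Truthy

  holds-¬ : ∀ {a : Expr n} → Holds (¬ₑ a) X xs ⇔ (¬ Holds a X xs)
  holds-¬ {a} = mk⇔ (λ h ha → to (truthy-not (nonzero (⟦ a ⟧ X xs))) (truth h) (truth ha))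
                    (λ ¬ha → holds (from (truthy-not (nonzero (⟦ a ⟧ X xs))) (λ t → ¬ha (holds t))))

  holds-≐ : ∀ {a b : Expr n} → Holds (a ≐ b) X xs ⇔ (⟦ a ⟧ X xs ≡ ⟦ b ⟧ X xs)
  holds-≐ {a} {b} = truthy-≡ᵇ (⟦ a ⟧ X xs) (⟦ b ⟧ X xs) ⇔-∘ Holds⇔Truthy

  holds-≺ : ∀ {a b : Expr n} → Holds (a ≺ b) X xs ⇔ (⟦ a ⟧ X xs < ⟦ b ⟧ X xs)
  holds-≺ {a} {b} = truthy-<ᵇ (⟦ a ⟧ X xs) (⟦ b ⟧ X xs) ⇔-∘ Holds⇔Truthy

  holds-app : ∀ {m} {f : Expr m} {as : Vec (Expr n) m} → Holds (app f as) X xs ⇔ Holds f X (⟦ as ⟧* X xs)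
  holds-app = mk⇔ (λ h → holds (truth h)) (λ h → holds (truth h))

  holds-allₑ : ∀ {b : Expr n} {f : Expr (suc n)} →
    Holds (allₑ b f) X xs ⇔ (∀ i → i < ⟦ b ⟧ X xs → Holds f X (i ∷ xs))
  holds-allₑ {b} {f} = mk⇔ (λ h i i< → holds (allBelow-elim g (⟦ b ⟧ X xs) (truth h) i i<))
                           (λ h → holds (allBelow-intro g (⟦ b ⟧ X xs) (λ i i< → truth (h i i<))))
    where g = λ i → ⟦ f ⟧ X (i ∷ xs)

  ¬ₑ-zero : ∀ {a : Expr n} → ⟦ ¬ₑ a ⟧ X xs ≡ 0 → Holds a X xs
  ¬ₑ-zero {a} with nonzero (⟦ a ⟧ X xs) in eq
  ... | true = λ _ → holds eq

infix 4 _≤ₑ_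
_≤ₑ_ : ∀ {n} → Expr n → Expr n → Expr n
a ≤ₑ b = ¬ₑ (b ≺ a)

holds-≤ₑ : ∀ {n X xs} {a b : Expr n} → Holds (a ≤ₑ b) X xs ⇔ (⟦ a ⟧ X xs ≤ ⟦ b ⟧ X xs)
holds-≤ₑ = mk⇔ (λ h → ≮⇒≥ (λ lt → to holds-¬ h (from holds-≺ lt)))
               (λ le → from holds-¬ (λ h → <⇒≱ (to holds-≺ h) le))

-- Stages of the halting problem

eraseOracle : ∀ {n} → Code n → Code n
eraseOracle* : ∀ {m n} → Vec (Code n) m → Vec (Code n) m
eraseOracle Z = Z
eraseOracle S = S
eraseOracle O = Z
eraseOracle (P i) = P i
eraseOracle (comp f gs) = comp (eraseOracle f) (eraseOracle* gs)
eraseOracle (prec f g) = prec (eraseOracle f) (eraseOracle g)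
eraseOracle (mu f) = mu (eraseOracle f)
eraseOracle* [] = []
eraseOracle* (g ∷ gs) = eraseOracle g ∷ eraseOracle* gs

eraseOracle-sound : ∀ {X n} {c : Code n} {xs y} → Eval ∅ c xs y → Eval X (eraseOracle c) xs y
eraseOracle-sound* : ∀ {X m n} {gs : Vec (Code n) m} {xs ys} → EvalVec ∅ gs xs ys → EvalVec X (eraseOracle* gs) xs ys
eraseOracle-soundˢ : ∀ {X n} {f : Code (suc n)} {xs z y} → Search ∅ f xs z y → Search X (eraseOracle f) xs z y
eraseOracle-sound ev-Z = ev-Z
eraseOracle-sound ev-S = ev-S
eraseOracle-sound ev-O = ev-Z
eraseOracle-sound (ev-P i) = ev-P i
eraseOracle-sound (ev-comp ev e) = ev-comp (eraseOracle-sound* ev) (eraseOracle-sound e)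
eraseOracle-sound (ev-prec0 e) = ev-prec0 (eraseOracle-sound e)
eraseOracle-sound (ev-precS e₁ e₂) = ev-precS (eraseOracle-sound e₁) (eraseOracle-sound e₂)
eraseOracle-sound (ev-mu s) = ev-mu (eraseOracle-soundˢ s)
eraseOracle-sound* ev-[] = ev-[]
eraseOracle-sound* (ev-∷ e ev) = ev-∷ (eraseOracle-sound e) (eraseOracle-sound* ev)
eraseOracle-soundˢ (found e) = found (eraseOracle-sound e)
eraseOracle-soundˢ (next e s) = next (eraseOracle-sound e) (eraseOracle-soundˢ s)

embed : ∀ {m n} (e : Expr m) (f : Vec ℕ m → ℕ) → (∀ xs → ⟦ e ⟧ ∅ xs ≡ f xs) → Vec (Expr n) m → Expr n
embed e f e≗f = prim (eraseOracle (compile e)) f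
  (λ X xs → subst (Eval X (eraseOracle (compile e)) xs) (e≗f xs) (eraseOracle-sound (correct e ∅ xs)))

anyBelow-boolean : ∀ k f → anyBelow k f ≡ χ (nonzero (anyBelow k f))
anyBelow-boolean zero f = refl
anyBelow-boolean (suc k) f = sym (cong χ (nonzero-χ _))

haltingStageExpr : Expr 2
haltingStageExpr = exₑ (lit 1 ⊕ v0) (app haltingCertificateExpr (v0 ∷ v2 ∷ []))

opaque
  haltsWithin : ℕ → ℕ → Bool
  haltsWithin s m = nonzero (⟦ haltingStageExpr ⟧ ∅ (s ∷ m ∷ []))

  haltsWithin-sound : ∀ s m → haltsWithin s m ≡ true → Halting m
  haltsWithin-sound s m h with anyBelow-elim _ (1 + s) h
  ... | z , _ , certified = haltingCertificate-sound z m certified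

  haltsWithin-complete : ∀ m → Halting m → Σ ℕ λ s → haltsWithin s m ≡ true
  haltsWithin-complete m h with haltingCertificate-complete m h
  ... | z , certified = z , anyBelow-intro _ z (1 + z) ≤-refl certified

  haltsWithin-mono : ∀ {s s'} m → s ≤ s' → haltsWithin s m ≡ true → haltsWithin s' m ≡ true
  haltsWithin-mono {s} {s'} m s≤s' h with anyBelow-elim _ (1 + s) h
  ... | z , z≤s , certified = anyBelow-intro _ z (1 + s') (≤-trans z≤s (s≤s s≤s')) certified

  haltingStageExpr-χ : ∀ s m → ⟦ haltingStageExpr ⟧ ∅ (s ∷ m ∷ []) ≡ χ (haltsWithin s m)
  haltingStageExpr-χ s m = anyBelow-boolean (1 + s) _

haltsWithinₑ : ∀ {n} → Expr n → Expr n → Expr n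
haltsWithinₑ s m = embed haltingStageExpr (λ { (s ∷ m ∷ []) → χ (haltsWithin s m) })
  (λ { (s ∷ m ∷ []) → haltingStageExpr-χ s m }) (s ∷ m ∷ [])

haltsWithin-false : ∀ s m → ¬ Halting m → haltsWithin s m ≡ false
haltsWithin-false s m ¬h with haltsWithin s m in eq
... | false = refl
... | true = contradiction (haltsWithin-sound s m eq) ¬h

minBelow-suc : ∀ k f → minBelow (suc k) f ≡ (if minBelow k f <ᵇ k then minBelow k f else (if nonzero (f k) then k else suc k))
minBelow-suc k f = cong (λ b → if b then minBelow k f else (if nonzero (f k) then k else suc k)) (nonzero-χ (minBelow k f <ᵇ k))

minBelow-cong : ∀ {f g : ℕ → ℕ} b → (∀ i → f i ≡ g i) → minBelow b f ≡ minBelow b g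
minBelow-cong zero f≗g = refl
minBelow-cong (suc k) f≗g rewrite minBelow-cong k f≗g | f≗g k = refl

minBelow-found : ∀ b f → minBelow b f < b → nonzero (f (minBelow b f)) ≡ true
minBelow-found zero f ()
minBelow-found (suc k) f rewrite minBelow-suc k f with minBelow k f <ᵇ k in found-before | nonzero (f k) in fk
... | true | _ = λ _ → minBelow-found k f (<ᵇ≡true⇒< _ _ found-before)
... | false | true = λ _ → fk
... | false | false = λ lt → ⊥-elim (<-irrefl refl lt)

minBelow-minimal : ∀ b f m → m < b → nonzero (f m) ≡ true → minBelow b f ≤ m
minBelow-minimal zero f m ()
minBelow-minimal (suc k) f m m<b fm rewrite minBelow-suc k f
  with minBelow k f <ᵇ k in found-before | nonzero (f k) in fk | m≤n⇒m<n∨m≡n (s≤s⁻¹ m<b)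
... | true | _ | inj₁ m<k = minBelow-minimal k f m m<k fm
... | true | _ | inj₂ refl = <⇒≤ (<ᵇ≡true⇒< _ _ found-before)
... | false | true | inj₂ refl = ≤-refl
... | false | false | inj₂ refl = ⊥-elim (false≢true (trans (sym fk) fm))
... | false | _ | inj₁ m<k =
  ⊥-elim (false≢true (trans (sym found-before) (<⇒<ᵇ≡true (≤-<-trans (minBelow-minimal k f m m<k fm) m<k))))

entersAfter : ℕ → ℕ → Bool
entersAfter t m = haltsWithin (suc t) m ∧ not (haltsWithin t m)

pos : ℕ → ℕ
pos zero = 0
pos (suc t) = suc (minBelow (pos t) (λ m → χ (entersAfter t m)))

posExpr : Expr 1
posExpr = recₑ v0 (lit 0) (lit 1 ⊕ mnₑ v1 (haltsWithinₑ (lit 1 ⊕ v1) v0 ∧ₑ ¬ₑ (haltsWithinₑ v1 v0)))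

posExpr-correct : ∀ t → ⟦ posExpr ⟧ ∅ (t ∷ []) ≡ pos t
posExpr-correct zero = refl
posExpr-correct (suc t) =
  cong suc (trans (cong (λ a → minBelow a entersₑ) (posExpr-correct t)) (minBelow-cong (pos t) entersₑ≗))
  where
  entersₑ : ℕ → ℕ
  entersₑ m = χ (nonzero (χ (haltsWithin (suc t) m)) ∧ nonzero (χ (not (nonzero (χ (haltsWithin t m))))))
  entersₑ≗ : ∀ m → entersₑ m ≡ χ (entersAfter t m)
  entersₑ≗ m rewrite nonzero-χ (haltsWithin (suc t) m) | nonzero-χ (haltsWithin t m) | nonzero-χ (not (haltsWithin t m)) = refl

posₑ : ∀ {n} → Expr n → Expr n
posₑ t = embed posExpr (λ { (t ∷ []) → pos t }) (λ { (t ∷ []) → posExpr-correct t }) (t ∷ [])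

entersAfter-elim : ∀ t m → entersAfter t m ≡ true → haltsWithin (suc t) m ≡ true × haltsWithin t m ≡ false
entersAfter-elim t m with haltsWithin (suc t) m | haltsWithin t m
... | true | false = λ _ → refl , refl
... | true | true = λ ()
... | false | _ = λ ()

entersAfter-intro : ∀ {t m} → haltsWithin (suc t) m ≡ true → haltsWithin t m ≡ false → entersAfter t m ≡ true
entersAfter-intro h ¬h rewrite h | ¬h = refl

entersAfter-once : ∀ {t t' m} → t < t' → entersAfter t m ≡ true → entersAfter t' m ≡ true → ⊥
entersAfter-once {t} {t'} {m} t<t' e e' =
  false≢true (trans (sym (proj₂ (entersAfter-elim t' m e')))
             (haltsWithin-mono m t<t' (proj₁ (entersAfter-elim t m e))))

first-entry : ∀ w s m → haltsWithin w m ≡ false → haltsWithin s m ≡ true →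
  Σ ℕ λ t → w ≤ t × entersAfter t m ≡ true
first-entry w zero m ¬hw h0 = ⊥-elim (false≢true (trans (sym ¬hw) (haltsWithin-mono m z≤n h0)))
first-entry w (suc s) m ¬hw hs with haltsWithin s m in eq
... | true = first-entry w s m ¬hw eq
... | false with w ≤? s
...   | yes w≤s = s , w≤s , entersAfter-intro hs eq
...   | no w≰s = ⊥-elim (false≢true (trans (sym ¬hw) (haltsWithin-mono m (≰⇒> w≰s) hs)))

pos-drop : ∀ t → pos (suc t) ≤ pos t → Σ ℕ λ m → pos (suc t) ≡ suc m × entersAfter t m ≡ true
pos-drop t drop = M , refl , trans (sym (nonzero-χ _)) (minBelow-found (pos t) enters drop)
  where
  enters = λ m → χ (entersAfter t m)
  M = minBelow (pos t) enters

pos-entry-bound : ∀ t m → entersAfter t m ≡ true → m < pos t → pos (suc t) ≤ suc m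
pos-entry-bound t m e m< = s≤s (minBelow-minimal (pos t) (λ m → χ (entersAfter t m)) m m< (trans (nonzero-χ _) e))

-- Graphs of interval minima

Between : ℕ → ℕ → ℕ → Set
Between x y u = (x ≤ u × u ≤ y) ⊎ (y ≤ u × u ≤ x)

between-sym : ∀ {x y u} → Between x y u → Between y x u
between-sym (inj₁ p) = inj₂ p
between-sym (inj₂ p) = inj₁ p

between-split : ∀ x y z u → Between x z u → Between x y u ⊎ Between y z u
between-split x y z u (inj₁ (x≤u , u≤z)) with u ≤? y
... | yes u≤y = inj₁ (inj₁ (x≤u , u≤y))
... | no u≰y = inj₂ (inj₁ (<⇒≤ (≰⇒> u≰y) , u≤z))
between-split x y z u (inj₂ (z≤u , u≤x)) with u ≤? y
... | yes u≤y = inj₂ (inj₂ (z≤u , u≤y))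
... | no u≰y = inj₁ (inj₂ (<⇒≤ (≰⇒> u≰y) , u≤x))

between-suc : ∀ {x u} → Between x (suc x) u → u ≡ x ⊎ u ≡ suc x
between-suc {x} (inj₁ (x≤u , u≤sx)) with m≤n⇒m<n∨m≡n u≤sx
... | inj₁ u<sx = inj₁ (≤-antisym (s≤s⁻¹ u<sx) x≤u)
... | inj₂ u≡sx = inj₂ u≡sx
between-suc {x} (inj₂ (sx≤u , u≤x)) = ⊥-elim (<-irrefl refl (≤-trans sx≤u u≤x))

between-right : ∀ x y → Between x y y
between-right x y with ≤-total x y
... | inj₁ x≤y = inj₁ (x≤y , ≤-refl)
... | inj₂ y≤x = inj₂ (≤-refl , y≤x)

between-bound : ∀ {x y u} → Between x y u → u < suc (x + y)
between-bound {x} {y} (inj₁ (_ , u≤y)) = s≤s (≤-trans u≤y (m≤n+m y x))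
between-bound {x} {y} (inj₂ (_ , u≤x)) = s≤s (≤-trans u≤x (m≤m+n x y))

module IntervalMinimumGraph {ℓ} (_≼_ : ℕ → ℕ → Set ℓ)
  (≼-trans : ∀ {x y z} → x ≼ y → y ≼ z → x ≼ z) (≼-total : ∀ x y → x ≼ y ⊎ y ≼ x) where

  ≼-refl : ∀ x → x ≼ x
  ≼-refl x with ≼-total x x
  ... | inj₁ x≼x = x≼x
  ... | inj₂ x≼x = x≼x

  Dominates : ℕ → ℕ → Set ℓ
  Dominates x y = ∀ u → Between x y u → x ≼ u

  Adjacent : ℕ → ℕ → Set ℓ
  Adjacent x y = x ≢ y × (Dominates x y ⊎ Dominates y x)

  dominates-trans : ∀ {x y z} → Dominates x y → Dominates y z → Dominates x z
  dominates-trans {x} {y} {z} x▹y y▹z u u∈xz with between-split x y z u u∈xz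
  ... | inj₁ u∈xy = x▹y u u∈xy
  ... | inj₂ u∈yz = ≼-trans (x▹y y (between-right x y)) (y▹z u u∈yz)

  dominates-join : ∀ {x y z} → Dominates x z → Dominates y z → Dominates x y ⊎ Dominates y x
  dominates-join {x} {y} {z} x▹z y▹z with ≼-total x y
  ... | inj₁ x≼y = inj₁ λ u u∈xy → [ x▹z u , (λ u∈zy → ≼-trans x≼y (y▹z u (between-sym u∈zy))) ]′
                                     (between-split x z y u u∈xy)
  ... | inj₂ y≼x = inj₂ λ u u∈yx → [ y▹z u , (λ u∈zx → ≼-trans y≼x (x▹z u (between-sym u∈zx))) ]′
                                     (between-split y z x u u∈yx)

  adjacent-sym : ∀ {x y} → Adjacent x y → Adjacent y x
  adjacent-sym (x≢y , d) = (λ y≡x → x≢y (sym y≡x)) , swap d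

  adjacent-suc : ∀ x → Adjacent x (suc x)
  adjacent-suc x = (λ x≡sx → 1+n≢n (sym x≡sx)) , [ inj₁ ∘ dominates-next , inj₂ ∘ dominated-next ]′ (≼-total x (suc x))
    where
    dominates-next : x ≼ suc x → Dominates x (suc x)
    dominates-next x≼sx u u∈ with between-suc u∈
    ... | inj₁ refl = ≼-refl x
    ... | inj₂ refl = x≼sx
    dominated-next : suc x ≼ x → Dominates (suc x) x
    dominated-next sx≼x u u∈ with between-suc (between-sym u∈)
    ... | inj₁ refl = sx≼x
    ... | inj₂ refl = ≼-refl (suc x)

  no-chordless-P4 : ∀ {a b c d} → Adjacent a b → Adjacent b c → Adjacent c d →
    a ≢ c → ¬ Adjacent a c → b ≢ d → ¬ Adjacent b d → ⊥
  no-chordless-P4 (_ , ab) (_ , bc) (_ , cd) a≢c ¬ac b≢d ¬bd with bc | ab | cd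
  ... | inj₁ b▹c | inj₁ a▹b | _ = ¬ac (a≢c , inj₁ (dominates-trans a▹b b▹c))
  ... | inj₁ b▹c | inj₂ _ | inj₁ c▹d = ¬bd (b≢d , inj₁ (dominates-trans b▹c c▹d))
  ... | inj₁ b▹c | inj₂ _ | inj₂ d▹c = ¬bd (b≢d , swap (dominates-join d▹c b▹c))
  ... | inj₂ c▹b | _ | inj₂ d▹c = ¬bd (b≢d , inj₂ (dominates-trans d▹c c▹b))
  ... | inj₂ c▹b | inj₂ b▹a | inj₁ _ = ¬ac (a≢c , inj₂ (dominates-trans c▹b b▹a))
  ... | inj₂ c▹b | inj₁ a▹b | inj₁ _ = ¬ac (a≢c , dominates-join a▹b c▹b)

-- Ties are broken towards the larger index, so that a vertex of infinite degree has a strictly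
-- smaller position than every later vertex.
_≼⟨_⟩_ : ℕ → (ℕ → ℕ) → ℕ → Set
x ≼⟨ f ⟩ u = f x < f u ⊎ (f x ≡ f u × u ≤ x)

≼-trans : ∀ {f x y z} → x ≼⟨ f ⟩ y → y ≼⟨ f ⟩ z → x ≼⟨ f ⟩ z
≼-trans (inj₁ fx<fy) (inj₁ fy<fz) = inj₁ (<-trans fx<fy fy<fz)
≼-trans (inj₁ fx<fy) (inj₂ (fy≡fz , _)) = inj₁ (<-≤-trans fx<fy (≤-reflexive fy≡fz))
≼-trans (inj₂ (fx≡fy , _)) (inj₁ fy<fz) = inj₁ (≤-<-trans (≤-reflexive fx≡fy) fy<fz)
≼-trans (inj₂ (fx≡fy , y≤x)) (inj₂ (fy≡fz , z≤y)) = inj₂ (trans fx≡fy fy≡fz , ≤-trans z≤y y≤x)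

≼-total : ∀ f x y → x ≼⟨ f ⟩ y ⊎ y ≼⟨ f ⟩ x
≼-total f x y with <-cmp (f x) (f y) | ≤-total x y
... | tri< fx<fy _ _ | _ = inj₁ (inj₁ fx<fy)
... | tri> _ _ fy<fx | _ = inj₂ (inj₁ fy<fx)
... | tri≈ _ fx≡fy _ | inj₁ x≤y = inj₂ (inj₂ (sym fx≡fy , x≤y))
... | tri≈ _ fx≡fy _ | inj₂ y≤x = inj₁ (inj₂ (fx≡fy , y≤x))

-- The graph

open IntervalMinimumGraph (λ x u → x ≼⟨ pos ⟩ u) ≼-trans (≼-total pos)

betweenExpr : Expr 3
betweenExpr = (v1 ≤ₑ v0 ∧ₑ v0 ≤ₑ v2) ∨ₑ (v2 ≤ₑ v0 ∧ₑ v0 ≤ₑ v1)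

precedesExpr : Expr 3
precedesExpr = (posₑ v1 ≺ posₑ v0) ∨ₑ (posₑ v1 ≐ posₑ v0 ∧ₑ v0 ≤ₑ v1)

dominatesExpr : Expr 2
dominatesExpr = allₑ (lit 1 ⊕ v0 ⊕ v1) (¬ₑ betweenExpr ∨ₑ precedesExpr)

edgeExpr : Expr 2
edgeExpr = ¬ₑ (v0 ≐ v1) ∧ₑ (dominatesExpr ∨ₑ app dominatesExpr (v1 ∷ v0 ∷ []))

module _ {X : Oracle} where

  holds-betweenExpr : ∀ u x y → Holds betweenExpr X (u ∷ x ∷ y ∷ []) ⇔ Between x y u
  holds-betweenExpr u x y = ((holds-≤ₑ ×-⇔ holds-≤ₑ) ⇔-∘ holds-∧ ⊎-⇔ (holds-≤ₑ ×-⇔ holds-≤ₑ) ⇔-∘ holds-∧) ⇔-∘ holds-∨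

  holds-precedesExpr : ∀ u x y → Holds precedesExpr X (u ∷ x ∷ y ∷ []) ⇔ x ≼⟨ pos ⟩ u
  holds-precedesExpr u x y = (holds-≺ ⊎-⇔ (holds-≐ ×-⇔ holds-≤ₑ) ⇔-∘ holds-∧) ⇔-∘ holds-∨

  holds-dominatesExpr : ∀ x y → Holds dominatesExpr X (x ∷ y ∷ []) ⇔ Dominates x y
  holds-dominatesExpr x y = mk⇔ dominates checked
    where
    Outside Inside : ℕ → Set
    Outside u = Holds (¬ₑ betweenExpr) X (u ∷ x ∷ y ∷ [])
    Inside u = Holds precedesExpr X (u ∷ x ∷ y ∷ [])
    all⇔ : Holds dominatesExpr X (x ∷ y ∷ []) ⇔ (∀ u → u < suc (x + y) → Holds (¬ₑ betweenExpr ∨ₑ precedesExpr) X (u ∷ x ∷ y ∷ []))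
    all⇔ = holds-allₑ {b = lit 1 ⊕ v0 ⊕ v1} {f = ¬ₑ betweenExpr ∨ₑ precedesExpr}
    or⇔ : ∀ u → Holds (¬ₑ betweenExpr ∨ₑ precedesExpr) X (u ∷ x ∷ y ∷ []) ⇔ (Outside u ⊎ Inside u)
    or⇔ u = holds-∨ {a = ¬ₑ betweenExpr} {b = precedesExpr}
    dominates : Holds dominatesExpr X (x ∷ y ∷ []) → Dominates x y
    dominates h u u∈ = [ (λ ∉ → contradiction (from (holds-betweenExpr u x y) u∈) (to holds-¬ ∉)) ,
                         to (holds-precedesExpr u x y) ]′ (to (or⇔ u) (to all⇔ h u (between-bound u∈)))
    checked : Dominates x y → Holds dominatesExpr X (x ∷ y ∷ [])
    checked d = from all⇔ λ u _ → from (or⇔ u) (case ((x ≤? u ×-dec u ≤? y) ⊎-dec (y ≤? u ×-dec u ≤? x)))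
      where
      case : ∀ {u} → Dec (Between x y u) → Outside u ⊎ Inside u
      case {u} (yes u∈) = inj₂ (from (holds-precedesExpr u x y) (d u u∈))
      case {u} (no u∉) = inj₁ (from holds-¬ (λ b → u∉ (to (holds-betweenExpr u x y) b)))

  holds-edgeExpr : ∀ x y → Holds edgeExpr X (x ∷ y ∷ []) ⇔ Adjacent x y
  holds-edgeExpr x y =
    (distinct ×-⇔ (holds-dominatesExpr x y ⊎-⇔ holds-dominatesExpr y x ⇔-∘ holds-app) ⇔-∘ holds-∨) ⇔-∘ holds-∧
    where
    distinct : Holds (¬ₑ (v0 ≐ v1)) X (x ∷ y ∷ []) ⇔ (x ≢ y)
    distinct = mk⇔ (λ h x≡y → to holds-¬ h (from holds-≐ x≡y)) (λ x≢y → from holds-¬ (λ h → x≢y (to holds-≐ h)))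

opaque
  isEdge : ℕ → ℕ → Bool
  isEdge x y = nonzero (⟦ edgeExpr ⟧ ∅ (x ∷ y ∷ []))

  isEdge⇔Adjacent : ∀ x y → isEdge x y ≡ true ⇔ Adjacent x y
  isEdge⇔Adjacent x y = holds-edgeExpr {∅} x y ⇔-∘ ⇔-sym (Holds⇔Truthy {e = edgeExpr} {∅} {x ∷ y ∷ []})

  isEdge-computable : ComputableRel isEdge
  isEdge-computable =
    compile edgeExpr , λ x y → subst (Eval ∅ (compile edgeExpr) (x ∷ y ∷ [])) (sym (cong χ (nonzero-χ _))) (correct edgeExpr ∅ _)

nonEdge⇒¬Adjacent : ∀ x y → isEdge x y ≡ false → ¬ Adjacent x y
nonEdge⇒¬Adjacent x y ¬e a = false≢true (trans (sym ¬e) (from (isEdge⇔Adjacent x y) a))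

graph : Graph
graph = record
  { V = λ _ → true
  ; E = isEdge
  ; E-sym = λ x y e → from (isEdge⇔Adjacent y x) (adjacent-sym (to (isEdge⇔Adjacent x y) e))
  ; E-irr = irreflexive
  ; E-inV = λ _ _ _ → refl , refl
  }
  where
  irreflexive : ∀ x → isEdge x x ≡ false
  irreflexive x with isEdge x x in e
  ... | false = refl
  ... | true = ⊥-elim (proj₁ (to (isEdge⇔Adjacent x x) e) refl)

graph-infinite : InfiniteGraph graph
graph-infinite n = n , ≤-refl , refl

graph-computable : ComputableGraph graph
graph-computable = (constC 1 , λ _ → ev-const 1) , isEdge-computable

identity-tracing : IsTracing graph (λ n → n)
identity-tracing = (λ _ → refl) , (λ _ _ i≡j → i≡j) , (λ v _ → v , refl) , (λ i → from (isEdge⇔Adjacent i (suc i)) (adjacent-suc i))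

identity-computable : ComputableFun (λ n → n)
identity-computable = P zero , λ _ → ev-P zero

graph-no-chordless-P4 : NoChordless4Paths graph
graph-no-chordless-P4 a b c d (_ , a≢c , _ , _ , b≢d , _ , ab , bc , cd , ¬ac , ¬bd , _) =
  no-chordless-P4 (to (isEdge⇔Adjacent a b) ab) (to (isEdge⇔Adjacent b c) bc) (to (isEdge⇔Adjacent c d) cd)
    a≢c (nonEdge⇒¬Adjacent a c ¬ac) b≢d (nonEdge⇒¬Adjacent b d ¬bd)

-- Vertices of infinite degree

dominates⇒pos≤ : ∀ {x y u} → Dominates x y → Between x y u → pos x ≤ pos u
dominates⇒pos≤ x▹y u∈ with x▹y _ u∈
... | inj₁ px<pu = <⇒≤ px<pu
... | inj₂ (px≡pu , _) = ≤-reflexive px≡pu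

late-neighbour-dominates : ∀ {w s y} → w < s → pos s ≤ pos w → s ≤ y → Adjacent w y → Dominates y w
late-neighbour-dominates {w} {s} w<s ps≤pw s≤y (_ , inj₂ y▹w) = y▹w
late-neighbour-dominates {w} {s} w<s ps≤pw s≤y (_ , inj₁ w▹y) with w▹y s (inj₁ (<⇒≤ w<s , s≤y))
... | inj₁ pw<ps = ⊥-elim (<⇒≱ pw<ps ps≤pw)
... | inj₂ (_ , s≤w) = ⊥-elim (<⇒≱ w<s s≤w)

late-neighbour-entrant : ∀ {w s t} → w < s → pos s ≤ pos w → s < suc t → Adjacent w (suc t) →
  Σ ℕ λ m → pos (suc t) ≡ suc m × entersAfter t m ≡ true
late-neighbour-entrant {w} {s} {t} w<s ps≤pw s<st adj =
  pos-drop t (dominates⇒pos≤ (late-neighbour-dominates w<s ps≤pw (<⇒≤ s<st) adj)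
                              (inj₂ (≤-trans (<⇒≤ w<s) (s≤s⁻¹ s<st) , n≤1+n t)))

late-neighbours-descend : ∀ {w s y y'} → w < s → pos s ≤ pos w → s < y → y < y' →
  Adjacent w y → Adjacent w y' → pos y' < pos y
late-neighbours-descend {w} {s} {suc t} {suc t'} w<s ps≤pw s<y y<y' adj adj' =
  ≤∧≢⇒< py'≤py distinct
  where
  py'≤py : pos (suc t') ≤ pos (suc t)
  py'≤py = dominates⇒pos≤ {suc t'} {w} {suc t} (late-neighbour-dominates w<s ps≤pw (<⇒≤ (<-trans s<y y<y')) adj')
                          (inj₂ (≤-trans (<⇒≤ w<s) (<⇒≤ s<y) , <⇒≤ y<y'))
  distinct : pos (suc t') ≢ pos (suc t)
  distinct p≡ with late-neighbour-entrant {w} {s} {t} w<s ps≤pw s<y adj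
                 | late-neighbour-entrant {w} {s} {t'} w<s ps≤pw (<-trans s<y y<y') adj'
  ... | m , pm , e | m' , pm' , e' = entersAfter-once (s≤s⁻¹ y<y') e (subst (λ k → entersAfter t' k ≡ true) m'≡m e')
    where
    m'≡m : m' ≡ m
    m'≡m = suc-injective (trans (sym pm') (trans p≡ pm))

IsRecord : ℕ → Set
IsRecord w = ∀ s → w < s → pos w < pos s

infinite-degree⇒record : ∀ w → Infinite (λ y → isEdge w y ≡ true) → IsRecord w
infinite-degree⇒record w inf s w<s with pos w <? pos s
... | yes pw<ps = pw<ps
... | no pw≮ps = ⊥-elim (too-deep (descent (suc (pos w))))
  where
  ps≤pw = ≮⇒≥ pw≮ps
  late-neighbour : ∀ y₀ → Σ ℕ λ y → y₀ ≤ y × Adjacent w y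
  late-neighbour y₀ with inf y₀
  ... | y , y₀≤y , e = y , y₀≤y , to (isEdge⇔Adjacent w y) e
  descent : ∀ k → Σ ℕ λ y → s < y × Adjacent w y × pos y + k ≤ pos w
  descent zero with late-neighbour (suc s)
  ... | y , s<y , adj = y , s<y , adj ,
    subst (_≤ pos w) (sym (+-identityʳ (pos y)))
      (dominates⇒pos≤ {y} {w} {w} (late-neighbour-dominates w<s ps≤pw (<⇒≤ s<y) adj) (inj₂ (≤-refl , <⇒≤ (<-trans w<s s<y))))
  descent (suc k) with descent k
  ... | y , s<y , adj , bound with late-neighbour (suc y)
  ...   | y' , y<y' , adj' = y' , <-trans s<y y<y' , adj' ,
    ≤-trans (≤-reflexive (+-suc (pos y') k)) (≤-trans (+-monoˡ-≤ k (late-neighbours-descend w<s ps≤pw s<y y<y' adj adj')) bound)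
  too-deep : (Σ ℕ λ y → s < y × Adjacent w y × pos y + suc (pos w) ≤ pos w) → ⊥
  too-deep (y , _ , _ , bound) = <-irrefl refl (≤-trans (m≤n+m (suc (pos w)) (pos y)) bound)

record⇒haltsWithin : ∀ w m → IsRecord w → m < pos w → Halting m → haltsWithin w m ≡ true
record⇒haltsWithin w m w-record m<pw h with haltsWithin w m in not-yet
... | true = refl
... | false with haltsWithin-complete m h
...   | s , hs with first-entry w s m not-yet hs
...     | t , w≤t , e = ⊥-elim (<⇒≱ (w-record (suc t) (s≤s w≤t)) (≤-trans (pos-entry-bound t m e m<pt) m<pw))
  where
  m<pt : m < pos t
  m<pt with m≤n⇒m<n∨m≡n w≤t
  ... | inj₁ w<t = <-trans m<pw (w-record t w<t)
  ... | inj₂ refl = m<pw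

-- Deciding 0′ from an infinite set of vertices of infinite degree

first-zero : ∀ (f : ℕ → ℕ) n →
  (Σ ℕ λ y → y < n × f y ≡ 0 × (∀ t → t < y → f t ≢ 0)) ⊎ (∀ t → t < n → f t ≢ 0)
first-zero f zero = inj₂ (λ t ())
first-zero f (suc n) with first-zero f n
... | inj₁ (y , y<n , fy≡0 , before) = inj₁ (y , m<n⇒m<1+n y<n , fy≡0 , before)
... | inj₂ none with f n ≟ 0
...   | yes fn≡0 = inj₁ (n , ≤-refl , fn≡0 , none)
...   | no fn≢0 = inj₂ λ t t<sn → [ none t , (λ { refl → fn≢0 }) ]′ (m≤n⇒m<n∨m≡n (s≤s⁻¹ t<sn))

mu-least-zero : ∀ {X n} {c : Code (suc n)} {xs : Vec ℕ n} (f : ℕ → ℕ) →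
  (∀ z → Eval X c (z ∷ xs) (f z)) → ∀ b → f b ≡ 0 → Σ ℕ λ y → Eval X (mu c) xs y × f y ≡ 0
mu-least-zero {X} {c = c} {xs} f c≗f b fb≡0 with first-zero f (suc b)
... | inj₂ none = ⊥-elim (none b ≤-refl fb≡0)
... | inj₁ (y , _ , fy≡0 , before) =
  y , ev-mu (search-from (subst (Eval X c (y ∷ xs)) fy≡0 (c≗f y)) positive-before y 0 refl) , fy≡0
  where
  positive-before : ∀ t → t < y → Σ ℕ λ k → Eval X c (t ∷ xs) (suc k)
  positive-before t t<y with f t in ft | c≗f t
  ... | zero | _ = ⊥-elim (before t t<y ft)
  ... | suc k | ev = k , ev

¬ₑ-zero-intro : ∀ {n X xs} {a : Expr n} → Holds a X xs → ⟦ ¬ₑ a ⟧ X xs ≡ 0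
¬ₑ-zero-intro h rewrite truth h = refl

certifiedLargeExpr : Code 1 → Expr 2
certifiedLargeExpr e = app (domainCertificateExpr e) (unpair₁ₑ v0 ∷ unpair₂ₑ v0 ∷ []) ∧ₑ v1 ≺ posₑ (unpair₂ₑ v0)

answerExpr : Expr 2
answerExpr = haltsWithinₑ (unpair₂ₑ v0) v1

decider : Code 1 → Code 1
decider e = comp (compile answerExpr) (mu (compile (¬ₑ (certifiedLargeExpr e))) ∷ P zero ∷ [])

decider-output : ∀ X e m w₀ → (Σ ℕ λ z → Truthy (⟦ domainCertificateExpr e ⟧ X (z ∷ w₀ ∷ []))) → m < pos w₀ →
  Σ ℕ λ w → W e X w × m < pos w × Eval X (decider e) (m ∷ []) (χ (haltsWithin w m))
decider-output X e m w₀ (z₀ , certified) m<pw₀ =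
  conclude (mu-least-zero search (λ z → correct (¬ₑ (certifiedLargeExpr e)) X (z ∷ m ∷ [])) ⟨ z₀ , w₀ ⟩ start)
  where
  search : ℕ → ℕ
  search z = ⟦ ¬ₑ (certifiedLargeExpr e) ⟧ X (z ∷ m ∷ [])
  certified′ : Holds (domainCertificateExpr e) X (unpair₁ ⟨ z₀ , w₀ ⟩ ∷ unpair₂ ⟨ z₀ , w₀ ⟩ ∷ [])
  certified′ = subst (Holds (domainCertificateExpr e) X) (sym (cong₂ (λ z w → z ∷ w ∷ []) (unpair₁-pair z₀ w₀) (unpair₂-pair z₀ w₀)))
                     (holds {e = domainCertificateExpr e} {X} {z₀ ∷ w₀ ∷ []} certified)
  start = ¬ₑ-zero-intro {X = X} {xs = ⟨ z₀ , w₀ ⟩ ∷ m ∷ []} {a = certifiedLargeExpr e} (from holds-∧ (from holds-app certified′ , from holds-≺ (subst (λ w → m < pos w) (sym (unpair₂-pair z₀ w₀)) m<pw₀)))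
  conclude : (Σ ℕ λ y → Eval X (mu (compile (¬ₑ (certifiedLargeExpr e)))) (m ∷ []) y × search y ≡ 0) →
    Σ ℕ λ w → W e X w × m < pos w × Eval X (decider e) (m ∷ []) (χ (haltsWithin w m))
  conclude (y , ev-y , search-y≡0) =
    unpair₂ y , domainCertificate-sound X e (unpair₁ y) (unpair₂ y) (truth {e = domainCertificateExpr e} {X} {unpair₁ y ∷ unpair₂ y ∷ []} (to holds-app (proj₁ hit))) , to holds-≺ (proj₂ hit) ,
    ev-comp (ev-∷ ev-y (ev-∷ (ev-P zero) ev-[])) (correct answerExpr X (y ∷ m ∷ []))
    where
    hit : Holds (app (domainCertificateExpr e) (unpair₁ₑ v0 ∷ unpair₂ₑ v0 ∷ [])) X (y ∷ m ∷ []) × Holds (v1 ≺ posₑ (unpair₂ₑ v0)) X (y ∷ m ∷ [])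
    hit = to holds-∧ (¬ₑ-zero {a = certifiedLargeExpr e} search-y≡0)

unbounded-positions : ∀ {A : ℕ → Set} → Infinite A → (∀ w → A w → IsRecord w) →
  ∀ k → Σ ℕ λ w → A w × k ≤ pos w
unbounded-positions inf records zero with inf 0
... | w , _ , w∈A = w , w∈A , z≤n
unbounded-positions inf records (suc k) with unbounded-positions inf records k
... | w , w∈A , k≤pw with inf (suc w)
...   | w' , w<w' , w'∈A = w' , w'∈A , ≤-<-trans k≤pw (records w w∈A w' w<w')

halting-reduces : ∀ X → (Σ (Code 1) λ e → Infinite (W e X) × (∀ m → W e X m → InfDeg graph m)) → Halting ≤T X
halting-reduces X (e , W-infinite , W⊆V∞) = decider e , λ m → answer m (unbounded-positions W-infinite records (suc m))
  where
  records : ∀ w → W e X w → IsRecord w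
  records w w∈W = infinite-degree⇒record w (proj₂ (W⊆V∞ w w∈W))
  decide : ∀ m → (Σ ℕ λ w → W e X w × m < pos w × Eval X (decider e) (m ∷ []) (χ (haltsWithin w m))) →
    (Halting m → Eval X (decider e) (m ∷ []) 1) × (¬ Halting m → Eval X (decider e) (m ∷ []) 0)
  decide m (w , w∈W , m<pw , ev) =
    (λ h → subst (λ b → Eval X (decider e) (m ∷ []) (χ b)) (record⇒haltsWithin w m (records w w∈W) m<pw h) ev) ,
    (λ ¬h → subst (λ b → Eval X (decider e) (m ∷ []) (χ b)) (haltsWithin-false w m ¬h) ev)
  answer : ∀ m → (Σ ℕ λ w₀ → W e X w₀ × suc m ≤ pos w₀) →
    (Halting m → Eval X (decider e) (m ∷ []) 1) × (¬ Halting m → Eval X (decider e) (m ∷ []) 0)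
  answer m (w₀ , w₀∈W , m<pw₀) = decide m (decider-output X e m w₀ (domainCertificate-complete X e w₀ w₀∈W) m<pw₀)

theorem2p1 : Σ Graph λ G →
    InfiniteGraph G × ComputableGraph G ×
    (Σ (ℕ → ℕ) λ T → IsTracing G T × ComputableFun T) ×
    NoChordless4Paths G ×
    (∀ (X : Oracle) →
       (Σ (Code 1) λ e → Infinite (W e X) × (∀ m → W e X m → InfDeg G m)) →
       Halting ≤T X)
theorem2p1 = graph , graph-infinite , graph-computable , ((λ n → n) , identity-tracing , identity-computable) ,
             graph-no-chordless-P4 , halting-reduces
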